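{- Suppose that $h$ is an integer-valued skew supermodular biset function such that $h(\hat{X})>0$ only for $\hat{X}\in\mathcal{C}$. Let $\bar{x}\colon E\to\mathbb{Z}_+$, and let $x$ be an extreme point of $P(h_{\bar{x}},\mathbf{1})$. Let $F=\{e\in E: 0<x(e)<1\}$, $E_1=\{e\in E: x(e)=1\}$, and let $\mathcal{L}$ be an inclusion-wise maximal laminar subfamily of $\{\hat{X}\in\mathcal{V}: x(\delta_F(\hat{X}))=h_{\bar{x}}(\hat{X})-|\delta_{E_1}(\hat{X})|>0\}$ such that the vectors $\eta_{F,\hat{X}}$, $\hat{X}\in\mathcal{L}$, are linearly independent. Then: (i) $|F^+_{\mathcal{L}}(\hat{X})|+|F^-_{\mathcal{L}}(\hat{X})|=2$ for each $\hat{X}\in\mathcal{L}$; (ii) if $e\in F$ is incident to a maximal biset in $\mathcal{L}$, then it is incident to exactly two maximal bisets in $\mathcal{L}$; (iii) $x(e)=1/2$ for each $e\in F$.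
   Context: Let $G=(V,E)$ be an undirected graph, $T\subseteq V$. A biset is an ordered pair $\hat{X}=(X,X^+)$ with $X\subseteq X^+\subseteq V$; $\mathcal{V}$ is the family of bisets with nonempty inner part. For bisets, $\hat{X}\cap\hat{Y}=(X\cap Y,X^+\cap Y^+)$, $\hat{X}\cup\hat{Y}=(X\cup Y,X^+\cup Y^+)$, $\hat{X}\setminus\hat{Y}=(X\setminus Y^+,X^+\setminus Y)$; $\hat{X}\subseteq\hat{Y}$ means $X\subseteq Y$ and $X^+\subseteq Y^+$. For an edge set $F'\subseteq E$, $\delta_{F'}(\hat{X})$ is the set of edges of $F'$ with one end in $X$ and the other in $V\setminus X^+$, and $\delta=\delta_E$; an edge in $\delta(\hat X)$ is said to be incident to $\hat X$. For $t\in T$, $\mathcal{C}(t)=\{\hat{X}\in\mathcal{V}: X\cap T=X^+\cap T=\{t\}\}$ and $\mathcal{C}=\bigcup_{t\in T}\mathcal{C}(t)$. A biset function $h$ is skew supermodular if for all $\hat{X},\hat{Y}$ with $h(\hat{X})>0$, $h(\hat{Y})>0$: $h(\hat{X})+h(\hat{Y})\le h(\hat{X}\cap\hat{Y})+h(\hat{X}\cup\hat{Y})$ or $h(\hat{X})+h(\hat{Y})\le h(\hat{X}\setminus\hat{Y})+h(\hat{Y}\setminus\hat{X})$. For $y\colon E\to\mathbb{Q}_+$, $y(E')=\sum_{e\in E'}y(e)$ and $h_y(\hat{X})=h(\hat{X})-y(\delta(\hat{X}))$. For a biset function $g$ and $u\colon E\to\mathbb{Z}_+$, $P(g,u)=\{x\in\mathbb{Q}_+^E: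 x(\delta(\hat{X}))\ge g(\hat{X})\ \forall\hat{X}\in\mathcal{V},\ x(e)\le u(e)\ \forall e\in E\}$; $\mathbf{1}$ is the all-ones vector on $E$. $\eta_{F,\hat{X}}\in\{0,1\}^F$ is the characteristic vector of $\delta_F(\hat{X})$. Bisets $\hat{X},\hat{Y}$ are strongly disjoint if $X\cap Y^+=\emptyset=X^+\cap Y$; they are noncrossing if strongly disjoint, or $\hat{X}\subseteq\hat{Y}$, or $\hat{Y}\subseteq\hat{X}$; a family is laminar if every pair is noncrossing. In a laminar family $\mathcal{L}$, the parent of a non-maximal $\hat{X}$ is the unique minimal $\hat{Y}\in\mathcal{L}$, $\hat Y\ne\hat X$, with $\hat{X}\subseteq\hat{Y}$, and $\hat{X}$ is then a child of $\hat{Y}$. For $\hat{Y}\in\mathcal{L}$ with set of children $\mathcal{X}$: $F^+_{\mathcal{L}}(\hat{Y})=\delta_F(\hat{Y})\setminus\bigcup_{\hat{X}\in\mathcal{X}}\delta_F(\hat{X})$ and $F^-_{\mathcal{L}}(\hat{Y})=\bigcup_{\hat{X}\in\mathcal{X}}\delta_F(\hat{X})\setminus\delta_F(\hat{Y})$. -}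

module Defs where

open import Data.Bool using (Bool; true; false; _∧_; _∨_; not; if_then_else_; T)
open import Data.Nat as ℕ using (ℕ; zero; suc)
open import Data.Integer as ℤ using (ℤ; +_)
open import Data.Rational as ℚ using (ℚ; 0ℚ; 1ℚ; _/_)
open import Data.Rational.Properties as ℚP using ()
open import Data.Fin using (Fin; zero; suc)
open import Data.Fin.Subset using (Subset; _∩_; _∪_; _─_; ⁅_⁆; _⊆_; Nonempty; Empty; _∈_)
open import Data.Fin.Subset.Properties using (_⊆?_)
open import Data.Vec using (lookup)
open import Data.Product using (_×_; _,_; ∃; proj₁; proj₂)
open import Data.Sum using (_⊎_)
open import Relation.Binary.PropositionalEquality using (_≡_)
open import Relation.Nullary.Decidable using (⌊_⌋)

sumℚ : ∀ {k} → (Fin k → ℚ) → ℚ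
sumℚ {zero}  f = 0ℚ
sumℚ {suc k} f = f zero ℚ.+ sumℚ (λ i → f (suc i))

sumℕ : ∀ {k} → (Fin k → ℕ) → ℕ
sumℕ {zero}  f = 0
sumℕ {suc k} f = f zero ℕ.+ sumℕ (λ i → f (suc i))

countᵇ : ∀ {k} → (Fin k → Bool) → ℕ
countᵇ P = sumℕ (λ i → if P i then 1 else 0)

anyFin : ∀ {k} → (Fin k → Bool) → Bool
anyFin {zero}  P = false
anyFin {suc k} P = P zero ∨ anyFin (λ i → P (suc i))

toℚ : ℤ → ℚ
toℚ z = z / 1

-- Bisets on V = Fin n : pairs (X , X⁺) ; a genuine biset has X ⊆ X⁺

Biset : ℕ → Set
Biset n = Subset n × Subset n

module _ {n : ℕ} where

  IsBiset : Biset n → Set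
  IsBiset (X , X⁺) = X ⊆ X⁺

  InV : Biset n → Set
  InV (X , X⁺) = (X ⊆ X⁺) × Nonempty X

  InC : Subset n → Biset n → Set
  InC Tm (X , X⁺) = InV (X , X⁺) ×
    ∃ λ t → t ∈ Tm × (X ∩ Tm ≡ ⁅ t ⁆) × (X⁺ ∩ Tm ≡ ⁅ t ⁆)

  _⊓_ : Biset n → Biset n → Biset n
  (X , X⁺) ⊓ (Y , Y⁺) = (X ∩ Y , X⁺ ∩ Y⁺)

  _⊔_ : Biset n → Biset n → Biset n
  (X , X⁺) ⊔ (Y , Y⁺) = (X ∪ Y , X⁺ ∪ Y⁺)

  _∖_ : Biset n → Biset n → Biset n
  (X , X⁺) ∖ (Y , Y⁺) = (X ─ Y⁺ , X⁺ ─ Y)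

  _⊑_ : Biset n → Biset n → Set
  (X , X⁺) ⊑ (Y , Y⁺) = (X ⊆ Y) × (X⁺ ⊆ Y⁺)

  StronglyDisjoint : Biset n → Biset n → Set
  StronglyDisjoint (X , X⁺) (Y , Y⁺) = Empty (X ∩ Y⁺) × Empty (X⁺ ∩ Y)

  Noncrossing : Biset n → Biset n → Set
  Noncrossing A B = StronglyDisjoint A B ⊎ (A ⊑ B) ⊎ (B ⊑ A)

  _⊑ᵇ_ : Biset n → Biset n → Bool
  (X , X⁺) ⊑ᵇ (Y , Y⁺) = ⌊ X ⊆? Y ⌋ ∧ ⌊ X⁺ ⊆? Y⁺ ⌋

  _⊏ᵇ_ : Biset n → Biset n → Bool
  A ⊏ᵇ B = (A ⊑ᵇ B) ∧ not (B ⊑ᵇ A)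

  SkewSupermodular : (Biset n → ℤ) → Set
  SkewSupermodular h = ∀ A B → IsBiset A → IsBiset B →
    ℤ.0ℤ ℤ.< h A → ℤ.0ℤ ℤ.< h B →
    (h A ℤ.+ h B ℤ.≤ h (A ⊓ B) ℤ.+ h (A ⊔ B)) ⊎
    (h A ℤ.+ h B ℤ.≤ h (A ∖ B) ℤ.+ h (B ∖ A))

module _ {n m : ℕ} (ends : Fin m → Fin n × Fin n) where

  crosses : Fin m → Biset n → Bool
  crosses e (X , X⁺) =
    (lookup X (proj₁ (ends e)) ∧ not (lookup X⁺ (proj₂ (ends e)))) ∨
    (lookup X (proj₂ (ends e)) ∧ not (lookup X⁺ (proj₁ (ends e))))

  sumδ : (Fin m → Bool) → (Fin m → ℚ) → Biset n → ℚ
  sumδ S y A = sumℚ (λ e → if S e ∧ crosses e A then y e else 0ℚ)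

  sizeδ : (Fin m → Bool) → Biset n → ℕ
  sizeδ S A = countᵇ (λ e → S e ∧ crosses e A)

  allE : Fin m → Bool
  allE _ = true

  hShift : (Biset n → ℤ) → (Fin m → ℕ) → Biset n → ℤ
  hShift h ȳ A = h A ℤ.- + sumℕ (λ e → if crosses e A then ȳ e else 0)

  InP : (Biset n → ℚ) → (Fin m → ℕ) → (Fin m → ℚ) → Set
  InP g u x = (∀ e → 0ℚ ℚ.≤ x e) × (∀ e → x e ℚ.≤ toℚ (+ u e)) ×
              (∀ A → InV A → g A ℚ.≤ sumδ allE x A)

  ExtremePoint : (Biset n → ℚ) → (Fin m → ℕ) → (Fin m → ℚ) → Set
  ExtremePoint g u x = InP g u x ×
    (∀ y z (λ' : ℚ) → InP g u y → InP g u z → 0ℚ ℚ.< λ' → λ' ℚ.< 1ℚ →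
       (∀ e → x e ≡ λ' ℚ.* y e ℚ.+ (1ℚ ℚ.- λ') ℚ.* z e) → ∀ e → y e ≡ z e)

  Fset : (Fin m → ℚ) → Fin m → Bool
  Fset x e = ⌊ 0ℚ ℚP.<? x e ⌋ ∧ ⌊ x e ℚP.<? 1ℚ ⌋

  E1set : (Fin m → ℚ) → Fin m → Bool
  E1set x e = ⌊ x e ℚP.≟ 1ℚ ⌋

  Tight : (Biset n → ℤ) → (Fin m → ℕ) → (Fin m → ℚ) → Biset n → Set
  Tight h x̄ x A = InV A ×
    (sumδ (Fset x) x A ≡ toℚ (hShift h x̄ A) ℚ.- toℚ (+ sizeδ (E1set x) A)) ×
    (0ℚ ℚ.< sumδ (Fset x) x A)

  Laminar : ∀ {k} → (Fin k → Biset n) → Set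
  Laminar L = ∀ i j → Noncrossing (L i) (L j)

  LinIndep : ∀ {k} → (Fin m → Bool) → (Fin k → Biset n) → Set
  LinIndep {k} S L = ∀ (c : Fin k → ℚ) →
    (∀ e → T (S e) → sumℚ (λ i → if crosses e (L i) then c i else 0ℚ) ≡ 0ℚ) →
    ∀ i → c i ≡ 0ℚ

  MaximalLaminarIndep : ∀ {k} → (Biset n → ℤ) → (Fin m → ℕ) → (Fin m → ℚ) →
                        (Fin k → Biset n) → Set
  MaximalLaminarIndep {k} h x̄ x L =
    (∀ i → Tight h x̄ x (L i)) × Laminar L × LinIndep (Fset x) L ×
    (∀ {k'} (L' : Fin k' → Biset n) → (∀ j → Tight h x̄ x (L' j)) →
       Laminar L' → LinIndep (Fset x) L' →
       (∀ i → ∃ λ j → L' j ≡ L i) → ∀ j → ∃ λ i → L i ≡ L' j)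

  module _ {k : ℕ} (L : Fin k → Biset n) where

    isChild : Fin k → Fin k → Bool
    isChild i j = (L i ⊏ᵇ L j) ∧
      not (anyFin (λ l → (L i ⊏ᵇ L l) ∧ (L l ⊏ᵇ L j)))

    isMaximal : Fin k → Bool
    isMaximal i = not (anyFin (λ j → L i ⊏ᵇ L j))

    inChildCut : (Fin m → Bool) → Fin k → Fin m → Bool
    inChildCut S j e = anyFin (λ i → isChild i j ∧ crosses e (L i))

    Fplus : (Fin m → Bool) → Fin k → ℕ
    Fplus S j = countᵇ (λ e → S e ∧ crosses e (L j) ∧ not (inChildCut S j e))

    Fminus : (Fin m → Bool) → Fin k → ℕ
    Fminus S j = countᵇ (λ e → S e ∧ inChildCut S j e ∧ not (crosses e (L j)))

module Submission where

-- Proof plan: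
--  * Uncrossing: a vector d orthogonal to all η_{F,L j} is orthogonal to η_{F,A}
--    for every active biset A (else A could be added to the maximal family L,
--    or uncrossed against a member by skew supermodularity).
--  * Rigidity: such a d supported on F is 0, since x ± ε·d would both be in
--    P(h_x̄, 1); hence |F| ≤ |L|.
--  * Members of L contain one terminal each, so L is a union of chains.  Each
--    F-edge gives a token to L j for each role e ∈ F⁺(L j), e ∈ F⁻(L j): an edge
--    hands out ≤ 2 tokens, a member receives ≥ 2 by parity, as x(δ_F(L j)) ∈ ℤ.
--    So 2|L| ≤ #tokens ≤ 2|F| ≤ 2|L| is tight, giving (i), and (ii) follows by
--    inspecting the two tokens of an edge.  For (iii), parity gives
--    (2x - 1)(δ_F(L j)) = 0 for all j, so 2x - 1 = 0 on F by rigidity.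

open import Data.Nat using (ℕ)

module Rationals where

  open import Defs using (toℚ)
  open import Data.Nat as ℕ using (ℕ; zero; suc)
  open import Data.Bool using (true; false)
  open import Data.Fin using (Fin; zero; suc)
  open import Data.Fin.Subset using (Subset)
  open import Data.Vec using ([]; _∷_)
  open import Data.Integer as ℤ using (ℤ)
  import Data.Integer.Properties as ℤP

  open import Data.Rational as ℚ using (ℚ; 0ℚ; 1ℚ; _+_; _*_; _-_; -_; _≤_; _<_; mkℚ; ∣_∣; _⊓_)
  open import Data.Rational.Properties
  open import Data.Rational.Solver
  open import Data.Rational.Unnormalised as ℚᵘ using (mkℚᵘ; *≡*)
  import Data.Rational.Unnormalised.Properties as ℚᵘP
  open import Data.Nat.Coprimality as C using (Coprime)
  open import Data.Product using (_×_; _,_; ∃)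
  open import Data.Sum using (inj₁; inj₂)
  open import Relation.Binary.PropositionalEquality
  open import Relation.Nullary using (¬_)
  open +-*-Solver

  p≤q⇒0≤q-p : ∀ {p q} → p ≤ q → 0ℚ ≤ q - p
  p≤q⇒0≤q-p {p} p≤q = ≤-trans (≤-reflexive (sym (+-inverseʳ p))) (+-monoˡ-≤ (- p) p≤q)

  0≤q-p⇒p≤q : ∀ {p q} → 0ℚ ≤ q - p → p ≤ q
  0≤q-p⇒p≤q {p} {q} h = ≤-trans (≤-reflexive (sym (+-identityˡ p)))
    (≤-trans (+-monoˡ-≤ p h) (≤-reflexive (solve 2 (λ p q → (q :- p) :+ p := q) refl p q)))

  p<q⇒0<q-p : ∀ {p q} → p < q → 0ℚ < q - p
  p<q⇒0<q-p {p} p<q = <-respˡ-≡ (+-inverseʳ p) (+-monoˡ-< (- p) p<q)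

  0<q-p⇒p<q : ∀ {p q} → 0ℚ < q - p → p < q
  0<q-p⇒p<q {p} {q} h = <-respʳ-≡ (solve 2 (λ p q → (q :- p) :+ p := q) refl p q)
    (<-respˡ-≡ (+-identityˡ p) (+-monoˡ-< p h))

  p-q≡0⇒p≡q : ∀ {p q} → p - q ≡ 0ℚ → p ≡ q
  p-q≡0⇒p≡q {p} {q} e = begin
    p           ≡⟨ solve 2 (λ p q → p := (p :- q) :+ q) refl p q ⟩
    (p - q) + q ≡⟨ cong (_+ q) e ⟩
    0ℚ + q      ≡⟨ +-identityˡ q ⟩
    q           ∎
    where open ≡-Reasoning

  -‿mono-≤ : ∀ {a b c d} → a ≤ c → d ≤ b → a - b ≤ c - d
  -‿mono-≤ a≤c d≤b = +-mono-≤ a≤c (neg-antimono-≤ d≤b)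

  0<1 : 0ℚ < 1ℚ
  0<1 = ℚ.*<* (ℤ.+<+ (ℕ.s≤s ℕ.z≤n))

  pos⊓pos : ∀ {p q} → 0ℚ < p → 0ℚ < q → 0ℚ < p ⊓ q
  pos⊓pos {p} {q} hp hq with ⊓-sel p q
  ... | inj₁ e = <-respʳ-≡ (sym e) hp
  ... | inj₂ e = <-respʳ-≡ (sym e) hq

  p*q≡0⇒p≡0 : ∀ {p q} → p * q ≡ 0ℚ → ¬ q ≡ 0ℚ → p ≡ 0ℚ
  p*q≡0⇒p≡0 {p} {q} e q≢0 = begin
    p              ≡⟨ sym (*-identityʳ p) ⟩
    p * 1ℚ         ≡⟨ cong (p *_) (sym (*-inverseʳ q {{ℚ.≢-nonZero q≢0}})) ⟩
    p * (q * q⁻¹)  ≡⟨ sym (*-assoc p q q⁻¹) ⟩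
    (p * q) * q⁻¹  ≡⟨ cong (_* q⁻¹) e ⟩
    0ℚ * q⁻¹       ≡⟨ *-zeroˡ q⁻¹ ⟩
    0ℚ             ∎
    where
    open ≡-Reasoning
    q⁻¹ = (ℚ.1/ q) {{ℚ.≢-nonZero q≢0}}

  ≤-+-squeeze : ∀ {a b c d} → a ≤ c → b ≤ d → a + b ≡ c + d → a ≡ c
  ≤-+-squeeze {a} {b} {c} {d} a≤c b≤d e = ≤-antisym a≤c (0≤q-p⇒p≤q (≤-trans (p≤q⇒0≤q-p b≤d) (≤-reflexive d-b≡a-c)))
    where
    d-b≡a-c : d - b ≡ a - c
    d-b≡a-c = begin
      d - b             ≡⟨ solve 3 (λ b c d → d :- b := ((c :+ d) :- c) :- b) refl b c d ⟩
      ((c + d) - c) - b ≡⟨ cong (λ z → (z - c) - b) (sym e) ⟩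
      ((a + b) - c) - b ≡⟨ solve 3 (λ a b c → ((a :+ b) :- c) :- b := a :- c) refl a b c ⟩
      a - c             ∎
      where open ≡-Reasoning

  p≤∣p∣ : ∀ q → q ≤ ∣ q ∣
  p≤∣p∣ q with ∣p∣≡p∨∣p∣≡-p q
  ... | inj₁ e = ≤-reflexive (sym e)
  ... | inj₂ e = ≤-trans (≤-reflexive (solve 1 (λ q → q := :- (:- q)) refl q))
                   (≤-trans (≤-reflexive (cong -_ (sym e))) (≤-trans (neg-antimono-≤ (0≤∣p∣ q)) (0≤∣p∣ q)))

  -∣p∣≤p : ∀ q → - ∣ q ∣ ≤ q
  -∣p∣≤p q = ≤-trans (neg-antimono-≤ (≤-trans (p≤∣p∣ (- q)) (≤-reflexive (∣-p∣≡∣p∣ q))))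
    (≤-reflexive (solve 1 (λ q → :- (:- q) := q) refl q))

  ∣q∣≤r⇒a-r≤a+q : ∀ {a q r} → ∣ q ∣ ≤ r → a - r ≤ a + q
  ∣q∣≤r⇒a-r≤a+q {a} {q} h = +-monoʳ-≤ a (≤-trans (neg-antimono-≤ h) (-∣p∣≤p q))

  ∣q∣≤r⇒a+q≤a+r : ∀ {a q r} → ∣ q ∣ ≤ r → a + q ≤ a + r
  ∣q∣≤r⇒a+q≤a+r {a} {q} h = +-monoʳ-≤ a (≤-trans (p≤∣p∣ q) h)

  private
    coprime-to-1 : ∀ (z : ℤ) → Coprime ℤ.∣ z ∣ 1
    coprime-to-1 z = C.sym (C.1-coprimeTo ℤ.∣ z ∣)

    toℚ-mkℚ : ∀ z → toℚ z ≡ mkℚ z 0 (coprime-to-1 z)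
    toℚ-mkℚ (ℤ.+ n)     = normalize-coprime (coprime-to-1 (ℤ.+ n))
    toℚ-mkℚ (ℤ.-[1+ n ]) = cong -_ (normalize-coprime (coprime-to-1 (ℤ.+ suc n)))

    toℚᵘ-toℚ : ∀ z → ℚ.toℚᵘ (toℚ z) ≡ mkℚᵘ z 0
    toℚᵘ-toℚ z rewrite toℚ-mkℚ z = refl

  toℚ-+ : ∀ a b → toℚ (a ℤ.+ b) ≡ toℚ a + toℚ b
  toℚ-+ a b = toℚᵘ-injective (ℚᵘP.≃-trans (ℚᵘP.≃-reflexive (toℚᵘ-toℚ (a ℤ.+ b)))
    (ℚᵘP.≃-trans unnormalised (ℚᵘP.≃-sym (ℚᵘP.≃-trans (toℚᵘ-homo-+ (toℚ a) (toℚ b))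
       (ℚᵘP.≃-reflexive (cong₂ ℚᵘ._+_ (toℚᵘ-toℚ a) (toℚᵘ-toℚ b)))))))
    where
    unnormalised : mkℚᵘ (a ℤ.+ b) 0 ℚᵘ.≃ (mkℚᵘ a 0 ℚᵘ.+ mkℚᵘ b 0)
    unnormalised = *≡* (trans (ℤP.*-identityʳ (a ℤ.+ b)) (sym (trans (ℤP.*-identityʳ _)
                     (cong₂ ℤ._+_ (ℤP.*-identityʳ a) (ℤP.*-identityʳ b)))))

  toℚ-neg : ∀ a → toℚ (ℤ.- a) ≡ - toℚ a
  toℚ-neg a = toℚᵘ-injective (ℚᵘP.≃-trans (ℚᵘP.≃-reflexive (toℚᵘ-toℚ (ℤ.- a)))
    (ℚᵘP.≃-sym (ℚᵘP.≃-trans (toℚᵘ-homo‿- (toℚ a)) (ℚᵘP.≃-reflexive (cong ℚᵘ.-_ (toℚᵘ-toℚ a))))))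

  toℚ-- : ∀ a b → toℚ (a ℤ.- b) ≡ toℚ a - toℚ b
  toℚ-- a b = trans (toℚ-+ a (ℤ.- b)) (cong (toℚ a +_) (toℚ-neg b))

  toℚ-mono-≤ : ∀ {a b} → a ℤ.≤ b → toℚ a ≤ toℚ b
  toℚ-mono-≤ {a} {b} a≤b rewrite toℚ-mkℚ a | toℚ-mkℚ b =
    ℚ.*≤* (subst₂ ℤ._≤_ (sym (ℤP.*-identityʳ a)) (sym (ℤP.*-identityʳ b)) a≤b)

  toℚ-cancel-≤ : ∀ {a b} → toℚ a ≤ toℚ b → a ℤ.≤ b
  toℚ-cancel-≤ {a} {b} h rewrite toℚ-mkℚ a | toℚ-mkℚ b =
    subst₂ ℤ._≤_ (ℤP.*-identityʳ a) (ℤP.*-identityʳ b) (drop-*≤* h)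

  toℚ-cancel-< : ∀ {a b} → toℚ a < toℚ b → a ℤ.< b
  toℚ-cancel-< {a} {b} h rewrite toℚ-mkℚ a | toℚ-mkℚ b =
    subst₂ ℤ._<_ (ℤP.*-identityʳ a) (ℤP.*-identityʳ b) (drop-*<* h)

  toℚ-injective : ∀ {a b} → toℚ a ≡ toℚ b → a ≡ b
  toℚ-injective h = ℤP.≤-antisym (toℚ-cancel-≤ (≤-reflexive h)) (toℚ-cancel-≤ (≤-reflexive (sym h)))

  ℕℚ : ℕ → ℚ
  ℕℚ n = toℚ (ℤ.+ n)

  ℕℚ-+ : ∀ a b → ℕℚ (a ℕ.+ b) ≡ ℕℚ a + ℕℚ b
  ℕℚ-+ a b = toℚ-+ (ℤ.+ a) (ℤ.+ b)

  ℕℚ-mono-≤ : ∀ {a b} → a ℕ.≤ b → ℕℚ a ≤ ℕℚ b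
  ℕℚ-mono-≤ le = toℚ-mono-≤ (ℤ.+≤+ le)

  0≤ℕℚ : ∀ a → 0ℚ ≤ ℕℚ a
  0≤ℕℚ a = ℕℚ-mono-≤ {0} {a} ℕ.z≤n

  IsInt : ℚ → Set
  IsInt q = ∃ λ z → q ≡ toℚ z

  int-0 : IsInt 0ℚ
  int-0 = ℤ.+ 0 , refl

  int-- : ∀ {p q} → IsInt p → IsInt q → IsInt (p - q)
  int-- (a , refl) (b , refl) = a ℤ.- b , sym (toℚ-- a b)

  ∣toℚ∣<⇒bounds : ∀ w s → ∣ toℚ w ∣ < ℕℚ s → ℤ.- ℤ.+ s ℤ.< w × w ℤ.< ℤ.+ s
  ∣toℚ∣<⇒bounds w s h =
    toℚ-cancel-< (<-respˡ-≡ (sym (toℚ-neg (ℤ.+ s))) (<-≤-trans (neg-antimono-< h) (-∣p∣≤p (toℚ w)))) ,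
    toℚ-cancel-< (≤-<-trans (p≤∣p∣ (toℚ w)) h)

  minSubset : ∀ n → (Subset n → ℚ) → ℚ
  minSubset zero    f = f []
  minSubset (suc n) f = minSubset n (λ p → f (true ∷ p)) ⊓ minSubset n (λ p → f (false ∷ p))

  minSubset-≤ : ∀ n f (p : Subset n) → minSubset n f ≤ f p
  minSubset-≤ zero    f []         = ≤-refl
  minSubset-≤ (suc n) f (true ∷ p)  = ≤-trans (p⊓q≤p _ _) (minSubset-≤ n (λ p → f (true ∷ p)) p)
  minSubset-≤ (suc n) f (false ∷ p) = ≤-trans (p⊓q≤q (minSubset n (λ p → f (true ∷ p))) _) (minSubset-≤ n (λ p → f (false ∷ p)) p)

  minSubset-pos : ∀ n f → (∀ p → 0ℚ < f p) → 0ℚ < minSubset n f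
  minSubset-pos zero    f h = h []
  minSubset-pos (suc n) f h = pos⊓pos (minSubset-pos n _ (λ p → h (true ∷ p))) (minSubset-pos n _ (λ p → h (false ∷ p)))

  minFin : ∀ {m} → (Fin m → ℚ) → ℚ
  minFin {zero}  f = 1ℚ
  minFin {suc m} f = f zero ⊓ minFin (λ i → f (suc i))

  minFin-≤ : ∀ {m} f (i : Fin m) → minFin f ≤ f i
  minFin-≤ {suc m} f zero    = p⊓q≤p _ _
  minFin-≤ {suc m} f (suc i) = ≤-trans (p⊓q≤q (f zero) _) (minFin-≤ (λ i → f (suc i)) i)

  minFin-pos : ∀ {m} (f : Fin m → ℚ) → (∀ i → 0ℚ < f i) → 0ℚ < minFin f
  minFin-pos {zero}  f h = 0<1
  minFin-pos {suc m} f h = pos⊓pos (h zero) (minFin-pos (λ i → f (suc i)) (λ i → h (suc i)))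

module Parity where

  open import Data.Nat as ℕ using (ℕ; zero; suc)
  import Data.Nat.Properties as ℕP
  open import Data.Integer as ℤ using (ℤ)
  import Data.Integer.Properties as ℤP
  open import Data.Integer.Solver using (module +-*-Solver)
  open import Data.Product using (_,_; ∃)
  open import Data.Empty using (⊥)
  open import Relation.Binary.PropositionalEquality
  open import Relation.Nullary using (¬_)
  open +-*-Solver

  -- The integer 2z - (p - q); it is the value of Σ (2x - 1) over the p plus
  -- and q minus edges of a member whose net flow x(F⁺) - x(F⁻) is z.
  doubledDeviation : ℤ → ℕ → ℕ → ℤ
  doubledDeviation z p q = (z ℤ.+ z) ℤ.- (ℤ.+ p ℤ.- ℤ.+ q)

  private
    strictly-between-±1 : ∀ w → ℤ.-[1+ 0 ] ℤ.< w → w ℤ.< ℤ.+ 1 → w ≡ ℤ.+ 0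
    strictly-between-±1 (ℤ.+ 0)      _          _                    = refl
    strictly-between-±1 (ℤ.+ suc n)  _          (ℤ.+<+ (ℕ.s≤s ()))
    strictly-between-±1 ℤ.-[1+ n ]   (ℤ.-<- ()) _

    double≢1 : ∀ y → ¬ (y ℤ.+ y ≡ ℤ.+ 1)
    double≢1 (ℤ.+ 0) ()
    double≢1 (ℤ.+ suc n) eq with trans (sym (ℕP.+-suc (suc n) n)) (ℤP.+-injective eq)
    ... | ()
    double≢1 ℤ.-[1+ n ] ()

    double≢-1 : ∀ y → ¬ (y ℤ.+ y ≡ ℤ.-[1+ 0 ])
    double≢-1 (ℤ.+ n) ()
    double≢-1 ℤ.-[1+ n ] ()

    double-strictly-between-±2 : ∀ y → ℤ.-[1+ 1 ] ℤ.< y ℤ.+ y → y ℤ.+ y ℤ.< ℤ.+ 2 → y ≡ ℤ.+ 0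
    double-strictly-between-±2 (ℤ.+ 0) _ _ = refl
    double-strictly-between-±2 (ℤ.+ suc n) _ (ℤ.+<+ lt)
      with subst (ℕ._< 2) (ℕP.+-suc (suc n) n) lt
    ... | ℕ.s≤s (ℕ.s≤s ())
    double-strictly-between-±2 ℤ.-[1+ n ] (ℤ.-<- (ℕ.s≤s ())) _

  -- For p + q = 1 the deviation is odd, so it cannot lie strictly between -1 and 1.
  deviation-odd : ∀ z p q → p ℕ.+ q ≡ 1 →
    ℤ.- ℤ.+ (p ℕ.+ q) ℤ.< doubledDeviation z p q → doubledDeviation z p q ℤ.< ℤ.+ (p ℕ.+ q) → ⊥
  deviation-odd z 1 0 refl l u = double≢1 z (trans
    (solve 1 (λ a → a :+ a := ((a :+ a) :- (con (ℤ.+ 1) :- con (ℤ.+ 0))) :+ con (ℤ.+ 1)) refl z)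
    (cong (ℤ._+ ℤ.+ 1) (strictly-between-±1 (doubledDeviation z 1 0) l u)))
  deviation-odd z 0 1 refl l u = double≢-1 z (trans
    (solve 1 (λ a → a :+ a := ((a :+ a) :- (con (ℤ.+ 0) :- con (ℤ.+ 1))) :+ con ℤ.-[1+ 0 ]) refl z)
    (cong (ℤ._+ ℤ.-[1+ 0 ]) (strictly-between-±1 (doubledDeviation z 0 1) l u)))
  deviation-odd z (suc (suc p)) q        ()
  deviation-odd z (suc zero)    (suc q)  ()
  deviation-odd z zero          zero     ()
  deviation-odd z zero (suc (suc q))     ()

  -- For p + q = 2 the difference p - q is even, so the deviation is a double.
  deviation-as-double : ∀ z p q → p ℕ.+ q ≡ 2 → ∃ λ y → doubledDeviation z p q ≡ y ℤ.+ y
  deviation-as-double z 2 0 refl = z ℤ.- ℤ.+ 1 , solve 1 (λ a → (a :+ a) :- (con (ℤ.+ 2) :- con (ℤ.+ 0))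
                             := (a :- con (ℤ.+ 1)) :+ (a :- con (ℤ.+ 1))) refl z
  deviation-as-double z 1 1 refl = z , solve 1 (λ a → (a :+ a) :- (con (ℤ.+ 1) :- con (ℤ.+ 1)) := a :+ a) refl z
  deviation-as-double z 0 2 refl = z ℤ.+ ℤ.+ 1 , solve 1 (λ a → (a :+ a) :- (con (ℤ.+ 0) :- con (ℤ.+ 2))
                             := (a :+ con (ℤ.+ 1)) :+ (a :+ con (ℤ.+ 1))) refl z
  deviation-as-double z (suc (suc (suc p))) q ()
  deviation-as-double z (suc (suc zero)) (suc q) ()
  deviation-as-double z (suc zero) zero ()
  deviation-as-double z (suc zero) (suc (suc q)) ()
  deviation-as-double z zero zero ()
  deviation-as-double z zero (suc zero) ()
  deviation-as-double z zero (suc (suc (suc q))) ()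

  -- For p + q = 2 the deviation is even, so strictly between -2 and 2 it is 0.
  deviation-even : ∀ z p q → p ℕ.+ q ≡ 2 →
    ℤ.- ℤ.+ (p ℕ.+ q) ℤ.< doubledDeviation z p q → doubledDeviation z p q ℤ.< ℤ.+ (p ℕ.+ q) →
    doubledDeviation z p q ≡ ℤ.+ 0
  deviation-even z p q p+q≡2 l u with deviation-as-double z p q p+q≡2
  ... | y , e rewrite p+q≡2 =
    trans e (cong (λ y → y ℤ.+ y) (double-strictly-between-±2 y (subst (ℤ.-[1+ 1 ] ℤ.<_) e l) (subst (ℤ._< ℤ.+ 2) e u)))

module Sums where

  open import Defs using (sumℚ; sumℕ; countᵇ; anyFin)
  open Rationals
  open import Data.Bool using (Bool; true; false; _∧_; _∨_; not; if_then_else_; T)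
  open import Data.Bool.Properties using (T-∧; T-∨)
  open import Data.Nat as ℕ using (ℕ; zero; suc)
  import Data.Nat.Properties as ℕP
  open import Data.Rational.Solver
  open import Algebra.Bundles using (CommutativeMonoid)
  import Algebra.Properties.CommutativeSemigroup as CommutativeSemigroupProperties
  open import Data.Rational as ℚ using (ℚ; 0ℚ; 1ℚ; _+_; _*_; _-_; -_; _≤_; _<_; ∣_∣)
  open import Data.Rational.Properties
  open import Data.Fin using (Fin; zero; suc)
  import Data.Fin.Properties as FP
  open import Data.Product using (_×_; _,_; ∃; proj₁; proj₂)
  open import Data.Sum using (_⊎_; inj₁; inj₂)
  open import Data.Unit using (tt)
  open import Data.Empty using (⊥-elim)
  open import Function.Bundles using (Equivalence)
  open import Relation.Binary.PropositionalEquality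
  open import Relation.Nullary using (¬_)
  open +-*-Solver

  T∧ : ∀ {a b} → T a → T b → T (a ∧ b)
  T∧ {a} {b} p q = Equivalence.from (T-∧ {a} {b}) (p , q)

  T∧₁ : ∀ {a b} → T (a ∧ b) → T a
  T∧₁ {a} {b} t = proj₁ (Equivalence.to (T-∧ {a} {b}) t)

  T∧₂ : ∀ {a b} → T (a ∧ b) → T b
  T∧₂ {a} {b} t = proj₂ (Equivalence.to (T-∧ {a} {b}) t)

  T∨ : ∀ {a b} → T (a ∨ b) → T a ⊎ T b
  T∨ {a} {b} = Equivalence.to (T-∨ {a} {b})

  T∨₁ : ∀ {a b} → T a → T (a ∨ b)
  T∨₁ {a} {b} t = Equivalence.from (T-∨ {a} {b}) (inj₁ t)

  T∨₂ : ∀ {a b} → T b → T (a ∨ b)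
  T∨₂ {a} {b} t = Equivalence.from (T-∨ {a} {b}) (inj₂ t)

  Tnot : ∀ {a} → ¬ T a → T (not a)
  Tnot {true}  h = h tt
  Tnot {false} h = tt

  Tnot⁻ : ∀ {a} → T (not a) → ¬ T a
  Tnot⁻ {true}  () _
  Tnot⁻ {false} _  ()

  ¬Tnot⇒T : ∀ {a} → ¬ T (not a) → T a
  ¬Tnot⇒T {true}  _ = tt
  ¬Tnot⇒T {false} h = h tt

  T⇒≡true : ∀ {a} → T a → a ≡ true
  T⇒≡true {true} _ = refl

  T-ext : ∀ {a b} → (T a → T b) → (T b → T a) → a ≡ b
  T-ext {true}  {true}  f g = refl
  T-ext {true}  {false} f g = ⊥-elim (f tt)
  T-ext {false} {true}  f g = ⊥-elim (g tt)
  T-ext {false} {false} f g = refl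

  anyFin⇒∃ : ∀ {k} (P : Fin k → Bool) → T (anyFin P) → ∃ λ i → T (P i)
  anyFin⇒∃ {suc k} P t with T∨ {P zero} t
  ... | inj₁ p = zero , p
  ... | inj₂ q with anyFin⇒∃ (λ i → P (suc i)) q
  ...   | i , pi = suc i , pi

  ∃⇒anyFin : ∀ {k} (P : Fin k → Bool) i → T (P i) → T (anyFin P)
  ∃⇒anyFin {suc k} P zero    t = T∨₁ t
  ∃⇒anyFin {suc k} P (suc i) t = T∨₂ {P zero} (∃⇒anyFin (λ i → P (suc i)) i t)

  ind : Bool → ℕ
  ind b = if b then 1 else 0

  ifq : Bool → ℚ → ℚ
  ifq b q = if b then q else 0ℚ

  ind-∨ : ∀ a b → ind (a ∨ b) ℕ.≤ ind a ℕ.+ ind b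
  ind-∨ true  b = ℕ.s≤s ℕ.z≤n
  ind-∨ false b = ℕP.≤-refl

  ind-T : ∀ {b} → T b → ind b ≡ 1
  ind-T {true} _ = refl

  ind-F : ∀ {b} → ¬ T b → ind b ≡ 0
  ind-F {true}  h = ⊥-elim (h _)
  ind-F {false} h = refl

  ind-mono : ∀ a b → (T a → T b) → ind a ℕ.≤ ind b
  ind-mono true  true  f = ℕP.≤-refl
  ind-mono true  false f = ⊥-elim (f _)
  ind-mono false b     f = ℕ.z≤n

  ifq-0 : ∀ b → ifq b 0ℚ ≡ 0ℚ
  ifq-0 true  = refl
  ifq-0 false = refl

  ifq-F : ∀ {b} q → ¬ T b → ifq b q ≡ 0ℚ
  ifq-F {true}  q n = ⊥-elim (n tt)
  ifq-F {false} q n = refl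

  ifq-ind : ∀ b q → ifq b q ≡ ℕℚ (ind b) * q
  ifq-ind true  q = sym (*-identityˡ q)
  ifq-ind false q = sym (*-zeroˡ q)

  ifq-pair : ∀ a b q → ifq a q + ifq b q ≡ ℕℚ (ind a ℕ.+ ind b) * q
  ifq-pair a b q = trans (cong₂ _+_ (ifq-ind a q) (ifq-ind b q))
    (trans (sym (*-distribʳ-+ q (ℕℚ (ind a)) (ℕℚ (ind b)))) (cong (_* q) (sym (ℕℚ-+ (ind a) (ind b)))))

  ifn-pair : ∀ a b v → (if a then v else 0) ℕ.+ (if b then v else 0) ≡ (ind a ℕ.+ ind b) ℕ.* v
  ifn-pair a b v = trans (cong₂ ℕ._+_ (ifn-ind a) (ifn-ind b)) (sym (ℕP.*-distribʳ-+ v (ind a) (ind b)))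
    where
    ifn-ind : ∀ b → (if b then v else 0) ≡ ind b ℕ.* v
    ifn-ind true  = sym (ℕP.+-identityʳ v)
    ifn-ind false = refl

  ∣ifq-ifq∣< : ∀ b₁ b₂ q → (T b₁ ⊎ T b₂ → ∣ q ∣ < 1ℚ) → T b₁ ⊎ T b₂ → ∣ ifq b₁ q - ifq b₂ q ∣ < ifq b₁ 1ℚ + ifq b₂ 1ℚ
  ∣ifq-ifq∣< true true q h t = <-respˡ-≡ (sym (trans (cong ∣_∣ (+-inverseʳ q)) (0≤p⇒∣p∣≡p ≤-refl)))
    (<-≤-trans 0<1 (≤-trans (≤-reflexive (sym (+-identityʳ 1ℚ))) (+-monoʳ-≤ 1ℚ (<⇒≤ 0<1))))
  ∣ifq-ifq∣< true false q h t = <-respˡ-≡ (cong ∣_∣ (solve 1 (λ q → q := q :- con 0ℚ) refl q))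
    (<-respʳ-≡ (sym (+-identityʳ 1ℚ)) (h t))
  ∣ifq-ifq∣< false true q h t = <-respˡ-≡ (trans (sym (∣-p∣≡∣p∣ q)) (cong ∣_∣ (solve 1 (λ q → :- q := con 0ℚ :- q) refl q)))
    (<-respʳ-≡ (sym (+-identityˡ 1ℚ)) (h t))
  ∣ifq-ifq∣< false false q h (inj₁ ())
  ∣ifq-ifq∣< false false q h (inj₂ ())

  ∣ifq-ifq∣≤ : ∀ b₁ b₂ q → (T b₁ ⊎ T b₂ → ∣ q ∣ < 1ℚ) → ∣ ifq b₁ q - ifq b₂ q ∣ ≤ ifq b₁ 1ℚ + ifq b₂ 1ℚ
  ∣ifq-ifq∣≤ true  b₂    q h = <⇒≤ (∣ifq-ifq∣< true b₂ q h (inj₁ tt))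
  ∣ifq-ifq∣≤ false true  q h = <⇒≤ (∣ifq-ifq∣< false true q h (inj₂ tt))
  ∣ifq-ifq∣≤ false false q h = ≤-reflexive (trans (cong ∣_∣ (+-inverseʳ 0ℚ)) (trans (0≤p⇒∣p∣≡p ≤-refl) (sym (+-identityˡ 0ℚ))))

  sumℚ-cong : ∀ {k} {f g : Fin k → ℚ} → (∀ i → f i ≡ g i) → sumℚ f ≡ sumℚ g
  sumℚ-cong {zero}  h = refl
  sumℚ-cong {suc k} h = cong₂ _+_ (h zero) (sumℚ-cong (λ i → h (suc i)))

  sumℚ-0 : ∀ {k} → sumℚ {k} (λ _ → 0ℚ) ≡ 0ℚ
  sumℚ-0 {zero}  = refl
  sumℚ-0 {suc k} = trans (+-identityˡ _) (sumℚ-0 {k})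

  sumℚ-zero : ∀ {k} {f : Fin k → ℚ} → (∀ i → f i ≡ 0ℚ) → sumℚ f ≡ 0ℚ
  sumℚ-zero {k} h = trans (sumℚ-cong h) (sumℚ-0 {k})

  sumℚ-+ : ∀ {k} (f g : Fin k → ℚ) → sumℚ (λ i → f i + g i) ≡ sumℚ f + sumℚ g
  sumℚ-+ {zero}  f g = sym (+-identityˡ 0ℚ)
  sumℚ-+ {suc k} f g rewrite sumℚ-+ (λ i → f (suc i)) (λ i → g (suc i)) =
    CommutativeSemigroupProperties.interchange (CommutativeMonoid.commutativeSemigroup +-0-commutativeMonoid)
      (f zero) (g zero) (sumℚ (λ i → f (suc i))) (sumℚ (λ i → g (suc i)))

  sumℚ-* : ∀ {k} (c : ℚ) (f : Fin k → ℚ) → sumℚ (λ i → c * f i) ≡ c * sumℚ f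
  sumℚ-* {zero}  c f = sym (*-zeroʳ c)
  sumℚ-* {suc k} c f rewrite sumℚ-* c (λ i → f (suc i)) = sym (*-distribˡ-+ c (f zero) _)

  sumℚ-neg : ∀ {k} (f : Fin k → ℚ) → sumℚ (λ i → - f i) ≡ - sumℚ f
  sumℚ-neg {zero}  f = refl
  sumℚ-neg {suc k} f rewrite sumℚ-neg (λ i → f (suc i)) = sym (neg-distrib-+ (f zero) _)

  sumℚ-- : ∀ {k} (f g : Fin k → ℚ) → sumℚ (λ i → f i - g i) ≡ sumℚ f - sumℚ g
  sumℚ-- f g = trans (sumℚ-+ f (λ i → - g i)) (cong (sumℚ f +_) (sumℚ-neg g))

  sumℚ-mono : ∀ {k} {f g : Fin k → ℚ} → (∀ i → f i ≤ g i) → sumℚ f ≤ sumℚ g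
  sumℚ-mono {zero}  h = ≤-refl
  sumℚ-mono {suc k} h = +-mono-≤ (h zero) (sumℚ-mono (λ i → h (suc i)))

  sumℚ-strict : ∀ {k} {f g : Fin k → ℚ} → (∀ i → f i ≤ g i) → ∀ j → f j < g j → sumℚ f < sumℚ g
  sumℚ-strict {suc k} h zero    lt = +-mono-<-≤ lt (sumℚ-mono (λ i → h (suc i)))
  sumℚ-strict {suc k} h (suc j) lt = +-mono-≤-< (h zero) (sumℚ-strict (λ i → h (suc i)) j lt)

  sumℚ-nonneg : ∀ {k} {f : Fin k → ℚ} → (∀ i → 0ℚ ≤ f i) → 0ℚ ≤ sumℚ f
  sumℚ-nonneg {k} h = ≤-trans (≤-reflexive (sym (sumℚ-0 {k}))) (sumℚ-mono h)

  sumℚ-swap : ∀ {k l} (f : Fin k → Fin l → ℚ) →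
    sumℚ (λ i → sumℚ (λ j → f i j)) ≡ sumℚ (λ j → sumℚ (λ i → f i j))
  sumℚ-swap {zero}  {l} f = sym (sumℚ-0 {l})
  sumℚ-swap {suc k} {l} f = trans (cong (sumℚ (λ j → f zero j) +_) (sumℚ-swap (λ i j → f (suc i) j)))
    (sym (sumℚ-+ (λ j → f zero j) (λ j → sumℚ (λ i → f (suc i) j))))

  sumℚ-term : ∀ {k} {f : Fin k → ℚ} → (∀ i → 0ℚ ≤ f i) → ∀ j → f j ≤ sumℚ f
  sumℚ-term {suc k} {f} h zero = ≤-trans (≤-reflexive (sym (+-identityʳ (f zero))))
    (+-monoʳ-≤ (f zero) (sumℚ-nonneg (λ i → h (suc i))))
  sumℚ-term {suc k} {f} h (suc j) = ≤-trans (sumℚ-term (λ i → h (suc i)) j)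
    (≤-trans (≤-reflexive (sym (+-identityˡ _))) (+-monoˡ-≤ _ (h zero)))

  sumℚ-pos : ∀ {k} {f : Fin k → ℚ} → (∀ i → 0ℚ ≤ f i) → ∀ j → 0ℚ < f j → 0ℚ < sumℚ f
  sumℚ-pos h j p = <-≤-trans p (sumℚ-term h j)

  sumℚ-nonneg-zero : ∀ {k} {f : Fin k → ℚ} → (∀ i → 0ℚ ≤ f i) → sumℚ f ≡ 0ℚ → ∀ i → f i ≡ 0ℚ
  sumℚ-nonneg-zero h Σ≡0 i = ≤-antisym (≤-trans (sumℚ-term h i) (≤-reflexive Σ≡0)) (h i)

  sumℚ-abs : ∀ {k} (f : Fin k → ℚ) → ∣ sumℚ f ∣ ≤ sumℚ (λ i → ∣ f i ∣)
  sumℚ-abs {zero}  f = ≤-refl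
  sumℚ-abs {suc k} f = ≤-trans (∣p+q∣≤∣p∣+∣q∣ (f zero) _) (+-monoʳ-≤ ∣ f zero ∣ (sumℚ-abs (λ i → f (suc i))))

  sumℚ-single : ∀ {k} (f : Fin k → ℚ) (j : Fin k) → (∀ i → ¬ i ≡ j → f i ≡ 0ℚ) → sumℚ f ≡ f j
  sumℚ-single {suc k} f zero h =
    trans (cong (f zero +_) (sumℚ-zero (λ i → h (suc i) (λ ())))) (+-identityʳ _)
  sumℚ-single {suc k} f (suc j) h = trans (cong (_+ sumℚ (λ i → f (suc i))) (h zero (λ ())))
    (trans (+-identityˡ _) (sumℚ-single (λ i → f (suc i)) j (λ i ne → h (suc i) (λ e → ne (FP.suc-injective e)))))

  sumℚ-ind : ∀ {l} (P : Fin l → Bool) → sumℚ (λ e → ifq (P e) 1ℚ) ≡ ℕℚ (countᵇ P)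
  sumℚ-ind {zero}  P = refl
  sumℚ-ind {suc l} P = trans (cong (ifq (P zero) 1ℚ +_) (sumℚ-ind (λ i → P (suc i))))
    (trans (cong (_+ ℕℚ (countᵇ (λ i → P (suc i)))) (ifq-1 (P zero))) (sym (ℕℚ-+ (ind (P zero)) _)))
    where ifq-1 : ∀ b → ifq b 1ℚ ≡ ℕℚ (ind b)
          ifq-1 true  = refl
          ifq-1 false = refl

  sumℕ-cong : ∀ {k} {f g : Fin k → ℕ} → (∀ i → f i ≡ g i) → sumℕ f ≡ sumℕ g
  sumℕ-cong {zero}  h = refl
  sumℕ-cong {suc k} h = cong₂ ℕ._+_ (h zero) (sumℕ-cong (λ i → h (suc i)))

  sumℕ-mono : ∀ {k} {f g : Fin k → ℕ} → (∀ i → f i ℕ.≤ g i) → sumℕ f ℕ.≤ sumℕ g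
  sumℕ-mono {zero}  h = ℕ.z≤n
  sumℕ-mono {suc k} h = ℕP.+-mono-≤ (h zero) (sumℕ-mono (λ i → h (suc i)))

  sumℕ-+ : ∀ {k} (f g : Fin k → ℕ) → sumℕ (λ i → f i ℕ.+ g i) ≡ sumℕ f ℕ.+ sumℕ g
  sumℕ-+ {zero}  f g = refl
  sumℕ-+ {suc k} f g rewrite sumℕ-+ (λ i → f (suc i)) (λ i → g (suc i)) =
    CommutativeSemigroupProperties.interchange ℕP.+-commutativeSemigroup
      (f zero) (g zero) (sumℕ (λ i → f (suc i))) (sumℕ (λ i → g (suc i)))

  sumℕ-0 : ∀ {k} → sumℕ {k} (λ _ → 0) ≡ 0
  sumℕ-0 {zero}  = refl
  sumℕ-0 {suc k} = sumℕ-0 {k}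

  sumℕ-swap : ∀ {k l} (f : Fin k → Fin l → ℕ) →
    sumℕ (λ i → sumℕ (λ j → f i j)) ≡ sumℕ (λ j → sumℕ (λ i → f i j))
  sumℕ-swap {zero}  {l} f = sym (sumℕ-0 {l})
  sumℕ-swap {suc k} {l} f = trans (cong (sumℕ (λ j → f zero j) ℕ.+_) (sumℕ-swap (λ i j → f (suc i) j)))
    (sym (sumℕ-+ (λ j → f zero j) (λ j → sumℕ (λ i → f (suc i) j))))

  sumℕ-const : ∀ {k} c → sumℕ {k} (λ _ → c) ≡ k ℕ.* c
  sumℕ-const {zero}  c = refl
  sumℕ-const {suc k} c = cong (c ℕ.+_) (sumℕ-const {k} c)

  sumℕ-squeeze : ∀ {k} {a b : Fin k → ℕ} → (∀ i → b i ℕ.≤ a i) → sumℕ a ℕ.≤ sumℕ b → ∀ i → a i ≡ b i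
  sumℕ-squeeze {suc k} {a} {b} h le zero =
    ℕP.≤-antisym (ℕP.+-cancelʳ-≤ _ _ _ (ℕP.≤-trans le (ℕP.+-monoʳ-≤ (b zero) (sumℕ-mono (λ i → h (suc i))))))
      (h zero)
  sumℕ-squeeze {suc k} {a} {b} h le (suc i) = sumℕ-squeeze (λ i → h (suc i))
    (ℕP.+-cancelˡ-≤ (a zero) _ _ (ℕP.≤-trans le (ℕP.+-monoˡ-≤ _ (h zero)))) i

  count-mono : ∀ {k} {P Q : Fin k → Bool} → (∀ i → T (P i) → T (Q i)) → countᵇ P ℕ.≤ countᵇ Q
  count-mono {P = P} {Q} h = sumℕ-mono (λ i → ind-mono (P i) (Q i) (h i))

  count-term : ∀ {k} (P : Fin k → Bool) j → T (P j) → 1 ℕ.≤ countᵇ P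
  count-term {suc k} P zero t rewrite ind-T {P zero} t = ℕ.s≤s ℕ.z≤n
  count-term {suc k} P (suc j) t = ℕP.≤-trans (count-term (λ i → P (suc i)) j t) (ℕP.m≤n+m _ (ind (P zero)))

  count-strict : ∀ {k} {P Q : Fin k → Bool} → (∀ i → T (P i) → T (Q i)) →
    ∀ j → T (Q j) → ¬ T (P j) → countᵇ P ℕ.< countᵇ Q
  count-strict {suc k} {P} {Q} h zero qj pj rewrite ind-T {Q zero} qj | ind-F {P zero} pj =
    ℕ.s≤s (count-mono (λ i → h (suc i)))
  count-strict {suc k} {P} {Q} h (suc j) qj pj =
    ℕP.+-mono-≤-< (ind-mono (P zero) (Q zero) (h zero)) (count-strict (λ i → h (suc i)) j qj pj)

  count-none : ∀ {k} (P : Fin k → Bool) → (∀ i → ¬ T (P i)) → countᵇ P ≡ 0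
  count-none {zero}  P h = refl
  count-none {suc k} P h rewrite ind-F {P zero} (h zero) = count-none (λ i → P (suc i)) (λ i → h (suc i))

  count-le1 : ∀ {k} (P : Fin k → Bool) → (∀ i j → T (P i) → T (P j) → i ≡ j) → countᵇ P ℕ.≤ 1
  count-le1 {zero} P h = ℕ.z≤n
  count-le1 {suc k} P h with P zero in eq
  ... | true  = ℕP.≤-reflexive (cong suc (count-none (λ i → P (suc i))
                  (λ i t → 0≢suc (h zero (suc i) (subst T (sym eq) _) t))))
    where 0≢suc : ∀ {i : Fin k} → ¬ zero ≡ suc i
          0≢suc ()
  ... | false = count-le1 (λ i → P (suc i)) (λ i j a b → FP.suc-injective (h (suc i) (suc j) a b))

  count-ge2 : ∀ {k} (P : Fin k → Bool) i j → ¬ i ≡ j → T (P i) → T (P j) → 2 ℕ.≤ countᵇ P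
  count-ge2 {suc k} P zero    zero    ne _  _  = ⊥-elim (ne refl)
  count-ge2 {suc k} P zero    (suc j) ne pi pj rewrite ind-T {P zero} pi = ℕ.s≤s (count-term (λ i → P (suc i)) j pj)
  count-ge2 {suc k} P (suc i) zero    ne pi pj rewrite ind-T {P zero} pj = ℕ.s≤s (count-term (λ i → P (suc i)) i pi)
  count-ge2 {suc k} P (suc i) (suc j) ne pi pj =
    ℕP.≤-trans (count-ge2 (λ i → P (suc i)) i j (λ e → ne (cong suc e)) pi pj) (ℕP.m≤n+m _ (ind (P zero)))

  count-pos : ∀ {k} (P : Fin k → Bool) → 1 ℕ.≤ countᵇ P → ∃ λ i → T (P i)
  count-pos {suc k} P h with P zero in eq
  ... | true  = zero , subst T (sym eq) _
  ... | false with count-pos (λ i → P (suc i)) h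
  ...   | i , t = suc i , t

  count-compl : ∀ {m} (P : Fin m → Bool) → countᵇ P ℕ.+ countᵇ (λ e → not (P e)) ≡ m
  count-compl {m} P = trans (sym (sumℕ-+ (λ e → ind (P e)) (λ e → ind (not (P e)))))
    (trans (sumℕ-cong (λ e → ind+ind-not (P e))) (trans (sumℕ-const {m} 1) (ℕP.*-identityʳ m)))
    where ind+ind-not : ∀ b → ind b ℕ.+ ind (not b) ≡ 1
          ind+ind-not true  = refl
          ind+ind-not false = refl

  ≤2-of-4 : ∀ {a b c d} → a ℕ.≤ 1 → b ℕ.≤ 1 → c ℕ.≤ 1 → d ℕ.≤ 1 →
    (b ≡ 0 × d ≡ 0) ⊎ (a ≡ 0 × c ≡ 0) ⊎ (c ≡ 0 × d ≡ 0) → (a ℕ.+ b) ℕ.+ (c ℕ.+ d) ℕ.≤ 2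
  ≤2-of-4 {a} {c = c} a≤1 _ c≤1 _ (inj₁ (refl , refl)) =
    ℕP.+-mono-≤ (subst (ℕ._≤ 1) (sym (ℕP.+-identityʳ a)) a≤1) (subst (ℕ._≤ 1) (sym (ℕP.+-identityʳ c)) c≤1)
  ≤2-of-4 _ b≤1 _ d≤1 (inj₂ (inj₁ (refl , refl))) = ℕP.+-mono-≤ b≤1 d≤1
  ≤2-of-4 {a} {b} a≤1 b≤1 _ _ (inj₂ (inj₂ (refl , refl))) =
    subst (ℕ._≤ 2) (sym (ℕP.+-identityʳ (a ℕ.+ b))) (ℕP.+-mono-≤ a≤1 b≤1)

module LinearAlgebra where

  open import Defs using (sumℚ; countᵇ)
  open Sums using (sumℚ-cong; sumℚ-zero; sumℚ-+; sumℚ-*; sumℚ-single; ifq)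
  open import Data.Bool using (Bool; true; false; T)
  open import Data.Nat as ℕ using (ℕ; zero; suc)
  import Data.Nat.Properties as ℕP
  open import Data.Rational as ℚ using (ℚ; 0ℚ; 1ℚ; _+_; _*_; _-_; -_)
  open import Data.Rational.Properties
  open import Data.Rational.Solver
  open import Data.Fin using (Fin; zero; suc)
  import Data.Fin.Properties as FP
  open import Data.List using (List; []; _∷_; length; map)
  open import Data.List.Properties using (length-map)
  open import Data.List.Relation.Unary.All as All using (All; []; _∷_)
  import Data.List.Relation.Unary.All.Properties as AllP
  open import Data.Product using (_×_; _,_; ∃)
  open import Data.Empty using (⊥-elim)
  open import Relation.Binary.PropositionalEquality
  open import Relation.Nullary using (¬_; Dec; yes; no)
  open import Relation.Nullary.Decidable using (⌊_⌋)
  open +-*-Solver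

  Vecℚ : ℕ → Set
  Vecℚ m = Fin m → ℚ

  dot : ∀ {m} → Vecℚ m → Vecℚ m → ℚ
  dot r d = sumℚ (λ e → r e * d e)

  -- Gaussian elimination on the first coordinate: either every row vanishes
  -- there, or some row p has a nonzero pivot and the others are the rest.
  private
    data Pivot {m} (rows : List (Vecℚ (suc m))) : Set₁ where
      noPivot : All (λ r → r zero ≡ 0ℚ) rows → Pivot rows
      pivot   : (p : Vecℚ (suc m)) (rest : List (Vecℚ (suc m))) → ¬ p zero ≡ 0ℚ →
                length rows ≡ suc (length rest) →
                (∀ {P : Vecℚ (suc m) → Set} → P p → All P rest → All P rows) → Pivot rows

    findPivot : ∀ {m} (rows : List (Vecℚ (suc m))) → Pivot rows
    findPivot [] = noPivot []
    findPivot (r ∷ rows) with r zero ≟ 0ℚ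
    ... | no r₀≢0 = pivot r rows r₀≢0 refl (λ pp pr → pp ∷ pr)
    ... | yes r₀≡0 with findPivot rows
    ...   | noPivot a = noPivot (r₀≡0 ∷ a)
    ...   | pivot p rest p₀≢0 eq f = pivot p (r ∷ rest) p₀≢0 (cong suc eq) (λ { pp (q ∷ pr) → q ∷ f pp pr })

  nontrivial-solution : ∀ m (rows : List (Vecℚ m)) → length rows ℕ.< m →
    ∃ λ (d : Vecℚ m) → (∃ λ e → ¬ d e ≡ 0ℚ) × All (λ r → dot r d ≡ 0ℚ) rows
  nontrivial-solution zero rows ()
  nontrivial-solution (suc m) rows lt with findPivot rows
  ... | noPivot a = d , (zero , 1≢0) , All.map (λ {r} → solves {r}) a
    where
    -- the first unit vector solves every equation with vanishing first coefficient
    d : Vecℚ (suc m)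
    d zero    = 1ℚ
    d (suc i) = 0ℚ
    solves : ∀ {r : Vecℚ (suc m)} → r zero ≡ 0ℚ → dot r d ≡ 0ℚ
    solves {r} z = trans (cong₂ _+_ (trans (cong (_* 1ℚ) z) (*-zeroˡ 1ℚ))
                            (sumℚ-zero (λ i → *-zeroʳ (r (suc i)))))
                         (+-identityˡ 0ℚ)
  ... | pivot p rest p₀≢0 eq f = solution (nontrivial-solution m (map reduce rest) shorter)
    where
    p₀⁻¹ : ℚ
    p₀⁻¹ = (ℚ.1/ p zero) {{ℚ.≢-nonZero p₀≢0}}
    -- eliminate the first coordinate of r using the pivot row
    reduce : Vecℚ (suc m) → Vecℚ m
    reduce r i = r (suc i) - (r zero * p₀⁻¹) * p (suc i)
    shorter : length (map reduce rest) ℕ.< m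
    shorter = subst (ℕ._< m) (sym (length-map reduce rest)) (ℕP.≤-pred (subst (ℕ._< suc m) eq lt))
    -- extend a solution d' of the reduced system by the value forced by the pivot row
    solution : (∃ λ (d' : Vecℚ m) → (∃ λ e → ¬ d' e ≡ 0ℚ) × All (λ r → dot r d' ≡ 0ℚ) (map reduce rest)) →
               ∃ λ (d : Vecℚ (suc m)) → (∃ λ e → ¬ d e ≡ 0ℚ) × All (λ r → dot r d ≡ 0ℚ) rows
    solution (d' , (e , d'e≢0) , reduced) = d , (suc e , d'e≢0) , f pivot-solved (lift rest reduced)
      where
      S : ℚ
      S = sumℚ (λ i → p (suc i) * d' i)
      d : Vecℚ (suc m)
      d zero    = - (S * p₀⁻¹)
      d (suc i) = d' i
      open ≡-Reasoning
      pivot-solved : dot p d ≡ 0ℚ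
      pivot-solved = begin
        p zero * - (S * p₀⁻¹) + S  ≡⟨ solve 3 (λ a s i → a :* (:- (s :* i)) :+ s := s :* (con 1ℚ :- a :* i)) refl (p zero) S p₀⁻¹ ⟩
        S * (1ℚ - p zero * p₀⁻¹)  ≡⟨ cong (λ z → S * (1ℚ - z)) (*-inverseʳ (p zero) {{ℚ.≢-nonZero p₀≢0}}) ⟩
        S * (1ℚ - 1ℚ)             ≡⟨ *-zeroʳ S ⟩
        0ℚ                        ∎
      -- r is the reduced row plus a multiple of the pivot row
      lift-row : ∀ r → dot (reduce r) d' ≡ 0ℚ → dot r d ≡ 0ℚ
      lift-row r h = begin
        r zero * d zero + sumℚ (λ i → r (suc i) * d' i)
          ≡⟨ cong (r zero * d zero +_) (sumℚ-cong (λ i → solve 4 (λ a c b x → a :* x := (a :- c :* b) :* x :+ c :* (b :* x)) refl (r (suc i)) c (p (suc i)) (d' i))) ⟩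
        r zero * d zero + sumℚ (λ i → reduce r i * d' i + c * (p (suc i) * d' i))
          ≡⟨ cong (r zero * d zero +_) (trans (sumℚ-+ (λ i → reduce r i * d' i) (λ i → c * (p (suc i) * d' i))) (cong₂ _+_ h (sumℚ-* c (λ i → p (suc i) * d' i)))) ⟩
        r zero * d zero + (0ℚ + c * S)
          ≡⟨ solve 3 (λ a i s → a :* (:- (s :* i)) :+ (con 0ℚ :+ (a :* i) :* s) := con 0ℚ) refl (r zero) p₀⁻¹ S ⟩
        0ℚ ∎
        where c = r zero * p₀⁻¹
      lift : ∀ rs → All (λ r → dot r d' ≡ 0ℚ) (map reduce rs) → All (λ r → dot r d ≡ 0ℚ) rs
      lift []       []       = []
      lift (r ∷ rs) (h ∷ hs) = lift-row r h ∷ lift rs hs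

  listWhere : ∀ {m} → (Fin m → Bool) → List (Fin m)
  listWhere {zero}  P = []
  listWhere {suc m} P with P zero
  ... | true  = zero ∷ map suc (listWhere (λ i → P (suc i)))
  ... | false = map suc (listWhere (λ i → P (suc i)))

  listWhere-length : ∀ {m} (P : Fin m → Bool) → length (listWhere P) ≡ countᵇ P
  listWhere-length {zero}  P = refl
  listWhere-length {suc m} P with P zero
  ... | true  = cong suc rest
    where rest = trans (length-map suc (listWhere (λ i → P (suc i)))) (listWhere-length (λ i → P (suc i)))
  ... | false = trans (length-map suc (listWhere (λ i → P (suc i)))) (listWhere-length (λ i → P (suc i)))

  listWhere-all : ∀ {m} {Q : Fin m → Set} (P : Fin m → Bool) → All Q (listWhere P) → ∀ e → T (P e) → Q e
  listWhere-all {suc m} {Q} P a e t with P zero in eq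
  listWhere-all {suc m} {Q} P (q ∷ a) zero    t | true  = q
  listWhere-all {suc m} {Q} P (q ∷ a) (suc i) t | true  = listWhere-all {Q = λ i → Q (suc i)} (λ i → P (suc i)) (AllP.map⁻ a) i t
  listWhere-all {suc m} {Q} P a       zero    t | false = ⊥-elim (subst T eq t)
  listWhere-all {suc m} {Q} P a       (suc i) t | false = listWhere-all {Q = λ i → Q (suc i)} (λ i → P (suc i)) (AllP.map⁻ a) i t

  unit : ∀ {m} → Fin m → Vecℚ m
  unit e e' = ifq ⌊ e FP.≟ e' ⌋ 1ℚ

  dot-unit : ∀ {m} (e : Fin m) (d : Vecℚ m) → dot (unit e) d ≡ d e
  dot-unit e d = trans (sumℚ-single (λ e' → unit e e' * d e') e (λ e' ne → off e' (e FP.≟ e') (λ q → ne (sym q))))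
                       (on (e FP.≟ e))
    where
    off : ∀ e' (q : Dec (e ≡ e')) → ¬ e ≡ e' → ifq ⌊ q ⌋ 1ℚ * d e' ≡ 0ℚ
    off e' (yes p) ne = ⊥-elim (ne p)
    off e' (no _)  ne = *-zeroˡ (d e')
    on : (q : Dec (e ≡ e)) → ifq ⌊ q ⌋ 1ℚ * d e ≡ d e
    on (yes _) = *-identityˡ (d e)
    on (no ne) = ⊥-elim (ne refl)

module BisetCalculus where

  open import Defs
  open Sums using (T∧; T∧₁; T∧₂; T∨; T∨₁; T∨₂; Tnot; Tnot⁻; T⇒≡true; T-ext; ind)
  open import Data.Bool using (Bool; true; false; _∧_; _∨_; not; T)
  open import Data.Nat as ℕ using (ℕ; zero; suc; _≤ᵇ_)
  import Data.Nat.Properties as ℕP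
  open import Data.Fin using (Fin; zero; suc)
  open import Data.Fin.Subset using (Subset; _∩_; _∪_; _─_; _⊆_; Empty; _∈_; ∣_∣)
  open import Data.Fin.Subset.Properties using (_⊆?_; nonempty?; p⊆q⇒∣p∣≤∣q∣; ∣p∣≤n)
  open import Data.Vec using (Vec; []; _∷_; lookup)
  open import Data.Vec.Properties using ([]=⇒lookup; lookup⇒[]=; lookup-zipWith)
  open import Data.Product using (_×_; _,_; proj₁; proj₂)
  open import Data.Sum using (_⊎_; inj₁; inj₂; [_,_])
  open import Data.Empty using (⊥; ⊥-elim)
  open import Data.Unit using (tt)
  open import Relation.Binary.PropositionalEquality using (_≡_; refl; sym; cong₂; subst)
  open import Relation.Nullary using (¬_; Dec; yes; no)
  open import Relation.Nullary.Decidable using (⌊_⌋; _×-dec_; _⊎-dec_; ¬?; toWitness; fromWitness)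

  module _ {n : ℕ} where

    ∈→T : ∀ {X : Subset n} {u} → u ∈ X → T (lookup X u)
    ∈→T h rewrite []=⇒lookup h = tt

    T→∈ : ∀ {X : Subset n} {u} → T (lookup X u) → u ∈ X
    T→∈ {X} {u} t = lookup⇒[]= u X (T⇒≡true t)

    ⊆→ : ∀ {X Y : Subset n} → X ⊆ Y → ∀ u → T (lookup X u) → T (lookup Y u)
    ⊆→ s u t = ∈→T (s (T→∈ t))

    →⊆ : ∀ {X Y : Subset n} → (∀ u → T (lookup X u) → T (lookup Y u)) → X ⊆ Y
    →⊆ f {u} h = T→∈ (f u (∈→T h))

    lk∩ : ∀ (X Y : Subset n) u → lookup (X ∩ Y) u ≡ lookup X u ∧ lookup Y u
    lk∩ X Y u = lookup-zipWith _∧_ u X Y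

    lk∪ : ∀ (X Y : Subset n) u → lookup (X ∪ Y) u ≡ lookup X u ∨ lookup Y u
    lk∪ X Y u = lookup-zipWith _∨_ u X Y

  lk─ : ∀ {n} (X Y : Subset n) u → lookup (X ─ Y) u ≡ lookup X u ∧ not (lookup Y u)
  lk─ (x ∷ X)     (true ∷ Y)  zero    with x
  ... | true  = refl
  ... | false = refl
  lk─ (x ∷ X)     (false ∷ Y) zero    with x
  ... | true  = refl
  ... | false = refl
  lk─ (x ∷ X)     (y ∷ Y)     (suc u) = lk─ X Y u

  Subset-ext : ∀ {n} (X Y : Subset n) → (∀ u → T (lookup X u) → T (lookup Y u)) →
               (∀ u → T (lookup Y u) → T (lookup X u)) → X ≡ Y
  Subset-ext []      []      f g = refl
  Subset-ext (a ∷ X) (b ∷ Y) f g = cong₂ _∷_ (T-ext (f zero) (g zero)) (Subset-ext X Y (λ u → f (suc u)) (λ u → g (suc u)))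

  record I {n} (A : Biset n) (u : Fin n) : Set where
    constructor mkI
    field unI : T (lookup (proj₁ A) u)
  open I public

  record O {n} (A : Biset n) (u : Fin n) : Set where
    constructor mkO
    field unO : T (lookup (proj₂ A) u)
  open O public

  module _ {n : ℕ} where

    Sub : Biset n → Biset n → Set
    Sub A B = (∀ u → I A u → I B u) × (∀ u → O A u → O B u)

    SDisj : Biset n → Biset n → Set
    SDisj A B = (∀ u → I A u → O B u → ⊥) × (∀ u → O A u → I B u → ⊥)

    NCross : Biset n → Biset n → Set
    NCross A B = SDisj A B ⊎ Sub A B ⊎ Sub B A

    ⊑→Sub : ∀ {A B} → A ⊑ B → Sub A B
    ⊑→Sub (s , s⁺) = (λ u h → mkI (⊆→ s u (unI h))) , (λ u h → mkO (⊆→ s⁺ u (unO h)))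

    Sub→⊑ : ∀ {A B} → Sub A B → A ⊑ B
    Sub→⊑ (s , s⁺) = →⊆ (λ u h → unI (s u (mkI h))) , →⊆ (λ u h → unO (s⁺ u (mkO h)))

    private
      Empty∩→ : ∀ {X Y : Subset n} → Empty (X ∩ Y) → ∀ u → T (lookup X u) → T (lookup Y u) → ⊥
      Empty∩→ {X} {Y} e u a b = e (u , T→∈ (subst T (sym (lk∩ X Y u)) (T∧ a b)))

      →Empty∩ : ∀ {X Y : Subset n} → (∀ u → T (lookup X u) → T (lookup Y u) → ⊥) → Empty (X ∩ Y)
      →Empty∩ {X} {Y} f (u , h) with subst T (lk∩ X Y u) (∈→T h)
      ... | t = f u (T∧₁ t) (T∧₂ t)

      SD→SDisj : ∀ {A B} → StronglyDisjoint A B → SDisj A B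
      SD→SDisj (e1 , e2) = (λ u a b → Empty∩→ e1 u (unI a) (unO b)) , (λ u a b → Empty∩→ e2 u (unO a) (unI b))

      SDisj→SD : ∀ {A B} → SDisj A B → StronglyDisjoint A B
      SDisj→SD (f1 , f2) = →Empty∩ (λ u a b → f1 u (mkI a) (mkO b)) , →Empty∩ (λ u a b → f2 u (mkO a) (mkI b))

    NC→NCross : ∀ {A B} → Noncrossing A B → NCross A B
    NC→NCross (inj₁ s)        = inj₁ (SD→SDisj s)
    NC→NCross (inj₂ (inj₁ s)) = inj₂ (inj₁ (⊑→Sub s))
    NC→NCross (inj₂ (inj₂ s)) = inj₂ (inj₂ (⊑→Sub s))

    NCross→NC : ∀ {A B} → NCross A B → Noncrossing A B
    NCross→NC (inj₁ s)        = inj₁ (SDisj→SD s)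
    NCross→NC (inj₂ (inj₁ s)) = inj₂ (inj₁ (Sub→⊑ s))
    NCross→NC (inj₂ (inj₂ s)) = inj₂ (inj₂ (Sub→⊑ s))

    SDisj-sym : ∀ {A B} → SDisj A B → SDisj B A
    SDisj-sym (f , g) = (λ u a b → g u b a) , (λ u a b → f u b a)

    NCross-sym : ∀ {A B} → NCross A B → NCross B A
    NCross-sym (inj₁ s)        = inj₁ (SDisj-sym s)
    NCross-sym (inj₂ (inj₁ s)) = inj₂ (inj₂ s)
    NCross-sym (inj₂ (inj₂ s)) = inj₂ (inj₁ s)

    Sub-refl : ∀ {A} → Sub A A
    Sub-refl = (λ _ h → h) , (λ _ h → h)

    Sub-trans : ∀ {A B C} → Sub A B → Sub B C → Sub A C
    Sub-trans (f , g) (f' , g') = (λ u h → f' u (f u h)) , (λ u h → g' u (g u h))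

    Sub-antisym : ∀ {A B : Biset n} → Sub A B → Sub B A → A ≡ B
    Sub-antisym {A = X , X⁺} {B = Y , Y⁺} (f , g) (f' , g') =
      cong₂ _,_ (Subset-ext X Y (λ u t → unI (f u (mkI t))) (λ u t → unI (f' u (mkI t))))
                (Subset-ext X⁺ Y⁺ (λ u t → unO (g u (mkO t))) (λ u t → unO (g' u (mkO t))))

    I⇒O : ∀ {A : Biset n} → IsBiset A → ∀ {u} → I A u → O A u
    I⇒O bA {u} h = mkO (⊆→ bA u (unI h))

    shared-inner⇒¬SDisj : ∀ {A B : Biset n} → IsBiset B → ∀ u → I A u → I B u → ¬ SDisj A B
    shared-inner⇒¬SDisj bB u a b (f , g) = f u a (I⇒O bB b)

    I⊓ : ∀ {A B : Biset n} {u} → I (A ⊓ B) u → I A u × I B u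
    I⊓ {A} {B} {u} (mkI t) = let t' = subst T (lk∩ (proj₁ A) (proj₁ B) u) t in mkI (T∧₁ t') , mkI (T∧₂ t')
    ⊓I : ∀ {A B : Biset n} {u} → I A u → I B u → I (A ⊓ B) u
    ⊓I {A} {B} {u} (mkI a) (mkI b) = mkI (subst T (sym (lk∩ (proj₁ A) (proj₁ B) u)) (T∧ a b))
    O⊓ : ∀ {A B : Biset n} {u} → O (A ⊓ B) u → O A u × O B u
    O⊓ {A} {B} {u} (mkO t) = let t' = subst T (lk∩ (proj₂ A) (proj₂ B) u) t in mkO (T∧₁ t') , mkO (T∧₂ t')
    ⊓O : ∀ {A B : Biset n} {u} → O A u → O B u → O (A ⊓ B) u
    ⊓O {A} {B} {u} (mkO a) (mkO b) = mkO (subst T (sym (lk∩ (proj₂ A) (proj₂ B) u)) (T∧ a b))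

    I⊔ : ∀ {A B : Biset n} {u} → I (A ⊔ B) u → I A u ⊎ I B u
    I⊔ {A} {B} {u} (mkI t) with T∨ (subst T (lk∪ (proj₁ A) (proj₁ B) u) t)
    ... | inj₁ a = inj₁ (mkI a)
    ... | inj₂ b = inj₂ (mkI b)
    ⊔I₁ : ∀ {A B : Biset n} {u} → I A u → I (A ⊔ B) u
    ⊔I₁ {A} {B} {u} (mkI a) = mkI (subst T (sym (lk∪ (proj₁ A) (proj₁ B) u)) (T∨₁ a))
    ⊔I₂ : ∀ {A B : Biset n} {u} → I B u → I (A ⊔ B) u
    ⊔I₂ {A} {B} {u} (mkI b) = mkI (subst T (sym (lk∪ (proj₁ A) (proj₁ B) u)) (T∨₂ {lookup (proj₁ A) u} b))
    O⊔ : ∀ {A B : Biset n} {u} → O (A ⊔ B) u → O A u ⊎ O B u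
    O⊔ {A} {B} {u} (mkO t) with T∨ (subst T (lk∪ (proj₂ A) (proj₂ B) u) t)
    ... | inj₁ a = inj₁ (mkO a)
    ... | inj₂ b = inj₂ (mkO b)
    ⊔O₁ : ∀ {A B : Biset n} {u} → O A u → O (A ⊔ B) u
    ⊔O₁ {A} {B} {u} (mkO a) = mkO (subst T (sym (lk∪ (proj₂ A) (proj₂ B) u)) (T∨₁ a))
    ⊔O₂ : ∀ {A B : Biset n} {u} → O B u → O (A ⊔ B) u
    ⊔O₂ {A} {B} {u} (mkO b) = mkO (subst T (sym (lk∪ (proj₂ A) (proj₂ B) u)) (T∨₂ {lookup (proj₂ A) u} b))

    I∖ : ∀ {A B : Biset n} {u} → I (A ∖ B) u → I A u × ¬ O B u
    I∖ {A} {B} {u} (mkI t) = let t' = subst T (lk─ (proj₁ A) (proj₂ B) u) t in mkI (T∧₁ t') , (λ o → Tnot⁻ (T∧₂ t') (unO o))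
    ∖I : ∀ {A B : Biset n} {u} → I A u → ¬ O B u → I (A ∖ B) u
    ∖I {A} {B} {u} (mkI a) b = mkI (subst T (sym (lk─ (proj₁ A) (proj₂ B) u)) (T∧ a (Tnot (λ t → b (mkO t)))))
    O∖ : ∀ {A B : Biset n} {u} → O (A ∖ B) u → O A u × ¬ I B u
    O∖ {A} {B} {u} (mkO t) = let t' = subst T (lk─ (proj₂ A) (proj₁ B) u) t in mkO (T∧₁ t') , (λ o → Tnot⁻ (T∧₂ t') (unI o))
    ∖O : ∀ {A B : Biset n} {u} → O A u → ¬ I B u → O (A ∖ B) u
    ∖O {A} {B} {u} (mkO a) b = mkO (subst T (sym (lk─ (proj₂ A) (proj₁ B) u)) (T∧ a (Tnot (λ t → b (mkI t)))))

    IsBiset-⊓ : ∀ {A B : Biset n} → IsBiset A → IsBiset B → IsBiset (A ⊓ B)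
    IsBiset-⊓ {A} {B} bA bB = →⊆ (λ u t → let (a , b) = I⊓ {A = A} {B = B} (mkI t) in unO (⊓O (I⇒O bA a) (I⇒O bB b)))

    IsBiset-⊔ : ∀ {A B : Biset n} → IsBiset A → IsBiset B → IsBiset (A ⊔ B)
    IsBiset-⊔ {A} {B} bA bB = →⊆ (λ u t → unO (outer u (I⊔ {A = A} {B = B} (mkI t))))
      where outer : ∀ u → I A u ⊎ I B u → O (A ⊔ B) u
            outer u (inj₁ a) = ⊔O₁ {A = A} {B = B} (I⇒O bA a)
            outer u (inj₂ b) = ⊔O₂ {A = A} {B = B} (I⇒O bB b)

    IsBiset-∖ : ∀ {A B : Biset n} → IsBiset A → IsBiset B → IsBiset (A ∖ B)
    IsBiset-∖ {A} {B} bA bB = →⊆ (λ u t → let (a , ¬b) = I∖ {A = A} {B = B} (mkI t) in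
                                           unO (∖O {A = A} {B = B} (I⇒O bA a) (λ b → ¬b (I⇒O bB b))))

    SDisj-mono : ∀ {C A A'} → Sub A' A → SDisj C A → SDisj C A'
    SDisj-mono (f , g) (s1 , s2) = (λ u c a → s1 u c (g u a)) , (λ u c a → s2 u c (f u a))

    private
      ⊓sub₁ : ∀ {A B} → Sub (A ⊓ B) A
      ⊓sub₁ = (λ u h → proj₁ (I⊓ h)) , (λ u h → proj₁ (O⊓ h))
      ⊓sub₂ : ∀ {A B} → Sub (A ⊓ B) B
      ⊓sub₂ = (λ u h → proj₂ (I⊓ h)) , (λ u h → proj₂ (O⊓ h))
      ⊔sub₁ : ∀ {A B} → Sub A (A ⊔ B)
      ⊔sub₁ = (λ u h → ⊔I₁ h) , (λ u h → ⊔O₁ h)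
      ⊔sub₂ : ∀ {A B} → Sub B (A ⊔ B)
      ⊔sub₂ = (λ u h → ⊔I₂ h) , (λ u h → ⊔O₂ h)
      ∖sub : ∀ {A B} → Sub (A ∖ B) A
      ∖sub = (λ u h → proj₁ (I∖ h)) , (λ u h → proj₁ (O∖ h))

    NCross-⊓ : ∀ {C A B} → NCross C A → NCross C B → NCross C (A ⊓ B)
    NCross-⊓ (inj₁ s) _ = inj₁ (SDisj-mono ⊓sub₁ s)
    NCross-⊓ _ (inj₁ s) = inj₁ (SDisj-mono ⊓sub₂ s)
    NCross-⊓ (inj₂ (inj₂ s)) _ = inj₂ (inj₂ (Sub-trans ⊓sub₁ s))
    NCross-⊓ _ (inj₂ (inj₂ s)) = inj₂ (inj₂ (Sub-trans ⊓sub₂ s))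
    NCross-⊓ (inj₂ (inj₁ (f , g))) (inj₂ (inj₁ (f' , g'))) =
      inj₂ (inj₁ ((λ u c → ⊓I (f u c) (f' u c)) , (λ u c → ⊓O (g u c) (g' u c))))

    NCross-⊔ : ∀ {C A B} → ¬ SDisj A B → NCross C A → NCross C B → NCross C (A ⊔ B)
    NCross-⊔ nsd (inj₂ (inj₁ s)) _ = inj₂ (inj₁ (Sub-trans s ⊔sub₁))
    NCross-⊔ nsd _ (inj₂ (inj₁ s)) = inj₂ (inj₁ (Sub-trans s ⊔sub₂))
    NCross-⊔ nsd (inj₁ (s1 , s2)) (inj₁ (t1 , t2)) = inj₁
      ((λ u c ab → [ s1 u c , t1 u c ] (O⊔ ab)) , (λ u c ab → [ s2 u c , t2 u c ] (I⊔ ab)))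
    NCross-⊔ nsd (inj₂ (inj₂ (f , g))) (inj₂ (inj₂ (f' , g'))) =
      inj₂ (inj₂ ((λ u ab → [ f u , f' u ] (I⊔ ab)) , (λ u ab → [ g u , g' u ] (O⊔ ab))))
    NCross-⊔ nsd (inj₁ s) (inj₂ (inj₂ bc)) = ⊥-elim (nsd (SDisj-mono bc (SDisj-sym s)))
    NCross-⊔ nsd (inj₂ (inj₂ ac)) (inj₁ s) = ⊥-elim (nsd (SDisj-sym (SDisj-mono ac (SDisj-sym s))))

    NCross-∖ : ∀ {C A B} → ¬ Sub B A → NCross C A → NCross C B → NCross C (A ∖ B)
    NCross-∖ nba (inj₁ s) _ = inj₁ (SDisj-mono ∖sub s)
    NCross-∖ nba (inj₂ (inj₂ s)) _ = inj₂ (inj₂ (Sub-trans ∖sub s))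
    NCross-∖ nba (inj₂ (inj₁ (f , g))) (inj₁ (s1 , s2)) =
      inj₂ (inj₁ ((λ u c → ∖I (f u c) (s1 u c)) , (λ u c → ∖O (g u c) (s2 u c))))
    NCross-∖ nba (inj₂ (inj₁ (f , g))) (inj₂ (inj₁ (f' , g'))) =
      inj₁ ((λ u c ab → proj₂ (O∖ ab) (f' u c)) , (λ u c ab → proj₂ (I∖ ab) (g' u c)))
    NCross-∖ nba (inj₂ (inj₁ ca)) (inj₂ (inj₂ bc)) = ⊥-elim (nba (Sub-trans bc ca))

    NCross-self-⊓ : ∀ {A B} → NCross B (A ⊓ B)
    NCross-self-⊓ = inj₂ (inj₂ ⊓sub₂)
    NCross-self-⊔ : ∀ {A B} → NCross B (A ⊔ B)
    NCross-self-⊔ = inj₂ (inj₁ ⊔sub₂)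
    NCross-self-∖₁ : ∀ {A B} → NCross B (A ∖ B)
    NCross-self-∖₁ = inj₁ ((λ u b ab → proj₂ (O∖ ab) b) , (λ u b ab → proj₂ (I∖ ab) b))
    NCross-self-∖₂ : ∀ {A B} → NCross B (B ∖ A)
    NCross-self-∖₂ = inj₂ (inj₂ ∖sub)

    ⊑? : (A B : Biset n) → Dec (A ⊑ B)
    ⊑? A B = (proj₁ A ⊆? proj₁ B) ×-dec (proj₂ A ⊆? proj₂ B)

    Sub? : (A B : Biset n) → Dec (Sub A B)
    Sub? A B with ⊑? A B
    ... | yes p = yes (⊑→Sub p)
    ... | no np = no (λ s → np (Sub→⊑ s))

    NC? : (A B : Biset n) → Dec (Noncrossing A B)
    NC? A B = (Empty? (proj₁ A ∩ proj₂ B) ×-dec Empty? (proj₂ A ∩ proj₁ B)) ⊎-dec (⊑? A B ⊎-dec ⊑? B A)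
      where Empty? : (X : Subset n) → Dec (Empty X)
            Empty? X = ¬? (nonempty? X)

    ncᵇ : Biset n → Biset n → Bool
    ncᵇ A B = ⌊ NC? A B ⌋

    NCross→ncᵇ : ∀ {A B : Biset n} → NCross A B → T (ncᵇ A B)
    NCross→ncᵇ {A} {B} p = fromWitness {a? = NC? A B} (NCross→NC p)

    ncᵇ→NCross : ∀ {A B : Biset n} → T (ncᵇ A B) → NCross A B
    ncᵇ→NCross {A} {B} t = NC→NCross (toWitness {a? = NC? A B} t)

    ⊑ᵇ→Sub : ∀ {A B : Biset n} → T (A ⊑ᵇ B) → Sub A B
    ⊑ᵇ→Sub {A} {B} t = ⊑→Sub (toWitness {a? = proj₁ A ⊆? proj₁ B} (T∧₁ t) ,
                               toWitness {a? = proj₂ A ⊆? proj₂ B} (T∧₂ {⌊ proj₁ A ⊆? proj₁ B ⌋} t))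

    Sub→⊑ᵇ : ∀ {A B : Biset n} → Sub A B → T (A ⊑ᵇ B)
    Sub→⊑ᵇ {A} {B} s with Sub→⊑ s
    ... | (s₁ , s⁺) = T∧ (fromWitness {a? = proj₁ A ⊆? proj₁ B} s₁) (fromWitness {a? = proj₂ A ⊆? proj₂ B} s⁺)

    -- The size ∣ X ∣ + ∣ X⁺ ∣ strictly increases along proper inclusion and is at
    -- most 2n; it is the measure for all inductions along a laminar family.

    size : Biset n → ℕ
    size A = ∣ proj₁ A ∣ ℕ.+ ∣ proj₂ A ∣

    size-bound : ∀ (A : Biset n) → size A ℕ.≤ n ℕ.+ n
    size-bound A = ℕP.+-mono-≤ (∣p∣≤n (proj₁ A)) (∣p∣≤n (proj₂ A))

  ⊆-equal-size : ∀ {n} (X Y : Subset n) → (∀ u → T (lookup X u) → T (lookup Y u)) → ∣ X ∣ ≡ ∣ Y ∣ →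
                 ∀ u → T (lookup Y u) → T (lookup X u)
  ⊆-equal-size [] [] f e ()
  ⊆-equal-size (true ∷ X)  (true ∷ Y)  f e zero    t = tt
  ⊆-equal-size (true ∷ X)  (true ∷ Y)  f e (suc u) t = ⊆-equal-size X Y (λ u → f (suc u)) (ℕP.suc-injective e) u t
  ⊆-equal-size (true ∷ X)  (false ∷ Y) f e u       t = ⊥-elim (f zero tt)
  ⊆-equal-size (false ∷ X) (true ∷ Y)  f e u       t =
    ⊥-elim (ℕP.<-irrefl refl (subst (ℕ._≤ ∣ Y ∣) e (p⊆q⇒∣p∣≤∣q∣ (→⊆ {X = X} {Y = Y} (λ u → f (suc u))))))
  ⊆-equal-size (false ∷ X) (false ∷ Y) f e zero    ()
  ⊆-equal-size (false ∷ X) (false ∷ Y) f e (suc u) t = ⊆-equal-size X Y (λ u → f (suc u)) e u t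

  size-strict : ∀ {n} {A B : Biset n} → Sub A B → ¬ Sub B A → size A ℕ.< size B
  size-strict {A = A} {B} (f , g) nba with ∣ proj₁ A ∣ ℕP.≟ ∣ proj₁ B ∣ | ∣ proj₂ A ∣ ℕP.≟ ∣ proj₂ B ∣
  ... | yes e1 | yes e2 = ⊥-elim (nba
        ((λ u h → mkI (⊆-equal-size (proj₁ A) (proj₁ B) (λ u t → unI (f u (mkI t))) e1 u (unI h))) ,
         (λ u h → mkO (⊆-equal-size (proj₂ A) (proj₂ B) (λ u t → unO (g u (mkO t))) e2 u (unO h)))))
  ... | no ne1 | _      = ℕP.+-mono-<-≤ (ℕP.≤∧≢⇒< inner≤ ne1) outer≤
    where inner≤ = p⊆q⇒∣p∣≤∣q∣ (→⊆ {X = proj₁ A} {Y = proj₁ B} (λ u t → unI (f u (mkI t))))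
          outer≤ = p⊆q⇒∣p∣≤∣q∣ (→⊆ {X = proj₂ A} {Y = proj₂ B} (λ u t → unO (g u (mkO t))))
  ... | yes _  | no ne2 = ℕP.+-mono-≤-< inner≤ (ℕP.≤∧≢⇒< outer≤ ne2)
    where inner≤ = p⊆q⇒∣p∣≤∣q∣ (→⊆ {X = proj₁ A} {Y = proj₁ B} (λ u t → unI (f u (mkI t))))
          outer≤ = p⊆q⇒∣p∣≤∣q∣ (→⊆ {X = proj₂ A} {Y = proj₂ B} (λ u t → unO (g u (mkO t))))

  -- Whether uv crosses a biset
  -- depends only on the four bits (u ∈ X, u ∈ X⁺, v ∈ X, v ∈ X⁺); the inequalities
  -- |δ(A ⊓ B)| + |δ(A ⊔ B)| ≤ |δ(A)| + |δ(B)| and |δ(A ∖ B)| + |δ(B ∖ A)| ≤ |δ(A)| + |δ(B)|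
  -- hold edge by edge, which is checked over all 2⁸ bit patterns.

  private
    allVecs : ∀ n → (Vec Bool n → Bool) → Bool
    allVecs zero    f = f []
    allVecs (suc n) f = allVecs n (λ v → f (true ∷ v)) ∧ allVecs n (λ v → f (false ∷ v))

    allVecs-sound : ∀ n f → T (allVecs n f) → ∀ v → T (f v)
    allVecs-sound zero    f t []          = t
    allVecs-sound (suc n) f t (true ∷ v)  = allVecs-sound n _ (T∧₁ t) v
    allVecs-sound (suc n) f t (false ∷ v) = allVecs-sound n _ (T∧₂ {allVecs n (λ v → f (true ∷ v))} t) v

    crossBits : Bool → Bool → Bool → Bool → Bool
    crossBits iu ou iv ov = (iu ∧ not ov) ∨ (iv ∧ not ou)

    _⇒ᵇ_ : Bool → Bool → Bool
    a ⇒ᵇ b = not a ∨ b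

    bisetBits : Vec Bool 8 → Bool
    bisetBits (xu ∷ xu⁺ ∷ xv ∷ xv⁺ ∷ yu ∷ yu⁺ ∷ yv ∷ yv⁺ ∷ []) =
      (xu ⇒ᵇ xu⁺) ∧ (xv ⇒ᵇ xv⁺) ∧ (yu ⇒ᵇ yu⁺) ∧ (yv ⇒ᵇ yv⁺)

    ⊓⊔-bits : Vec Bool 8 → Bool
    ⊓⊔-bits b@(xu ∷ xu⁺ ∷ xv ∷ xv⁺ ∷ yu ∷ yu⁺ ∷ yv ∷ yv⁺ ∷ []) = bisetBits b ⇒ᵇ
      ((ind (crossBits (xu ∧ yu) (xu⁺ ∧ yu⁺) (xv ∧ yv) (xv⁺ ∧ yv⁺)) ℕ.+
        ind (crossBits (xu ∨ yu) (xu⁺ ∨ yu⁺) (xv ∨ yv) (xv⁺ ∨ yv⁺)))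
       ≤ᵇ (ind (crossBits xu xu⁺ xv xv⁺) ℕ.+ ind (crossBits yu yu⁺ yv yv⁺)))

    ∖-bits : Vec Bool 8 → Bool
    ∖-bits b@(xu ∷ xu⁺ ∷ xv ∷ xv⁺ ∷ yu ∷ yu⁺ ∷ yv ∷ yv⁺ ∷ []) = bisetBits b ⇒ᵇ
      ((ind (crossBits (xu ∧ not yu⁺) (xu⁺ ∧ not yu) (xv ∧ not yv⁺) (xv⁺ ∧ not yv)) ℕ.+
        ind (crossBits (yu ∧ not xu⁺) (yu⁺ ∧ not xu) (yv ∧ not xv⁺) (yv⁺ ∧ not xv)))
       ≤ᵇ (ind (crossBits xu xu⁺ xv xv⁺) ℕ.+ ind (crossBits yu yu⁺ yv yv⁺)))

    ⇒ᵇ-elim : ∀ {a b} → T (a ⇒ᵇ b) → T a → T b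
    ⇒ᵇ-elim {true} t _ = t

    ⇒ᵇ-intro : ∀ {a b} → (T a → T b) → T (a ⇒ᵇ b)
    ⇒ᵇ-intro {true}  f = f tt
    ⇒ᵇ-intro {false} f = tt

    bits : ∀ {n} → Biset n → Biset n → Fin n → Fin n → Vec Bool 8
    bits (X , X⁺) (Y , Y⁺) u v =
      lookup X u ∷ lookup X⁺ u ∷ lookup X v ∷ lookup X⁺ v ∷ lookup Y u ∷ lookup Y⁺ u ∷ lookup Y v ∷ lookup Y⁺ v ∷ []

    bisetBits-ok : ∀ {n} {A B : Biset n} → IsBiset A → IsBiset B → ∀ u v → T (bisetBits (bits A B u v))
    bisetBits-ok bA bB u v = T∧ (⇒ᵇ-intro (⊆→ bA u)) (T∧ (⇒ᵇ-intro (⊆→ bA v)) (T∧ (⇒ᵇ-intro (⊆→ bB u)) (⇒ᵇ-intro (⊆→ bB v))))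

  module _ {n : ℕ} where

    -- whether the edge with ends u, v crosses A (agrees with crosses for ends e = (u , v))
    crossesBetween : Fin n → Fin n → Biset n → Bool
    crossesBetween u v A = crossBits (lookup (proj₁ A) u) (lookup (proj₂ A) u) (lookup (proj₁ A) v) (lookup (proj₂ A) v)

    crossings-⊓⊔ : ∀ (A B : Biset n) → IsBiset A → IsBiset B → ∀ u v →
      ind (crossesBetween u v (A ⊓ B)) ℕ.+ ind (crossesBetween u v (A ⊔ B)) ℕ.≤
      ind (crossesBetween u v A) ℕ.+ ind (crossesBetween u v B)
    crossings-⊓⊔ (X , X⁺) (Y , Y⁺) bA bB u v
      rewrite lk∩ X Y u | lk∩ X⁺ Y⁺ u | lk∩ X Y v | lk∩ X⁺ Y⁺ v
            | lk∪ X Y u | lk∪ X⁺ Y⁺ u | lk∪ X Y v | lk∪ X⁺ Y⁺ v =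
      ℕP.≤ᵇ⇒≤ _ _ (⇒ᵇ-elim (allVecs-sound 8 ⊓⊔-bits tt (bits (X , X⁺) (Y , Y⁺) u v))
                           (bisetBits-ok {A = X , X⁺} {B = Y , Y⁺} bA bB u v))

    crossings-∖ : ∀ (A B : Biset n) → IsBiset A → IsBiset B → ∀ u v →
      ind (crossesBetween u v (A ∖ B)) ℕ.+ ind (crossesBetween u v (B ∖ A)) ℕ.≤
      ind (crossesBetween u v A) ℕ.+ ind (crossesBetween u v B)
    crossings-∖ (X , X⁺) (Y , Y⁺) bA bB u v
      rewrite lk─ X Y⁺ u | lk─ X⁺ Y u | lk─ X Y⁺ v | lk─ X⁺ Y v
            | lk─ Y X⁺ u | lk─ Y⁺ X u | lk─ Y X⁺ v | lk─ Y⁺ X v =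
      ℕP.≤ᵇ⇒≤ _ _ (⇒ᵇ-elim (allVecs-sound 8 ∖-bits tt (bits (X , X⁺) (Y , Y⁺) u v))
                           (bisetBits-ok {A = X , X⁺} {B = Y , Y⁺} bA bB u v))

  crossesFrom : ∀ {n} → Fin n → Fin n → Biset n → Bool
  crossesFrom u v A = lookup (proj₁ A) u ∧ not (lookup (proj₂ A) v)

module Setting where

  open import Defs
  open Rationals
  open Sums
  open BisetCalculus using (T→∈)
  open import Data.Bool using (Bool; true; false; _∧_; if_then_else_; T)
  open import Data.Nat as ℕ using (ℕ)
  open import Data.Integer as ℤ using (ℤ; 0ℤ)
  import Data.Integer.Properties as ℤP
  open import Data.Rational as ℚ using (ℚ; 0ℚ; 1ℚ; _+_; _-_; _≤_; _<_)
  open import Data.Rational.Properties as ℚP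
  open import Data.Rational.Solver
  open import Data.Fin using (Fin)
  open import Data.Fin.Subset using (Subset; Nonempty)
  open import Data.Fin.Subset.Properties using (nonempty?)
  open import Data.Product using (_×_; _,_; ∃; proj₁; proj₂)
  open import Data.Sum using (inj₁; inj₂)
  open import Data.Empty using (⊥-elim)
  open import Data.Unit using (tt)
  open import Relation.Binary.PropositionalEquality
  open import Relation.Nullary using (¬_; Dec; yes; no)
  open import Relation.Nullary.Decidable using (⌊_⌋; toWitness)
  open +-*-Solver

  record Situation (n m k : ℕ) : Set where
    field
      ends    : Fin m → Fin n × Fin n
      Tm      : Subset n
      h       : Biset n → ℤ
      skew    : SkewSupermodular h
      h-in-C  : ∀ A → IsBiset A → 0ℤ ℤ.< h A → InC Tm A
      x̄       : Fin m → ℕ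
      x       : Fin m → ℚ
      extreme : ExtremePoint ends (λ A → toℚ (hShift ends h x̄ A)) (λ _ → 1) x
      L       : Fin k → Biset n
      basis   : MaximalLaminarIndep ends h x̄ x L

  module Basics {n m k : ℕ} (S : Situation n m k) where

    open Situation S public

    F : Fin m → Bool
    F = Fset ends x

    E1 : Fin m → Bool
    E1 = E1set ends x

    cr : Fin m → Biset n → Bool
    cr = crosses ends

    hx : Biset n → ℚ
    hx A = toℚ (hShift ends h x̄ A)

    xδ : Biset n → ℚ
    xδ A = sumδ ends (allE ends) x A

    Active : Biset n → Set
    Active A = xδ A ≡ hx A

    dotF : (Fin m → ℚ) → Biset n → ℚ
    dotF d A = sumδ ends F d A

    x≥0 : ∀ e → 0ℚ ≤ x e
    x≥0 = proj₁ (proj₁ extreme)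

    x≤1 : ∀ e → x e ≤ 1ℚ
    x≤1 = proj₁ (proj₂ (proj₁ extreme))

    covers : ∀ A → InV A → hx A ≤ xδ A
    covers = proj₂ (proj₂ (proj₁ extreme))

    F-pos : ∀ e → T (F e) → 0ℚ < x e
    F-pos e t = toWitness {a? = 0ℚ ℚP.<? x e} (T∧₁ t)

    F-lt1 : ∀ e → T (F e) → x e < 1ℚ
    F-lt1 e t = toWitness {a? = x e ℚP.<? 1ℚ} (T∧₂ {⌊ 0ℚ ℚP.<? x e ⌋} t)

    tL : ∀ j → Tight ends h x̄ x (L j)
    tL = proj₁ basis

    lamL : Laminar ends L
    lamL = proj₁ (proj₂ basis)

    indL : LinIndep ends F L
    indL = proj₁ (proj₂ (proj₂ basis))

    maxL : ∀ {k'} (L' : Fin k' → Biset n) → (∀ j → Tight ends h x̄ x (L' j)) →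
           Laminar ends L' → LinIndep ends F L' →
           (∀ i → ∃ λ j → L' j ≡ L i) → ∀ j → ∃ λ i → L i ≡ L' j
    maxL = proj₂ (proj₂ (proj₂ basis))

    bL : ∀ j → IsBiset (L j)
    bL j = proj₁ (proj₁ (tL j))

    ifq-x≥0 : ∀ b e → 0ℚ ≤ ifq b (x e)
    ifq-x≥0 true  e = x≥0 e
    ifq-x≥0 false e = ≤-refl

    xδ-nonneg : ∀ A → 0ℚ ≤ xδ A
    xδ-nonneg A = sumℚ-nonneg (λ e → ifq-x≥0 (cr e A) e)

    -- Every edge is fractional (F), at one (E1), or at zero: x = [F] x + [E1].
    x-split : ∀ e → x e ≡ ifq (F e) (x e) + ifq (E1 e) 1ℚ
    x-split e = split (x e) (x≥0 e) (x≤1 e) (0ℚ ℚP.<? x e) (x e ℚP.<? 1ℚ) (x e ℚP.≟ 1ℚ)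
      where
      split : ∀ q → 0ℚ ≤ q → q ≤ 1ℚ → (d1 : Dec (0ℚ < q)) (d2 : Dec (q < 1ℚ)) (d3 : Dec (q ≡ 1ℚ)) →
              q ≡ ifq (⌊ d1 ⌋ ∧ ⌊ d2 ⌋) q + ifq ⌊ d3 ⌋ 1ℚ
      split q l u (yes p)  (yes q<1) (yes q≡1) = ⊥-elim (<-irrefl q≡1 q<1)
      split q l u (yes p)  (yes q<1) (no _)    = sym (+-identityʳ q)
      split q l u (yes p)  (no _)    (yes q≡1) = trans q≡1 (sym (+-identityˡ 1ℚ))
      split q l u (yes p)  (no q≮1)  (no q≢1)  = ⊥-elim (q≢1 (≤-antisym u (≮⇒≥ q≮1)))
      split q l u (no 0≮q) d2        (yes q≡1) = ⊥-elim (0≮q (<-respʳ-≡ (sym q≡1) 0<1))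
      split q l u (no 0≮q) d2        (no _)    = trans (≤-antisym (≮⇒≥ 0≮q) l) (sym (+-identityˡ 0ℚ))

    xδ-split : ∀ A → xδ A ≡ sumδ ends F x A + ℕℚ (sizeδ ends E1 A)
    xδ-split A = begin
      sumℚ (λ e → ifq (cr e A) (x e))
        ≡⟨ sumℚ-cong (λ e → restrict (cr e A) (F e) (E1 e) (x e) (x-split e)) ⟩
      sumℚ (λ e → ifq (F e ∧ cr e A) (x e) + ifq (E1 e ∧ cr e A) 1ℚ)
        ≡⟨ sumℚ-+ (λ e → ifq (F e ∧ cr e A) (x e)) (λ e → ifq (E1 e ∧ cr e A) 1ℚ) ⟩
      sumℚ (λ e → ifq (F e ∧ cr e A) (x e)) + sumℚ (λ e → ifq (E1 e ∧ cr e A) 1ℚ)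
        ≡⟨ cong (sumδ ends F x A +_) (sumℚ-ind (λ e → E1 e ∧ cr e A)) ⟩
      sumδ ends F x A + ℕℚ (sizeδ ends E1 A) ∎
      where
      open ≡-Reasoning
      restrict : ∀ b f e1 q → q ≡ ifq f q + ifq e1 1ℚ → ifq b q ≡ ifq (f ∧ b) q + ifq (e1 ∧ b) 1ℚ
      restrict true  true  true  q d = d
      restrict true  true  false q d = d
      restrict true  false true  q d = d
      restrict true  false false q d = d
      restrict false true  true  q d = sym (+-identityˡ 0ℚ)
      restrict false true  false q d = sym (+-identityˡ 0ℚ)
      restrict false false true  q d = sym (+-identityˡ 0ℚ)
      restrict false false false q d = sym (+-identityˡ 0ℚ)

    Tight→Active : ∀ {A} → Tight ends h x̄ x A → Active A
    Tight→Active {A} (iv , eq , pos) = begin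
      xδ A                                                 ≡⟨ xδ-split A ⟩
      sumδ ends F x A + ℕℚ (sizeδ ends E1 A)               ≡⟨ cong (_+ ℕℚ (sizeδ ends E1 A)) eq ⟩
      (hx A - ℕℚ (sizeδ ends E1 A)) + ℕℚ (sizeδ ends E1 A) ≡⟨ solve 2 (λ a b → (a :- b) :+ b := a) refl (hx A) _ ⟩
      hx A                                                 ∎
      where open ≡-Reasoning

    Active→Tight : ∀ {A} → InV A → Active A → 0ℚ < sumδ ends F x A → Tight ends h x̄ x A
    Active→Tight {A} iv act pos = iv , eq , pos
      where
      open ≡-Reasoning
      eq : sumδ ends F x A ≡ hx A - ℕℚ (sizeδ ends E1 A)
      eq = begin
        sumδ ends F x A
          ≡⟨ solve 2 (λ a b → a := (a :+ b) :- b) refl (sumδ ends F x A) _ ⟩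
        (sumδ ends F x A + ℕℚ (sizeδ ends E1 A)) - ℕℚ (sizeδ ends E1 A)
          ≡⟨ cong (_- ℕℚ (sizeδ ends E1 A)) (trans (sym (xδ-split A)) act) ⟩
        hx A - ℕℚ (sizeδ ends E1 A) ∎

    x̄δ : Biset n → ℕ
    x̄δ A = sumℕ (λ e → if cr e A then x̄ e else 0)

    hx-eq : ∀ A → hx A ≡ toℚ (h A) - ℕℚ (x̄δ A)
    hx-eq A = toℚ-- (h A) (ℤ.+ x̄δ A)

    hx≤h : ∀ A → hx A ≤ toℚ (h A)
    hx≤h A = ≤-trans (≤-reflexive (hx-eq A)) (0≤q-p⇒p≤q (≤-trans (0≤ℕℚ (x̄δ A))
       (≤-reflexive (solve 2 (λ a b → b := a :- (a :- b)) refl (toℚ (h A)) _))))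

    Tight-hx-pos : ∀ {A} → Tight ends h x̄ x A → 0ℚ < hx A
    Tight-hx-pos {A} (iv , eq , pos) = <-≤-trans pos (≤-trans (≤-reflexive eq)
      (0≤q-p⇒p≤q (≤-trans (0≤ℕℚ (sizeδ ends E1 A)) (≤-reflexive
        (solve 2 (λ a b → b := a :- (a :- b)) refl (hx A) _)))))

    Tight-hpos : ∀ {A} → Tight ends h x̄ x A → 0ℤ ℤ.< h A
    Tight-hpos {A} t = toℚ-cancel-< (<-≤-trans (Tight-hx-pos t) (hx≤h A))

    noFcross : ∀ d A → (∀ e → T (F e) → ¬ T (cr e A)) → dotF d A ≡ 0ℚ
    noFcross d A f = sumℚ-zero (λ e → vanish (F e) (cr e A) (d e) (f e))
      where vanish : ∀ a b q → (T a → ¬ T b) → ifq (a ∧ b) q ≡ 0ℚ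
            vanish true  true  q g = ⊥-elim (g tt tt)
            vanish true  false q g = refl
            vanish false b     q g = refl

    zeroflow : ∀ A → xδ A ≤ 0ℚ → ∀ e → T (F e) → ¬ T (cr e A)
    zeroflow A le e fe ce = <-irrefl refl (<-≤-trans (sumℚ-pos (λ e → ifq-x≥0 (cr e A) e) e xe>0) le)
      where xe>0 : 0ℚ < ifq (cr e A) (x e)
            xe>0 = subst (λ b → 0ℚ < ifq b (x e)) (sym (T⇒≡true ce)) (F-pos e fe)

    emptyNoCross : ∀ A → ¬ Nonempty (proj₁ A) → ∀ e → ¬ T (cr e A)
    emptyNoCross A ne e c with T∨ c
    ... | inj₁ t = ne (proj₁ (ends e) , T→∈ (T∧₁ t))
    ... | inj₂ t = ne (proj₂ (ends e) , T→∈ (T∧₁ t))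

    -- x covers every biset, also those with empty inner part (where h ≤ 0,
    -- since a biset with h > 0 lies in 𝒞).
    covers-all : ∀ A → IsBiset A → hx A ≤ xδ A
    covers-all A bA with nonempty? (proj₁ A)
    ... | yes ne = covers A (bA , ne)
    ... | no ne  = ≤-trans (hx≤h A) (≤-trans (toℚ-mono-≤ {h A} {0ℤ} h≤0) (xδ-nonneg A))
      where h≤0 : h A ℤ.≤ 0ℤ
            h≤0 = ℤP.≮⇒≥ (λ hp → ne (proj₂ (proj₁ (h-in-C A bA hp))))

open Setting using (Situation)

-- Orthogonality to L propagates to all active bisets.
module Uncrossing {n m k : ℕ} (S : Situation n m k) where

  open import Defs
  open Rationals
  open Sums
  open BisetCalculus
  open Setting
  open import Data.Bool using (true; false; _∧_; not; if_then_else_; T)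
  open import Data.Nat as ℕ using (ℕ; zero; suc)
  import Data.Nat.Properties as ℕP
  open import Data.Integer as ℤ using (ℤ; 0ℤ)
  import Data.Integer.Properties as ℤP
  open import Data.Rational as ℚ using (ℚ; 0ℚ; _+_; _*_; _-_; _≤_; _<_)
  open import Data.Rational.Properties as ℚP
  open import Data.Rational.Solver
  open import Data.Fin using (Fin; zero; suc)
  open import Data.Fin.Subset.Properties using (nonempty?)
  open import Data.Product using (_×_; _,_; ∃; proj₁; proj₂)
  open import Data.Sum using (_⊎_; inj₁; inj₂)
  open import Data.Empty using (⊥-elim)
  open import Data.Unit using (tt)
  open import Relation.Binary.PropositionalEquality
  open import Relation.Nullary using (¬_; Dec; yes; no)
  open import Relation.Nullary.Decidable using (T?)
  open +-*-Solver

  open Basics S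

  pairCount : Fin m → Biset n → Biset n → ℕ
  pairCount e N₁ N₂ = ind (cr e N₁) ℕ.+ ind (cr e N₂)

  record UncrossingStep (A B N₁ N₂ : Biset n) : Set where
    field
      fewer-edges : ∀ e → pairCount e N₁ N₂ ℕ.≤ pairCount e A B
      more-demand : h A ℤ.+ h B ℤ.≤ h N₁ ℤ.+ h N₂

  module _ {A B N₁ N₂ : Biset n} (step : UncrossingStep A B N₁ N₂) where

    open UncrossingStep step

    x̄δ-uncross : x̄δ N₁ ℕ.+ x̄δ N₂ ℕ.≤ x̄δ A ℕ.+ x̄δ B
    x̄δ-uncross = ℕP.≤-trans (ℕP.≤-reflexive (sym (sumℕ-+ (x̄-on N₁) (x̄-on N₂))))
      (ℕP.≤-trans (sumℕ-mono (λ e → ℕP.≤-trans (ℕP.≤-reflexive (ifn-pair (cr e N₁) (cr e N₂) (x̄ e)))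
         (ℕP.≤-trans (ℕP.*-monoˡ-≤ (x̄ e) (fewer-edges e)) (ℕP.≤-reflexive (sym (ifn-pair (cr e A) (cr e B) (x̄ e)))))))
      (ℕP.≤-reflexive (sumℕ-+ (x̄-on A) (x̄-on B))))
      where x̄-on : Biset n → Fin m → ℕ
            x̄-on N e = if cr e N then x̄ e else 0

    hx-uncross : hx A + hx B ≤ hx N₁ + hx N₂
    hx-uncross = begin
      hx A + hx B                                             ≡⟨ cong₂ _+_ (hx-eq A) (hx-eq B) ⟩
      (toℚ (h A) - ℕℚ (x̄δ A)) + (toℚ (h B) - ℕℚ (x̄δ B))       ≡⟨ regroup (toℚ (h A)) (ℕℚ (x̄δ A)) (toℚ (h B)) (ℕℚ (x̄δ B)) ⟩
      (toℚ (h A) + toℚ (h B)) - (ℕℚ (x̄δ A) + ℕℚ (x̄δ B))       ≤⟨ -‿mono-≤ demand edges ⟩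
      (toℚ (h N₁) + toℚ (h N₂)) - (ℕℚ (x̄δ N₁) + ℕℚ (x̄δ N₂))   ≡⟨ sym (regroup (toℚ (h N₁)) (ℕℚ (x̄δ N₁)) (toℚ (h N₂)) (ℕℚ (x̄δ N₂))) ⟩
      (toℚ (h N₁) - ℕℚ (x̄δ N₁)) + (toℚ (h N₂) - ℕℚ (x̄δ N₂))   ≡⟨ sym (cong₂ _+_ (hx-eq N₁) (hx-eq N₂)) ⟩
      hx N₁ + hx N₂                                           ∎
      where
      open ≤-Reasoning
      regroup : ∀ a b c d → (a - b) + (c - d) ≡ (a + c) - (b + d)
      regroup = solve 4 (λ a b c d → (a :- b) :+ (c :- d) := (a :+ c) :- (b :+ d)) refl
      demand : toℚ (h A) + toℚ (h B) ≤ toℚ (h N₁) + toℚ (h N₂)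
      demand = subst₂ _≤_ (toℚ-+ (h A) (h B)) (toℚ-+ (h N₁) (h N₂)) (toℚ-mono-≤ more-demand)
      edges : ℕℚ (x̄δ N₁) + ℕℚ (x̄δ N₂) ≤ ℕℚ (x̄δ A) + ℕℚ (x̄δ B)
      edges = subst₂ _≤_ (ℕℚ-+ (x̄δ N₁) (x̄δ N₂)) (ℕℚ-+ (x̄δ A) (x̄δ B)) (ℕℚ-mono-≤ x̄δ-uncross)

    pairWeight : Fin m → Biset n → Biset n → ℚ
    pairWeight e P Q = ifq (cr e P) (x e) + ifq (cr e Q) (x e)

    pairWeight-mono : ∀ e → pairWeight e N₁ N₂ ≤ pairWeight e A B
    pairWeight-mono e = subst₂ _≤_ (sym (ifq-pair (cr e N₁) (cr e N₂) (x e))) (sym (ifq-pair (cr e A) (cr e B) (x e)))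
      (*-monoʳ-≤-nonNeg (x e) {{ℚ.nonNegative (x≥0 e)}} (ℕℚ-mono-≤ (fewer-edges e)))

    xδ-pair : ∀ P Q → sumℚ (λ e → pairWeight e P Q) ≡ xδ P + xδ Q
    xδ-pair P Q = sumℚ-+ (λ e → ifq (cr e P) (x e)) (λ e → ifq (cr e Q) (x e))

    xδ-uncross : xδ N₁ + xδ N₂ ≤ xδ A + xδ B
    xδ-uncross = subst₂ _≤_ (xδ-pair N₁ N₂) (xδ-pair A B) (sumℚ-mono pairWeight-mono)

    uncross-active : Active A → Active B → IsBiset N₁ → IsBiset N₂ →
      (Active N₁ × Active N₂) × (∀ e → T (F e) → pairCount e N₁ N₂ ≡ pairCount e A B)
    uncross-active actA actB b₁ b₂ = (sym act₁ , sym act₂) , same-count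
      where
      cov₁ : hx N₁ ≤ xδ N₁
      cov₁ = covers-all N₁ b₁
      cov₂ : hx N₂ ≤ xδ N₂
      cov₂ = covers-all N₂ b₂
      -- xδ A + xδ B = hx A + hx B ≤ hx N₁ + hx N₂ ≤ xδ N₁ + xδ N₂ ≤ xδ A + xδ B
      A≤h : xδ A + xδ B ≤ hx N₁ + hx N₂
      A≤h = ≤-trans (≤-reflexive (cong₂ _+_ actA actB)) hx-uncross
      h≤N : hx N₁ + hx N₂ ≤ xδ N₁ + xδ N₂
      h≤N = +-mono-≤ cov₁ cov₂
      h≡N : hx N₁ + hx N₂ ≡ xδ N₁ + xδ N₂
      h≡N = ≤-antisym h≤N (≤-trans xδ-uncross A≤h)
      N≡A : xδ N₁ + xδ N₂ ≡ xδ A + xδ B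
      N≡A = ≤-antisym xδ-uncross (≤-trans A≤h h≤N)
      act₁ : hx N₁ ≡ xδ N₁
      act₁ = ≤-+-squeeze cov₁ cov₂ h≡N
      act₂ : hx N₂ ≡ xδ N₂
      act₂ = ≤-+-squeeze cov₂ cov₁ (trans (+-comm (hx N₂) (hx N₁)) (trans h≡N (+-comm (xδ N₁) (xδ N₂))))
      -- the nonnegative edgewise slack sums to zero, hence vanishes
      slack : Fin m → ℚ
      slack e = pairWeight e A B - pairWeight e N₁ N₂
      slack≡0 : ∀ e → slack e ≡ 0ℚ
      slack≡0 = sumℚ-nonneg-zero (λ e → p≤q⇒0≤q-p (pairWeight-mono e))
        (trans (sumℚ-- (λ e → pairWeight e A B) (λ e → pairWeight e N₁ N₂))
          (trans (cong₂ _-_ (xδ-pair A B) (trans (xδ-pair N₁ N₂) N≡A)) (+-inverseʳ (xδ A + xδ B))))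
      same-count : ∀ e → T (F e) → pairCount e N₁ N₂ ≡ pairCount e A B
      same-count e fe = sym (ℤP.+-injective (toℚ-injective (p-q≡0⇒p≡q (p*q≡0⇒p≡0 count-diff (λ z → <-irrefl (sym z) (F-pos e fe))))))
        where
        count-diff : (ℕℚ (pairCount e A B) - ℕℚ (pairCount e N₁ N₂)) * x e ≡ 0ℚ
        count-diff = trans (sym (trans (cong₂ _-_ (ifq-pair (cr e A) (cr e B) (x e)) (ifq-pair (cr e N₁) (cr e N₂) (x e)))
                       (solve 3 (λ a b q → a :* q :- b :* q := (a :- b) :* q) refl
                          (ℕℚ (pairCount e A B)) (ℕℚ (pairCount e N₁ N₂)) (x e))))
                     (slack≡0 e)

  dotF-pair : ∀ d A B N₁ N₂ → (∀ e → T (F e) → pairCount e N₁ N₂ ≡ pairCount e A B) →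
    dotF d N₁ + dotF d N₂ ≡ dotF d A + dotF d B
  dotF-pair d A B N₁ N₂ eq = trans (sym (sumℚ-+ (λ e → ifq (F e ∧ cr e N₁) (d e)) (λ e → ifq (F e ∧ cr e N₂) (d e))))
    (trans (sumℚ-cong (λ e → pointwise e (F e) (eq e))) (sumℚ-+ (λ e → ifq (F e ∧ cr e A) (d e)) (λ e → ifq (F e ∧ cr e B) (d e))))
    where
    pointwise : ∀ e f → (T f → pairCount e N₁ N₂ ≡ pairCount e A B) →
         ifq (f ∧ cr e N₁) (d e) + ifq (f ∧ cr e N₂) (d e) ≡ ifq (f ∧ cr e A) (d e) + ifq (f ∧ cr e B) (d e)
    pointwise e true  q = trans (ifq-pair (cr e N₁) (cr e N₂) (d e))
                            (trans (cong (λ z → ℕℚ z * d e) (q tt)) (sym (ifq-pair (cr e A) (cr e B) (d e))))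
    pointwise e false q = refl

  module Orthogonal (d : Fin m → ℚ) (dL : ∀ j → dotF d (L j) ≡ 0ℚ) where

    -- Σ_{e ∈ F} d(e) Σ_i c_i [e ∈ δ(L i)] = Σ_i c_i d(δ_F(L i)) = 0
    combination : ∀ (c : Fin k → ℚ) →
      sumℚ (λ e → ifq (F e) (d e * sumℚ (λ i → ifq (cr e (L i)) (c i)))) ≡ 0ℚ
    combination c = begin
      sumℚ (λ e → ifq (F e) (d e * sumℚ (λ i → ifq (cr e (L i)) (c i))))
        ≡⟨ sumℚ-cong (λ e → trans (ifq-sum (F e) (d e) (λ i → ifq (cr e (L i)) (c i)))
                               (sumℚ-cong (λ i → ifq-mul (F e) (cr e (L i)) (d e) (c i)))) ⟩
      sumℚ (λ e → sumℚ (λ i → c i * ifq (F e ∧ cr e (L i)) (d e)))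
        ≡⟨ sumℚ-swap (λ e i → c i * ifq (F e ∧ cr e (L i)) (d e)) ⟩
      sumℚ (λ i → sumℚ (λ e → c i * ifq (F e ∧ cr e (L i)) (d e)))
        ≡⟨ sumℚ-zero (λ i → trans (sumℚ-* (c i) (λ e → ifq (F e ∧ cr e (L i)) (d e))) (trans (cong (c i *_) (dL i)) (*-zeroʳ (c i)))) ⟩
      0ℚ ∎
      where
      open ≡-Reasoning
      ifq-sum : ∀ {l} f (q : ℚ) (g : Fin l → ℚ) → ifq f (q * sumℚ g) ≡ sumℚ (λ i → ifq f (q * g i))
      ifq-sum true      q g = sym (sumℚ-* q g)
      ifq-sum {l} false q g = sym (sumℚ-0 {l})
      ifq-mul : ∀ f b (q c : ℚ) → ifq f (q * ifq b c) ≡ c * ifq (f ∧ b) q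
      ifq-mul true  true  q c = *-comm q c
      ifq-mul true  false q c = trans (*-zeroʳ q) (sym (*-zeroʳ c))
      ifq-mul false b     q c = sym (*-zeroʳ c)

    -- Adding to L an active biset A of 𝒱 that crosses no member of L and has
    -- d(δ_F(A)) ≠ 0 gives a larger laminar independent family of tight bisets.
    module Extension (A : Biset n) (iv : InV A) (act : Active A) (nc : ∀ i → Noncrossing A (L i))
                     (dA≢0 : ¬ dotF d A ≡ 0ℚ) where

      -- some F-edge crosses A (otherwise d(δ_F(A)) = 0), so A is tight
      A-tight : Tight ends h x̄ x A
      A-tight = Active→Tight iv act (xF-pos (T? (anyFin (λ e → F e ∧ cr e A))))
        where
        xF-pos : Dec (T (anyFin (λ e → F e ∧ cr e A))) → 0ℚ < sumδ ends F x A
        xF-pos (yes t) with anyFin⇒∃ (λ e → F e ∧ cr e A) t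
        ... | e , fe = sumℚ-pos (λ e → ifq-x≥0 (F e ∧ cr e A) e) e
                         (subst (λ b → 0ℚ < ifq b (x e)) (sym (T⇒≡true fe)) (F-pos e (T∧₁ fe)))
        xF-pos (no nt) = ⊥-elim (dA≢0 (noFcross d A (λ e fe ce → nt (∃⇒anyFin (λ e → F e ∧ cr e A) e (T∧ fe ce)))))

      L⁺ : Fin (suc k) → Biset n
      L⁺ zero    = A
      L⁺ (suc i) = L i

      L⁺-tight : ∀ j → Tight ends h x̄ x (L⁺ j)
      L⁺-tight zero    = A-tight
      L⁺-tight (suc j) = tL j

      L⁺-laminar : Laminar ends L⁺
      L⁺-laminar zero    zero    = inj₂ (inj₁ ((λ z → z) , (λ z → z)))
      L⁺-laminar zero    (suc j) = nc j
      L⁺-laminar (suc i) zero    = NCross→NC (NCross-sym (NC→NCross (nc i)))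
      L⁺-laminar (suc i) (suc j) = lamL i j

      -- in a dependence c₀ η_A + Σ cᵢ η_{L i} = 0, pairing with d gives c₀ d(δ_F(A)) = 0
      first-coefficient : ∀ (c : Fin (suc k) → ℚ) →
        (∀ e → T (F e) → sumℚ (λ i → ifq (cr e (L⁺ i)) (c i)) ≡ 0ℚ) → c zero ≡ 0ℚ
      first-coefficient c H = p*q≡0⇒p≡0 (begin
        c zero * dotF d A
          ≡⟨ sym (+-identityʳ _) ⟩
        c zero * dotF d A + 0ℚ
          ≡⟨ cong (c zero * dotF d A +_) (sym (combination (λ i → c (suc i)))) ⟩
        c zero * dotF d A + sumℚ (λ e → ifq (F e) (d e * rest e))
          ≡⟨ cong (_+ sumℚ (λ e → ifq (F e) (d e * rest e))) (sym (sumℚ-* (c zero) (λ e → ifq (F e ∧ cr e A) (d e)))) ⟩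
        sumℚ (λ e → c zero * ifq (F e ∧ cr e A) (d e)) + sumℚ (λ e → ifq (F e) (d e * rest e))
          ≡⟨ sym (sumℚ-+ (λ e → c zero * ifq (F e ∧ cr e A) (d e)) (λ e → ifq (F e) (d e * rest e))) ⟩
        sumℚ (λ e → c zero * ifq (F e ∧ cr e A) (d e) + ifq (F e) (d e * rest e))
          ≡⟨ sumℚ-zero (λ e → pointwise e (F e) (cr e A) (H e)) ⟩
        0ℚ ∎) dA≢0
        where
        open ≡-Reasoning
        rest : Fin m → ℚ
        rest e = sumℚ (λ i → ifq (cr e (L i)) (c (suc i)))
        pointwise : ∀ e f a → (T f → ifq a (c zero) + rest e ≡ 0ℚ) →
                    c zero * ifq (f ∧ a) (d e) + ifq f (d e * rest e) ≡ 0ℚ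
        pointwise e true true H' = begin
          c zero * d e + d e * rest e  ≡⟨ solve 3 (λ c d r → c :* d :+ d :* r := d :* (c :+ r)) refl (c zero) (d e) (rest e) ⟩
          d e * (c zero + rest e)      ≡⟨ cong (d e *_) (H' tt) ⟩
          d e * 0ℚ                     ≡⟨ *-zeroʳ (d e) ⟩
          0ℚ                           ∎
        pointwise e true false H' = begin
          c zero * 0ℚ + d e * rest e   ≡⟨ cong (λ r → c zero * 0ℚ + d e * r) (trans (sym (+-identityˡ (rest e))) (H' tt)) ⟩
          c zero * 0ℚ + d e * 0ℚ       ≡⟨ solve 2 (λ c d → c :* con 0ℚ :+ d :* con 0ℚ := con 0ℚ) refl (c zero) (d e) ⟩
          0ℚ                           ∎
        pointwise e false a H' = trans (cong (_+ 0ℚ) (*-zeroʳ (c zero))) (+-identityˡ 0ℚ)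

      -- the remaining coefficients vanish by independence of L
      L⁺-independent : LinIndep ends F L⁺
      L⁺-independent c H zero    = first-coefficient c H
      L⁺-independent c H (suc i) = indL (λ i → c (suc i)) (λ e fe → trans (sym (+-identityˡ _))
        (trans (cong (_+ sumℚ (λ i → ifq (cr e (L i)) (c (suc i))))
                     (sym (trans (cong (ifq (cr e A)) (first-coefficient c H)) (ifq-0 (cr e A)))))
          (H e fe))) i

    -- By maximality of L such an A would be a member of L, where d(δ_F) = 0.
    noncrossing-orthogonal : ∀ A → InV A → Active A → (∀ i → Noncrossing A (L i)) → dotF d A ≡ 0ℚ
    noncrossing-orthogonal A iv act nc with dotF d A ℚP.≟ 0ℚ
    ... | yes z   = z
    ... | no dA≢0 with maxL L⁺ L⁺-tight L⁺-laminar L⁺-independent (λ i → suc i , refl) zero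
      where open Extension A iv act nc dA≢0
    ...   | i , Li≡A = ⊥-elim (dA≢0 (trans (cong (dotF d) (sym Li≡A)) (dL i)))

    crossCount : Biset n → ℕ
    crossCount A = countᵇ (λ i → not (ncᵇ A (L i)))

    -- The result of uncrossing A with a member L b it crosses: two bisets
    -- (A ⊓ L b, A ⊔ L b or A ∖ L b, L b ∖ A, as skew supermodularity dictates)
    -- noncrossing with every member that is noncrossing with both A and L b.
    record Uncrossed (A : Biset n) (b : Fin k) : Set where
      field
        N₁ N₂  : Biset n
        b₁     : IsBiset N₁
        b₂     : IsBiset N₂
        step   : UncrossingStep A (L b) N₁ N₂
        keeps₁ : ∀ i → NCross (L i) A → NCross (L i) (L b) → NCross (L i) N₁
        keeps₂ : ∀ i → NCross (L i) A → NCross (L i) (L b) → NCross (L i) N₂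
        self₁  : NCross (L b) N₁
        self₂  : NCross (L b) N₂

    uncrossed : ∀ A b → IsBiset A → 0ℤ ℤ.< h A → ¬ NCross A (L b) → Uncrossed A b
    uncrossed A b bA hA>0 crossing = by-skew (skew A B bA bB hA>0 (Tight-hpos (tL b)))
      where
      B : Biset n
      B = L b
      bB : IsBiset B
      bB = bL b
      by-skew : (h A ℤ.+ h B ℤ.≤ h (A ⊓ B) ℤ.+ h (A ⊔ B)) ⊎ (h A ℤ.+ h B ℤ.≤ h (A ∖ B) ℤ.+ h (B ∖ A)) → Uncrossed A b
      by-skew (inj₁ hi) = record
        { N₁ = A ⊓ B ; N₂ = A ⊔ B ; b₁ = IsBiset-⊓ {A = A} {B = B} bA bB ; b₂ = IsBiset-⊔ {A = A} {B = B} bA bB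
        ; step = record { fewer-edges = λ e → crossings-⊓⊔ A B bA bB (proj₁ (ends e)) (proj₂ (ends e)) ; more-demand = hi }
        ; keeps₁ = λ i pa pb → NCross-⊓ {C = L i} {A = A} {B = B} pa pb
        ; keeps₂ = λ i pa pb → NCross-⊔ {C = L i} {A = A} {B = B} (λ s → crossing (inj₁ s)) pa pb
        ; self₁ = NCross-self-⊓ {A = A} {B = B} ; self₂ = NCross-self-⊔ {A = A} {B = B} }
      by-skew (inj₂ hi) = record
        { N₁ = A ∖ B ; N₂ = B ∖ A ; b₁ = IsBiset-∖ {A = A} {B = B} bA bB ; b₂ = IsBiset-∖ {A = B} {B = A} bB bA
        ; step = record { fewer-edges = λ e → crossings-∖ A B bA bB (proj₁ (ends e)) (proj₂ (ends e)) ; more-demand = hi }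
        ; keeps₁ = λ i pa pb → NCross-∖ {C = L i} {A = A} {B = B} (λ s → crossing (inj₂ (inj₂ s))) pa pb
        ; keeps₂ = λ i pa pb → NCross-∖ {C = L i} {A = B} {B = A} (λ s → crossing (inj₂ (inj₁ s))) pb pa
        ; self₁ = NCross-self-∖₁ {A = A} {B = B} ; self₂ = NCross-self-∖₂ {A = A} {B = B} }

    fewer-crossings : ∀ A b N → ¬ NCross A (L b) →
      (∀ i → NCross (L i) A → NCross (L i) (L b) → NCross (L i) N) → NCross (L b) N →
      crossCount N ℕ.< crossCount A
    fewer-crossings A b N crossing keeps self =
      count-strict {P = λ i → not (ncᵇ N (L i))} {Q = λ i → not (ncᵇ A (L i))}
        (λ i N✗ → Tnot (λ A✓ → Tnot⁻ N✗ (NCross→ncᵇ {A = N} {B = L i} (NCross-sym {A = L i} {B = N}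
          (keeps i (NCross-sym {A = A} {B = L i} (ncᵇ→NCross {A = A} {B = L i} A✓)) (NC→NCross {A = L i} {B = L b} (lamL i b)))))))
        b (Tnot (λ A✓ → crossing (ncᵇ→NCross {A = A} {B = L b} A✓))) (λ N✗ → Tnot⁻ N✗ (NCross→ncᵇ {A = N} {B = L b} (NCross-sym {A = L b} {B = N} self)))

    -- By induction on crossCount: every active biset A of 𝒱 has d(δ_F(A)) = 0.
    -- If h(A) ≤ 0, A is crossed by no F-edge; if A crosses no member, use
    -- maximality; otherwise uncross A with a crossed member L b, using
    -- d(δ_F(A)) + d(δ_F(L b)) = d(δ_F(N₁)) + d(δ_F(N₂)) and induction.
    active-orthogonal : ∀ A → InV A → Active A → dotF d A ≡ 0ℚ
    active-orthogonal A = bounded (suc (crossCount A)) A ℕP.≤-refl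
      where
      bounded : ∀ bound A → crossCount A ℕ.< bound → InV A → Active A → dotF d A ≡ 0ℚ
      bounded zero    A () iv act
      bounded (suc c) A lt iv act with 0ℤ ℤP.<? h A
      ... | no  h≤0 = noFcross d A (zeroflow A (≤-trans (≤-reflexive act)
                         (≤-trans (hx≤h A) (toℚ-mono-≤ {h A} {0ℤ} (ℤP.≮⇒≥ h≤0)))))
      ... | yes h>0 with T? (anyFin (λ i → not (ncᵇ A (L i))))
      ...   | no none = noncrossing-orthogonal A iv act
                          (λ i → NCross→NC (ncᵇ→NCross {A = A} {B = L i} (¬Tnot⇒T (λ t → none (∃⇒anyFin _ i t)))))
      ...   | yes some with anyFin⇒∃ (λ i → not (ncᵇ A (L i))) some
      ...     | b , A✗b = begin
        dotF d A                             ≡⟨ sym (+-identityʳ (dotF d A)) ⟩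
        dotF d A + 0ℚ                        ≡⟨ cong (dotF d A +_) (sym (dL b)) ⟩
        dotF d A + dotF d (L b)              ≡⟨ sym (dotF-pair d A (L b) N₁ N₂ (proj₂ pieces)) ⟩
        dotF d N₁ + dotF d N₂                ≡⟨ cong₂ _+_ (piece N₁ b₁ (proj₁ (proj₁ pieces)) keeps₁ self₁)
                                                         (piece N₂ b₂ (proj₂ (proj₁ pieces)) keeps₂ self₂) ⟩
        0ℚ + 0ℚ                              ≡⟨ +-identityˡ 0ℚ ⟩
        0ℚ                                   ∎
        where
        open ≡-Reasoning
        crossing : ¬ NCross A (L b)
        crossing nc = Tnot⁻ A✗b (NCross→ncᵇ {A = A} {B = L b} nc)
        open Uncrossed (uncrossed A b (proj₁ iv) h>0 crossing)
        pieces : (Active N₁ × Active N₂) × (∀ e → T (F e) → pairCount e N₁ N₂ ≡ pairCount e A (L b))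
        pieces = uncross-active step act (Tight→Active (tL b)) b₁ b₂
        piece : ∀ N → IsBiset N → Active N →
                (∀ i → NCross (L i) A → NCross (L i) (L b) → NCross (L i) N) → NCross (L b) N → dotF d N ≡ 0ℚ
        piece N bN actN keeps self with nonempty? (proj₁ N)
        ... | yes ne = bounded c N (ℕP.<-≤-trans (fewer-crossings A b N crossing keeps self) (ℕP.≤-pred lt)) (bN , ne) actN
        ... | no ne  = noFcross d N (λ e fe → emptyNoCross N ne e)

-- Extremality of x makes the incidence vectors of L span all vectors on F.
module Rigidity {n m k : ℕ} (S : Situation n m k) where

  open import Defs hiding (_⊓_)
  open Rationals
  open Sums
  open Setting
  open import Data.Bool using (true; false; _∧_; T)
  open import Data.Nat as ℕ using (ℕ)
  open import Data.Rational as ℚ using (ℚ; 0ℚ; 1ℚ; ½; _+_; _*_; _-_; -_; _≤_; _<_; ∣_∣; _⊓_)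
  open import Data.Rational.Properties as ℚP
  open import Data.Rational.Solver
  open import Data.Fin using (Fin)
  open import Data.Product using (_,_; proj₁; proj₂)
  open import Data.Empty using (⊥-elim)
  open import Relation.Binary.PropositionalEquality
  open import Relation.Nullary using (¬_; yes; no)
  open +-*-Solver

  open Basics S
  open Uncrossing S using (module Orthogonal)

  -- For small c, x + c·d stays in P(h_x̄, 1): inactive constraints have slack
  -- at least μ, fractional coordinates are at distance at least μ from 0 and 1,
  -- and every change is bounded by ∣ c ∣ · (Σ ∣ d ∣ + 1).
  module Perturbation (d : Fin m → ℚ) (d-off-F : ∀ e → ¬ T (F e) → d e ≡ 0ℚ)
                      (d-active : ∀ A → InV A → Active A → dotF d A ≡ 0ℚ) where

    dδ : Biset n → ℚ
    dδ A = sumδ ends (allE ends) d A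

    dδ≡dotF : ∀ A → dδ A ≡ dotF d A
    dδ≡dotF A = sumℚ-cong (λ e → on-F e (F e) (d-off-F e))
      where on-F : ∀ e f → (¬ T f → d e ≡ 0ℚ) → ifq (cr e A) (d e) ≡ ifq (f ∧ cr e A) (d e)
            on-F e true  z = refl
            on-F e false z = trans (cong (ifq (cr e A)) (z (λ ()))) (ifq-0 (cr e A))

    bound : ℚ
    bound = sumℚ (λ e → ∣ d e ∣) + 1ℚ

    bound-pos : 0ℚ < bound
    bound-pos = <-≤-trans 0<1 (≤-trans (≤-reflexive (sym (+-identityˡ 1ℚ)))
                                 (+-monoˡ-≤ 1ℚ (sumℚ-nonneg (λ e → 0≤∣p∣ (d e)))))

    Σ∣d∣≤bound : sumℚ (λ e → ∣ d e ∣) ≤ bound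
    Σ∣d∣≤bound = ≤-trans (≤-reflexive (sym (+-identityʳ _))) (+-monoʳ-≤ (sumℚ (λ e → ∣ d e ∣)) (<⇒≤ 0<1))

    ∣d∣≤bound : ∀ e → ∣ d e ∣ ≤ bound
    ∣d∣≤bound e = ≤-trans (sumℚ-term (λ e → 0≤∣p∣ (d e)) e) Σ∣d∣≤bound

    ∣dotF∣≤bound : ∀ A → ∣ dotF d A ∣ ≤ bound
    ∣dotF∣≤bound A = ≤-trans (sumℚ-abs (λ e → ifq (F e ∧ cr e A) (d e)))
      (≤-trans (sumℚ-mono (λ e → ∣ifq∣≤∣∣ (F e ∧ cr e A) (d e))) Σ∣d∣≤bound)
      where ∣ifq∣≤∣∣ : ∀ b q → ∣ ifq b q ∣ ≤ ∣ q ∣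
            ∣ifq∣≤∣∣ true  q = ≤-refl
            ∣ifq∣≤∣∣ false q = 0≤∣p∣ q

    slack : Biset n → ℚ
    slack A = xδ A - hx A

    slack⁺ : Biset n → ℚ
    slack⁺ A with 0ℚ ℚP.<? slack A
    ... | yes _ = slack A
    ... | no  _ = 1ℚ

    slack⁺-pos : ∀ A → 0ℚ < slack⁺ A
    slack⁺-pos A with 0ℚ ℚP.<? slack A
    ... | yes p = p
    ... | no  _ = 0<1

    slack⁺-eq : ∀ A → 0ℚ < slack A → slack⁺ A ≡ slack A
    slack⁺-eq A p with 0ℚ ℚP.<? slack A
    ... | yes _ = refl
    ... | no ¬p = ⊥-elim (¬p p)

    room : Fin m → ℚ
    room e with F e
    ... | true  = x e ⊓ (1ℚ - x e)
    ... | false = 1ℚ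

    room-pos : ∀ e → 0ℚ < room e
    room-pos e with F e | F-pos e | F-lt1 e
    ... | true  | pos | lt1 = pos⊓pos (pos _) (p<q⇒0<q-p (lt1 _))
    ... | false | _   | _   = 0<1

    room≤x : ∀ e → T (F e) → room e ≤ x e
    room≤x e fe with F e
    ... | true = p⊓q≤p (x e) (1ℚ - x e)

    room≤1-x : ∀ e → T (F e) → room e ≤ 1ℚ - x e
    room≤1-x e fe with F e
    ... | true = p⊓q≤q (x e) (1ℚ - x e)

    μ-bisets : ℚ
    μ-bisets = minSubset n (λ X → minSubset n (λ Y → slack⁺ (X , Y)))

    μ : ℚ
    μ = μ-bisets ⊓ minFin room

    μ-pos : 0ℚ < μ
    μ-pos = pos⊓pos (minSubset-pos n _ (λ X → minSubset-pos n _ (λ Y → slack⁺-pos (X , Y))))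
                    (minFin-pos room room-pos)

    μ≤slack⁺ : ∀ A → μ ≤ slack⁺ A
    μ≤slack⁺ A = ≤-trans (p⊓q≤p μ-bisets (minFin room))
      (≤-trans (minSubset-≤ n _ (proj₁ A)) (minSubset-≤ n (λ Y → slack⁺ (proj₁ A , Y)) (proj₂ A)))

    μ≤room : ∀ e → μ ≤ room e
    μ≤room e = ≤-trans (p⊓q≤q μ-bisets (minFin room)) (minFin-≤ room e)

    module _ (c : ℚ) (small : ∣ c ∣ * bound ≤ μ) where

      y : Fin m → ℚ
      y e = x e + c * d e

      ∣c*∣≤μ : ∀ q → ∣ q ∣ ≤ bound → ∣ c * q ∣ ≤ μ
      ∣c*∣≤μ q hq = ≤-trans (≤-reflexive (∣p*q∣≡∣p∣*∣q∣ c q))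
        (≤-trans (*-monoˡ-≤-nonNeg ∣ c ∣ {{ℚ.nonNegative (0≤∣p∣ c)}} hq) small)

      y-off-F : ∀ e → ¬ T (F e) → y e ≡ x e
      y-off-F e nf = trans (cong (λ z → x e + c * z) (d-off-F e nf)) (trans (cong (x e +_) (*-zeroʳ c)) (+-identityʳ (x e)))

      y≥0 : ∀ e → 0ℚ ≤ y e
      y≥0 e with T? (F e)
        where open import Relation.Nullary.Decidable using (T?)
      ... | yes fe = ≤-trans (p≤q⇒0≤q-p (≤-trans (μ≤room e) (room≤x e fe))) (∣q∣≤r⇒a-r≤a+q {a = x e} (∣c*∣≤μ (d e) (∣d∣≤bound e)))
      ... | no nf  = ≤-trans (x≥0 e) (≤-reflexive (sym (y-off-F e nf)))

      y≤1 : ∀ e → y e ≤ 1ℚ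
      y≤1 e with T? (F e)
        where open import Relation.Nullary.Decidable using (T?)
      ... | yes fe = ≤-trans (∣q∣≤r⇒a+q≤a+r {a = x e} (∣c*∣≤μ (d e) (∣d∣≤bound e)))
                       (≤-trans (+-monoʳ-≤ (x e) (≤-trans (μ≤room e) (room≤1-x e fe)))
                         (≤-reflexive (solve 1 (λ a → a :+ (con 1ℚ :- a) := con 1ℚ) refl (x e))))
      ... | no nf  = ≤-trans (≤-reflexive (y-off-F e nf)) (x≤1 e)

      yδ : ∀ A → sumδ ends (allE ends) y A ≡ xδ A + c * dδ A
      yδ A = trans (sumℚ-cong (λ e → split (cr e A) e))
        (trans (sumℚ-+ (λ e → ifq (cr e A) (x e)) (λ e → c * ifq (cr e A) (d e)))
          (cong (xδ A +_) (sumℚ-* c (λ e → ifq (cr e A) (d e)))))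
        where split : ∀ b e → ifq b (y e) ≡ ifq b (x e) + c * ifq b (d e)
              split true  e = refl
              split false e = sym (trans (cong (0ℚ +_) (*-zeroʳ c)) (+-identityˡ 0ℚ))

      -- active constraints are unchanged; inactive ones have slack ≥ μ
      y-covers : ∀ A → InV A → hx A ≤ sumδ ends (allE ends) y A
      y-covers A iv with xδ A ℚP.≟ hx A | hx A ℚP.<? xδ A
      ... | yes act | _ = ≤-reflexive (sym (begin
        sumδ ends (allE ends) y A ≡⟨ yδ A ⟩
        xδ A + c * dδ A           ≡⟨ cong (λ z → xδ A + c * z) (trans (dδ≡dotF A) (d-active A iv act)) ⟩
        xδ A + c * 0ℚ             ≡⟨ cong (xδ A +_) (*-zeroʳ c) ⟩
        xδ A + 0ℚ                 ≡⟨ +-identityʳ (xδ A) ⟩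
        xδ A                      ≡⟨ act ⟩
        hx A                      ∎))
        where open ≡-Reasoning
      ... | no ¬act | no ¬lt = ⊥-elim (¬act (≤-antisym (≮⇒≥ ¬lt) (covers A iv)))
      ... | no ¬act | yes lt = ≤-trans (≤-reflexive (solve 2 (λ a b → b := a :- (a :- b)) refl (xδ A) (hx A)))
          (≤-trans (∣q∣≤r⇒a-r≤a+q {a = xδ A} (≤-trans (∣c*∣≤μ (dδ A) ∣dδ∣≤bound) μ≤slack))
            (≤-reflexive (sym (yδ A))))
        where
        μ≤slack : μ ≤ slack A
        μ≤slack = ≤-trans (μ≤slack⁺ A) (≤-reflexive (slack⁺-eq A (p<q⇒0<q-p lt)))
        ∣dδ∣≤bound : ∣ dδ A ∣ ≤ bound
        ∣dδ∣≤bound = ≤-trans (≤-reflexive (cong ∣_∣ (dδ≡dotF A))) (∣dotF∣≤bound A)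

      y∈P : InP ends hx (λ _ → 1) y
      y∈P = y≥0 , y≤1 , y-covers

    private instance
      bound-positive : ℚ.Positive bound
      bound-positive = ℚ.positive bound-pos
      bound-nonZero : ℚ.NonZero bound
      bound-nonZero = pos⇒nonZero bound

    ε : ℚ
    ε = μ * ℚ.1/ bound

    ε-pos : 0ℚ < ε
    ε-pos = positive⁻¹ ε {{pos*pos⇒pos μ {{ℚ.positive μ-pos}} (ℚ.1/ bound) {{1/pos⇒pos bound}}}}

    ε-small : ∣ ε ∣ * bound ≤ μ
    ε-small = ≤-reflexive (begin
      ∣ ε ∣ * bound               ≡⟨ cong (_* bound) (0≤p⇒∣p∣≡p (<⇒≤ ε-pos)) ⟩
      μ * ℚ.1/ bound * bound      ≡⟨ *-assoc μ (ℚ.1/ bound) bound ⟩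
      μ * (ℚ.1/ bound * bound)    ≡⟨ cong (μ *_) (*-inverseˡ bound) ⟩
      μ * 1ℚ                      ≡⟨ *-identityʳ μ ⟩
      μ                           ∎)
      where open ≡-Reasoning

    -ε-small : ∣ - ε ∣ * bound ≤ μ
    -ε-small = ≤-trans (≤-reflexive (cong (_* bound) (∣-p∣≡∣p∣ ε))) ε-small

    -- x is the midpoint of x + ε·d and x - ε·d, so extremality forces d = 0.
    vanishes : ∀ e → d e ≡ 0ℚ
    vanishes e with d e ℚP.≟ 0ℚ
    ... | yes z  = z
    ... | no d≢0 = ⊥-elim (d≢0 (p*q≡0⇒p≡0 twice-ε (λ z → <-irrefl (sym z) 2ε-pos)))
      where
      midpoint : ∀ e → x e ≡ ½ * y ε ε-small e + (1ℚ - ½) * y (- ε) -ε-small e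
      midpoint e = solve 3 (λ a c q → a := con ½ :* (a :+ c :* q) :+ (con 1ℚ :- con ½) :* (a :+ (:- c) :* q)) refl (x e) ε (d e)
      same : y ε ε-small e ≡ y (- ε) -ε-small e
      same = proj₂ extreme (y ε ε-small) (y (- ε) -ε-small) ½ (y∈P ε ε-small) (y∈P (- ε) -ε-small)
               (ℚ.*<* (ℤ.+<+ (ℕ.s≤s ℕ.z≤n))) (ℚ.*<* (ℤ.+<+ (ℕ.s≤s (ℕ.s≤s ℕ.z≤n)))) midpoint e
        where import Data.Integer as ℤ
      twice-ε : d e * (ε + ε) ≡ 0ℚ
      twice-ε = trans (solve 3 (λ a c q → q :* (c :+ c) := (a :+ c :* q) :- (a :+ (:- c) :* q)) refl (x e) ε (d e))
                  (trans (cong (_- y (- ε) -ε-small e) same) (+-inverseʳ (y (- ε) -ε-small e)))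
      2ε-pos : 0ℚ < ε + ε
      2ε-pos = <-respˡ-≡ (+-identityˡ 0ℚ) (+-mono-< ε-pos ε-pos)

  rigidity : ∀ (d : Fin m → ℚ) → (∀ e → ¬ T (F e) → d e ≡ 0ℚ) → (∀ j → dotF d (L j) ≡ 0ℚ) → ∀ e → d e ≡ 0ℚ
  rigidity d d-off-F dL = Perturbation.vanishes d d-off-F (Orthogonal.active-orthogonal d dL)

module Rank {n m k : ℕ} (S : Situation n m k) where

  open import Defs
  open Sums
  open LinearAlgebra
  open Setting
  open import Data.Bool using (true; false; _∧_; not; T)
  open import Data.Nat as ℕ using (ℕ; zero; suc)
  import Data.Nat.Properties as ℕP
  open import Data.Rational as ℚ using (0ℚ; 1ℚ; _*_)
  open import Data.Rational.Properties using (*-identityˡ; *-zeroˡ)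
  open import Data.Fin using (Fin; zero; suc)
  open import Data.List using (List; _∷_; length; map; _++_; tabulate)
  import Data.List.Properties as LP
  open import Data.List.Relation.Unary.All using (All; _∷_)
  import Data.List.Relation.Unary.All.Properties as AllP
  open import Data.Product using (_×_; _,_; ∃)
  open import Data.Empty using (⊥-elim)
  open import Relation.Binary.PropositionalEquality
  open import Relation.Nullary using (¬_; yes; no)

  open Basics S
  open Rigidity S using (rigidity)

  η : Fin k → Vecℚ m
  η j e = ifq (F e ∧ cr e (L j)) 1ℚ

  dot-η : ∀ j d → dot (η j) d ≡ dotF d (L j)
  dot-η j d = sumℚ-cong (λ e → ind-times (F e ∧ cr e (L j)) (d e))
    where ind-times : ∀ b q → ifq b 1ℚ * q ≡ ifq b q
          ind-times true  q = *-identityˡ q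
          ind-times false q = *-zeroˡ q

  -- |F| ≤ |L|: otherwise the k equations η_{F,L j}·d = 0 together with the
  -- m - |F| equations d(e) = 0 (e ∉ F) have a nonzero solution, contradicting
  -- rigidity.
  |F|≤k : countᵇ F ℕ.≤ k
  |F|≤k with countᵇ F ℕ.≤? k
  ... | yes p  = p
  ... | no F>k = no-solution (nontrivial-solution m rows few)
    where
    outside : List (Fin m)
    outside = listWhere (λ e → not (F e))
    rows : List (Vecℚ m)
    rows = tabulate η ++ map unit outside
    few : length rows ℕ.< m
    few = subst (ℕ._< m) (sym (trans (LP.length-++ (tabulate η))
            (cong₂ ℕ._+_ (LP.length-tabulate η) (trans (LP.length-map unit outside) (listWhere-length (λ e → not (F e)))))))
          (subst (k ℕ.+ countᵇ (λ e → not (F e)) ℕ.<_) (count-compl F) (ℕP.+-monoˡ-< _ (ℕP.≰⇒> F>k)))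
    no-solution : (∃ λ (d : Vecℚ m) → (∃ λ e → ¬ d e ≡ 0ℚ) × All (λ r → dot r d ≡ 0ℚ) rows) → countᵇ F ℕ.≤ k
    no-solution (d , (e , d≢0) , solves) = ⊥-elim (d≢0 (rigidity d d-off-F dL e))
      where
      d-off-F : ∀ e → ¬ T (F e) → d e ≡ 0ℚ
      d-off-F e nf = trans (sym (dot-unit e d))
        (listWhere-all {Q = λ e → dot (unit e) d ≡ 0ℚ} (λ e → not (F e)) (AllP.map⁻ (AllP.++⁻ʳ (tabulate η) solves)) e (Tnot nf))
      dL : ∀ j → dotF d (L j) ≡ 0ℚ
      dL j = trans (sym (dot-η j d)) (AllP.tabulate⁻ (AllP.++⁻ˡ (tabulate η) solves) j)

-- The structure of L: its members are distinct, each contains exactly one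
-- terminal, so members sharing a vertex are nested and every member has at
-- most one child; L is a disjoint union of chains.
module LaminarTree {n m k : ℕ} (S : Situation n m k) where

  open import Defs
  open Sums
  open BisetCalculus
  open Setting
  open import Data.Bool using (Bool; true; false; _∧_; T)
  open import Data.Nat as ℕ using (ℕ; zero; suc)
  import Data.Nat.Properties as ℕP
  open import Data.Rational as ℚ using (ℚ; 0ℚ; 1ℚ; _-_)
  open import Data.Rational.Properties using (+-inverseʳ; 1≢0)
  open import Data.Fin using (Fin)
  import Data.Fin.Properties as FP
  open import Data.Fin.Subset using (_∩_; ⁅_⁆)
  open import Data.Fin.Subset.Properties using (x∈⁅x⁆; x∈⁅y⁆⇒x≡y)
  open import Data.Vec using (lookup)
  open import Data.Product using (_×_; _,_; ∃; proj₁; proj₂)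
  open import Data.Sum using (_⊎_; inj₁; inj₂; [_,_])
  open import Data.Empty using (⊥; ⊥-elim)
  open import Relation.Binary.PropositionalEquality hiding ([_])
  open import Relation.Nullary using (¬_; Dec; yes; no)
  open import Relation.Nullary.Decidable using (⌊_⌋; T?)

  open Basics S

  L-in-C : ∀ j → InC Tm (L j)
  L-in-C j = h-in-C (L j) (bL j) (Tight-hpos (tL j))

  terminal : Fin k → Fin n
  terminal j = proj₁ (proj₂ (L-in-C j))

  terminal-inner : ∀ j → I (L j) (terminal j)
  terminal-inner j = mkI (T∧₁ (subst T (lk∩ (proj₁ (L j)) Tm (terminal j))
                      (subst (λ S → T (lookup S (terminal j))) (sym inner∩T) (∈→T (x∈⁅x⁆ (terminal j))))))
    where inner∩T = proj₁ (proj₂ (proj₂ (proj₂ (L-in-C j))))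

  terminal-∈T : ∀ j → T (lookup Tm (terminal j))
  terminal-∈T j = ∈→T (proj₁ (proj₂ (proj₂ (L-in-C j))))

  terminal-unique : ∀ j u → O (L j) u → T (lookup Tm u) → u ≡ terminal j
  terminal-unique j u o t = x∈⁅y⁆⇒x≡y (terminal j) (T→∈ (subst (λ S → T (lookup S u)) outer∩T
                              (subst T (sym (lk∩ (proj₂ (L j)) Tm u)) (T∧ (unO o) t))))
    where outer∩T = proj₂ (proj₂ (proj₂ (proj₂ (L-in-C j))))

  nested : ∀ a b u → I (L a) u → I (L b) u → Sub (L a) (L b) ⊎ Sub (L b) (L a)
  nested a b u ia ib with NC→NCross {A = L a} {B = L b} (lamL a b)
  ... | inj₁ sd = ⊥-elim (shared-inner⇒¬SDisj {A = L a} {B = L b} (bL b) u ia ib sd)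
  ... | inj₂ s  = s

  terminal-below : ∀ a j → Sub (L a) (L j) → I (L a) (terminal j)
  terminal-below a j (f , g) =
    subst (I (L a)) (terminal-unique j (terminal a) (g (terminal a) (I⇒O (bL a) (terminal-inner a))) (terminal-∈T a))
      (terminal-inner a)

  nested-below : ∀ a b j → Sub (L a) (L j) → Sub (L b) (L j) → Sub (L a) (L b) ⊎ Sub (L b) (L a)
  nested-below a b j sa sb = nested a b (terminal j) (terminal-below a j sa) (terminal-below b j sb)

  -- Members with the same F-incidence vector are equal, by independence of
  -- the vectors η_{F,L j} (take the coefficients δᵢ - δⱼ).
  η-injective : ∀ i j → (∀ e → T (F e) → cr e (L i) ≡ cr e (L j)) → i ≡ j
  η-injective i j same with i FP.≟ j
  ... | yes i≡j = i≡j
  ... | no  i≢j = ⊥-elim (1≢0 (trans (sym cᵢ≡1) (indL c dependence i)))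
    where
    δ : Fin k → Fin k → ℚ
    δ a l = ifq ⌊ a FP.≟ l ⌋ 1ℚ
    c : Fin k → ℚ
    c l = δ i l - δ j l
    pick : ∀ (f : Fin k → Bool) a → sumℚ (λ l → ifq (f l) (δ a l)) ≡ ifq (f a) 1ℚ
    pick f a = trans (sumℚ-single (λ l → ifq (f l) (δ a l)) a (λ l ne → off l (a FP.≟ l) (λ e → ne (sym e)))) (on (a FP.≟ a))
      where
      off : ∀ l (q : Dec (a ≡ l)) → ¬ a ≡ l → ifq (f l) (ifq ⌊ q ⌋ 1ℚ) ≡ 0ℚ
      off l (yes p) ne = ⊥-elim (ne p)
      off l (no _)  ne = ifq-0 (f l)
      on : (q : Dec (a ≡ a)) → ifq (f a) (ifq ⌊ q ⌋ 1ℚ) ≡ ifq (f a) 1ℚ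
      on (yes _) = refl
      on (no ne) = ⊥-elim (ne refl)
    dependence : ∀ e → T (F e) → sumℚ (λ l → ifq (cr e (L l)) (c l)) ≡ 0ℚ
    dependence e fe = begin
      sumℚ (λ l → ifq (cr e (L l)) (c l))
        ≡⟨ sumℚ-cong (λ l → ifq-- (cr e (L l)) (δ i l) (δ j l)) ⟩
      sumℚ (λ l → ifq (cr e (L l)) (δ i l) - ifq (cr e (L l)) (δ j l))
        ≡⟨ sumℚ-- (λ l → ifq (cr e (L l)) (δ i l)) (λ l → ifq (cr e (L l)) (δ j l)) ⟩
      sumℚ (λ l → ifq (cr e (L l)) (δ i l)) - sumℚ (λ l → ifq (cr e (L l)) (δ j l))
        ≡⟨ cong₂ _-_ (pick (λ l → cr e (L l)) i) (pick (λ l → cr e (L l)) j) ⟩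
      ifq (cr e (L i)) 1ℚ - ifq (cr e (L j)) 1ℚ
        ≡⟨ cong (λ b → ifq b 1ℚ - ifq (cr e (L j)) 1ℚ) (same e fe) ⟩
      ifq (cr e (L j)) 1ℚ - ifq (cr e (L j)) 1ℚ
        ≡⟨ +-inverseʳ (ifq (cr e (L j)) 1ℚ) ⟩
      0ℚ ∎
      where
      open ≡-Reasoning
      ifq-- : ∀ b p q → ifq b (p - q) ≡ ifq b p - ifq b q
      ifq-- true  p q = refl
      ifq-- false p q = sym (+-inverseʳ 0ℚ)
    cᵢ≡1 : c i ≡ 1ℚ
    cᵢ≡1 with i FP.≟ i | j FP.≟ i
    ... | yes _ | no _    = refl
    ... | no ¬p | _       = ⊥-elim (¬p refl)
    ... | yes _ | yes j≡i = ⊥-elim (i≢j (sym j≡i))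

  mutual-Sub⇒≡ : ∀ a b → Sub (L a) (L b) → Sub (L b) (L a) → a ≡ b
  mutual-Sub⇒≡ a b s s' = η-injective a b (λ e fe → cong (cr e) (Sub-antisym s s'))

  Strict : Fin k → Fin k → Set
  Strict a b = Sub (L a) (L b) × ¬ Sub (L b) (L a)

  Sub⇒≡ : ∀ a b → Sub (L a) (L b) → ¬ Strict a b → a ≡ b
  Sub⇒≡ a b s ¬st with Sub? (L b) (L a)
  ... | yes s' = mutual-Sub⇒≡ a b s s'
  ... | no ns  = ⊥-elim (¬st (s , ns))

  ⊏ᵇ→Strict : ∀ a b → T (L a ⊏ᵇ L b) → Strict a b
  ⊏ᵇ→Strict a b t = ⊑ᵇ→Sub {A = L a} {B = L b} (T∧₁ t) ,
                    (λ s → Tnot⁻ (T∧₂ {L a ⊑ᵇ L b} t) (Sub→⊑ᵇ {A = L b} {B = L a} s))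

  Strict→⊏ᵇ : ∀ a b → Strict a b → T (L a ⊏ᵇ L b)
  Strict→⊏ᵇ a b (s , ns) = T∧ (Sub→⊑ᵇ {A = L a} {B = L b} s) (Tnot (λ t → ns (⊑ᵇ→Sub {A = L b} {B = L a} t)))

  size-< : ∀ a b → Strict a b → size (L a) ℕ.< size (L b)
  size-< a b (s , ns) = size-strict {A = L a} {B = L b} s ns

  isCh : Fin k → Fin k → Bool
  isCh = isChild ends L

  isMax : Fin k → Bool
  isMax = isMaximal ends L

  child-strict : ∀ c j → T (isCh c j) → Strict c j
  child-strict c j t = ⊏ᵇ→Strict c j (T∧₁ t)

  child-no-between : ∀ c j → T (isCh c j) → ∀ l → Strict c l → Strict l j → ⊥
  child-no-between c j t l s1 s2 = Tnot⁻ (T∧₂ {L c ⊏ᵇ L j} t)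
    (∃⇒anyFin (λ l → (L c ⊏ᵇ L l) ∧ (L l ⊏ᵇ L j)) l (T∧ (Strict→⊏ᵇ c l s1) (Strict→⊏ᵇ l j s2)))

  not-child⇒between : ∀ a j → Strict a j → ¬ T (isCh a j) → ∃ λ l → Strict a l × Strict l j
  not-child⇒between a j st nc with anyFin⇒∃ (λ l → (L a ⊏ᵇ L l) ∧ (L l ⊏ᵇ L j))
                                   (¬Tnot⇒T (λ t → nc (T∧ (Strict→⊏ᵇ a j st) t)))
  ... | l , t = l , ⊏ᵇ→Strict a l (T∧₁ t) , ⊏ᵇ→Strict l j (T∧₂ {L a ⊏ᵇ L l} t)

  maximal-top : ∀ M → T (isMax M) → ∀ j → ¬ Strict M j
  maximal-top M t j s = Tnot⁻ t (∃⇒anyFin (λ j → L M ⊏ᵇ L j) j (Strict→⊏ᵇ M j s))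

  not-maximal⇒above : ∀ M → ¬ T (isMax M) → ∃ λ j → Strict M j
  not-maximal⇒above M nm with anyFin⇒∃ (λ j → L M ⊏ᵇ L j) (¬Tnot⇒T nm)
  ... | j , t = j , ⊏ᵇ→Strict M j t

  above-maximal : ∀ M a → T (isMax M) → Sub (L M) (L a) → Sub (L a) (L M)
  above-maximal M a tM s = subst (λ i → Sub (L a) (L i)) (sym (Sub⇒≡ M a s (maximal-top M tM a))) Sub-refl

  maximal-unique : ∀ i i' w → T (isMax i) → T (isMax i') → I (L i) w → I (L i') w → i ≡ i'
  maximal-unique i i' w ti ti' a b =
    [ (λ s → Sub⇒≡ i i' s (maximal-top i ti i')) , (λ s → sym (Sub⇒≡ i' i s (maximal-top i' ti' i))) ] (nested i i' w a b)

  child-unique : ∀ c c' j → T (isCh c j) → T (isCh c' j) → c ≡ c'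
  child-unique c c' j t t' =
    [ (λ s → Sub⇒≡ c c' s (λ st → child-no-between c j t c' st (child-strict c' j t'))) ,
      (λ s → sym (Sub⇒≡ c' c s (λ st → child-no-between c' j t' c st (child-strict c j t)))) ]
    (nested-below c c' j (proj₁ (child-strict c j t)) (proj₁ (child-strict c' j t')))

  child-above : ∀ a j → Strict a j → ∃ λ c → T (isCh c j) × Sub (L a) (L c)
  child-above a j st = go (size (L j)) a (ℕP.m≤n+m (size (L j)) (size (L a))) st
    where
    go : ∀ gap a → size (L j) ℕ.≤ size (L a) ℕ.+ gap → Strict a j → ∃ λ c → T (isCh c j) × Sub (L a) (L c)
    go zero a le st = ⊥-elim (ℕP.<-irrefl refl (ℕP.<-≤-trans (size-< a j st) (ℕP.≤-trans le (ℕP.≤-reflexive (ℕP.+-identityʳ _)))))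
    go (suc gap) a le st with T? (isCh a j)
    ... | yes t = a , t , Sub-refl
    ... | no nt with not-child⇒between a j st nt
    ...   | l , al , lj with go gap l (ℕP.≤-trans le (ℕP.≤-trans (ℕP.≤-reflexive (ℕP.+-suc (size (L a)) gap))
                                         (ℕP.+-monoˡ-≤ gap (size-< a l al)))) lj
    ...     | c , tc , lc = c , tc , Sub-trans (proj₁ al) lc

  maximal-above : ∀ j → ∃ λ M → T (isMax M) × Sub (L j) (L M)
  maximal-above j = go (n ℕ.+ n) j (ℕP.m≤n+m (n ℕ.+ n) (size (L j)))
    where
    go : ∀ gap j → n ℕ.+ n ℕ.≤ size (L j) ℕ.+ gap → ∃ λ M → T (isMax M) × Sub (L j) (L M)
    go gap j le with T? (isMax j)
    ... | yes t = j , t , Sub-refl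
    ... | no nt with not-maximal⇒above j nt | gap
    ...   | l , jl | zero = ⊥-elim (ℕP.<-irrefl refl (ℕP.<-≤-trans (ℕP.≤-<-trans
                               (ℕP.≤-trans le (ℕP.≤-reflexive (ℕP.+-identityʳ _))) (size-< j l jl)) (size-bound (L l))))
    ...   | l , jl | suc gap' with go gap' l (ℕP.≤-trans le (ℕP.≤-trans (ℕP.≤-reflexive (ℕP.+-suc (size (L j)) gap'))
                                               (ℕP.+-monoˡ-≤ gap' (size-< j l jl))))
    ...     | M , tM , lM = M , tM , Sub-trans (proj₁ jl) lM

-- Each F-edge e gives a token to L j for each of the roles
-- e ∈ F⁺(L j) and e ∈ F⁻(L j).  Then Σ_j (|F⁺(L j)| + |F⁻(L j)|) is the total
-- number of tokens, and every edge hands out at most two tokens.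
module Tokens {n m k : ℕ} (S : Situation n m k) where

  open import Defs
  open Sums
  open BisetCalculus
  open Setting
  open import Data.Bool using (Bool; true; false; _∧_; _∨_; not; T)
  open import Data.Bool.Properties using (∨-comm)
  open import Data.Nat as ℕ using (ℕ)
  import Data.Nat.Properties as ℕP
  open import Data.Fin using (Fin)
  open import Data.Vec using (lookup)
  open import Data.Product using (_×_; _,_; ∃; proj₁; proj₂)
  open import Data.Sum using (_⊎_; inj₁; inj₂)
  open import Data.Empty using (⊥; ⊥-elim)
  open import Data.Unit using (tt)
  open import Relation.Binary.PropositionalEquality
  open import Relation.Nullary using (¬_; yes; no)
  open import Relation.Nullary.Decidable using (T?)

  open Basics S
  open LaminarTree S

  childCrossed : Fin k → Fin m → Bool
  childCrossed j e = inChildCut ends L F j e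

  plusToken : Fin m → Fin k → Bool
  plusToken e j = F e ∧ cr e (L j) ∧ not (childCrossed j e)

  minusToken : Fin m → Fin k → Bool
  minusToken e j = F e ∧ childCrossed j e ∧ not (cr e (L j))

  tokens : Fin m → ℕ
  tokens e = sumℕ (λ j → ind (plusToken e j) ℕ.+ ind (minusToken e j))

  tokens-total : sumℕ (λ j → Fplus ends L F j ℕ.+ Fminus ends L F j) ≡ sumℕ tokens
  tokens-total = trans (sumℕ-cong (λ j → sym (sumℕ-+ (λ e → ind (plusToken e j)) (λ e → ind (minusToken e j)))))
                       (sumℕ-swap (λ j e → ind (plusToken e j) ℕ.+ ind (minusToken e j)))

  -- Fix an edge e with ends u, v (in either order) and count the tokens for
  -- which e crosses in the direction u → v.
  module Direction (e : Fin m) (u v : Fin n) (cr-split : ∀ A → cr e A ≡ crossesFrom u v A ∨ crossesFrom v u A) where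

    Dir : Biset n → Set
    Dir A = I A u × ¬ O A v

    T→Dir : ∀ A → T (crossesFrom u v A) → Dir A
    T→Dir A t = mkI (T∧₁ t) , (λ o → Tnot⁻ (T∧₂ {lookup (proj₁ A) u} t) (unO o))

    Dir→T : ∀ A → Dir A → T (crossesFrom u v A)
    Dir→T A (i , nov) = T∧ (unI i) (Tnot (λ t → nov (mkO t)))

    Dir→cr : ∀ A → Dir A → T (cr e A)
    Dir→cr A c = subst T (sym (cr-split A)) (T∨₁ (Dir→T A c))

    ¬cr⇒O : ∀ A → ¬ T (cr e A) → I A u → O A v
    ¬cr⇒O A ncr i with T? (lookup (proj₂ A) v)
    ... | yes t = mkO t
    ... | no nt = ⊥-elim (ncr (Dir→cr A (i , (λ o → nt (unO o)))))

    plusDir : Fin k → Bool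
    plusDir j = crossesFrom u v (L j) ∧ not (childCrossed j e)

    childDir : Fin k → Bool
    childDir j = anyFin (λ i → isCh i j ∧ crossesFrom u v (L i))

    minusDir : Fin k → Bool
    minusDir j = childDir j ∧ not (cr e (L j))

    -- Two members crossed u → v are nested; the larger one has a child
    -- containing the smaller, and that child is crossed too.
    plusDir-unique : ∀ a b → T (plusDir a) → T (plusDir b) → a ≡ b
    plusDir-unique a b ta tb = by-nesting (nested a b u (proj₁ da) (proj₁ db))
      where
      da : Dir (L a)
      da = T→Dir (L a) (T∧₁ ta)
      db : Dir (L b)
      db = T→Dir (L b) (T∧₁ tb)
      below : ∀ a b → Dir (L a) → Dir (L b) → ¬ T (childCrossed b e) → Sub (L a) (L b) → a ≡ b
      below a b da db nb s = Sub⇒≡ a b s strict-impossible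
        where
        strict-impossible : ¬ Strict a b
        strict-impossible st with child-above a b st
        ... | c , tc , ac = nb (∃⇒anyFin (λ i → isCh i b ∧ cr e (L i)) c (T∧ tc (Dir→cr (L c) dc)))
          where dc : Dir (L c)
                dc = proj₁ ac u (proj₁ da) , (λ o → proj₂ db (proj₂ (proj₁ (child-strict c b tc)) v o))
      by-nesting : Sub (L a) (L b) ⊎ Sub (L b) (L a) → a ≡ b
      by-nesting (inj₁ s) = below a b da db (Tnot⁻ (T∧₂ {crossesFrom u v (L b)} tb)) s
      by-nesting (inj₂ s) = sym (below b a db da (Tnot⁻ (T∧₂ {crossesFrom u v (L a)} ta)) s)

    MinusWitness : Fin k → Set
    MinusWitness a = ∃ λ c → T (isCh c a) × Dir (L c) × O (L a) v × I (L a) u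

    minusWitness : ∀ a → T (minusDir a) → MinusWitness a
    minusWitness a t with anyFin⇒∃ (λ i → isCh i a ∧ crossesFrom u v (L i)) (T∧₁ t)
    ... | c , tc = c , T∧₁ tc , dc , ¬cr⇒O (L a) (Tnot⁻ (T∧₂ {childDir a} t)) ia , ia
      where dc = T→Dir (L c) (T∧₂ {isCh c a} tc)
            ia = proj₁ (proj₁ (child-strict c a (T∧₁ tc))) u (proj₁ dc)

    minusDir-unique : ∀ a b → T (minusDir a) → T (minusDir b) → a ≡ b
    minusDir-unique a b ta tb = by-nesting (nested a b u (proj₂ (proj₂ (proj₂ (proj₂ wa)))) (proj₂ (proj₂ (proj₂ (proj₂ wb)))))
      where
      wa : MinusWitness a
      wa = minusWitness a ta
      wb : MinusWitness b
      wb = minusWitness b tb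
      -- if L a ⊊ L b, then L a lies between the child c' of L b and L b,
      -- or contains c', which then would contain v
      below : ∀ a b → MinusWitness a → MinusWitness b → Sub (L a) (L b) → a ≡ b
      below a b (c , tc , dc , oa , ia) (c' , tc' , dc' , ob , ib) s = Sub⇒≡ a b s strict-impossible
        where
        strict-impossible : ¬ Strict a b
        strict-impossible st = by-nesting' (nested c' a u (proj₁ dc') ia)
          where
          by-nesting' : Sub (L c') (L a) ⊎ Sub (L a) (L c') → ⊥
          by-nesting' (inj₂ ac') = proj₂ dc' (proj₂ ac' v oa)
          by-nesting' (inj₁ c'a) with Sub? (L a) (L c')
          ... | yes ac' = proj₂ dc' (proj₂ ac' v oa)
          ... | no ¬ac' = child-no-between c' b tc' a (c'a , ¬ac') st
      by-nesting : Sub (L a) (L b) ⊎ Sub (L b) (L a) → a ≡ b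
      by-nesting (inj₁ s) = below a b wa wb s
      by-nesting (inj₂ s) = sym (below b a wb wa s)

    minusDir⇒¬opposite : ∀ a → T (minusDir a) → ∀ b → ¬ T (crossesFrom v u (L b))
    minusDir⇒¬opposite a ta b t = from-witness (minusWitness a ta)
      where
      ibv : I (L b) v
      ibv = mkI (T∧₁ t)
      ¬obu : ¬ O (L b) u
      ¬obu o = Tnot⁻ (T∧₂ {lookup (proj₁ (L b)) v} t) (unO o)
      -- L b contains v but not u, while the child c contains u but not v,
      -- and L a contains u with v in its outer part
      from-witness : MinusWitness a → ⊥
      from-witness (c , tc , dc , oa , ia) = by-laminarity (NC→NCross {A = L b} {B = L a} (lamL b a))
        where
        by-nesting : Sub (L b) (L c) ⊎ Sub (L c) (L b) → ⊥
        by-nesting (inj₁ s) = proj₂ dc (I⇒O (bL c) (proj₁ s v ibv))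
        by-nesting (inj₂ s) = ¬obu (I⇒O (bL b) (proj₁ s u (proj₁ dc)))
        by-laminarity : NCross (L b) (L a) → ⊥
        by-laminarity (inj₁ (f , g))   = f v ibv oa
        by-laminarity (inj₂ (inj₁ s)) = by-nesting (nested-below b c a s (proj₁ (child-strict c a tc)))
        by-laminarity (inj₂ (inj₂ s)) = ¬obu (I⇒O (bL b) (proj₁ s u ia))

    minusDir⇒¬oppositeChild : ∀ a → T (minusDir a) → ∀ b → ¬ T (anyFin (λ i → isCh i b ∧ crossesFrom v u (L i)))
    minusDir⇒¬oppositeChild a ta b t with anyFin⇒∃ (λ i → isCh i b ∧ crossesFrom v u (L i)) t
    ... | c , tc = minusDir⇒¬opposite a ta c (T∧₂ {isCh c b} tc)

  module TokenBound (e : Fin m) where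
    u v : Fin n
    u = proj₁ (ends e)
    v = proj₂ (ends e)
    module U→V = Direction e u v (λ A → refl)
    module V→U = Direction e v u (λ A → ∨-comm (crossesFrom u v A) (crossesFrom v u A))

    plus-split : ∀ j → ind (plusToken e j) ℕ.≤ ind (U→V.plusDir j) ℕ.+ ind (V→U.plusDir j)
    plus-split j = split (F e) (crossesFrom u v (L j)) (crossesFrom v u (L j)) (not (childCrossed j e))
      where
      split : ∀ f a b c → ind (f ∧ (a ∨ b) ∧ c) ℕ.≤ ind (a ∧ c) ℕ.+ ind (b ∧ c)
      split false a     b     c     = ℕ.z≤n
      split true  true  b     true  = ℕ.s≤s ℕ.z≤n
      split true  true  b     false = ℕ.z≤n
      split true  false true  true  = ℕ.s≤s ℕ.z≤n
      split true  false true  false = ℕ.z≤n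
      split true  false false c     = ℕ.z≤n

    minus-split : ∀ j → ind (minusToken e j) ℕ.≤ ind (U→V.minusDir j) ℕ.+ ind (V→U.minusDir j)
    minus-split j = split (F e) (childCrossed j e) (U→V.childDir j) (V→U.childDir j) (not (cr e (L j))) child-dir
      where
      split : ∀ f i a b c → (T i → T a ⊎ T b) → ind (f ∧ i ∧ c) ℕ.≤ ind (a ∧ c) ℕ.+ ind (b ∧ c)
      split false i     a     b     c     h = ℕ.z≤n
      split true  false a     b     c     h = ℕ.z≤n
      split true  true  a     b     false h = ℕ.z≤n
      split true  true  true  b     true  h = ℕ.s≤s ℕ.z≤n
      split true  true  false true  true  h = ℕP.≤-refl
      split true  true  false false true  h with h tt
      ... | inj₁ ()
      ... | inj₂ ()
      child-dir : T (childCrossed j e) → T (U→V.childDir j) ⊎ T (V→U.childDir j)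
      child-dir t with anyFin⇒∃ (λ i → isCh i j ∧ cr e (L i)) t
      ... | i , ti with T∨ {crossesFrom u v (L i)} (T∧₂ {isCh i j} ti)
      ...   | inj₁ a = inj₁ (∃⇒anyFin (λ i → isCh i j ∧ crossesFrom u v (L i)) i (T∧ (T∧₁ {isCh i j} ti) a))
      ...   | inj₂ b = inj₂ (∃⇒anyFin (λ i → isCh i j ∧ crossesFrom v u (L i)) i (T∧ (T∧₁ {isCh i j} ti) b))

    tokens-by-direction : tokens e ℕ.≤ (countᵇ U→V.plusDir ℕ.+ countᵇ V→U.plusDir) ℕ.+ (countᵇ U→V.minusDir ℕ.+ countᵇ V→U.minusDir)
    tokens-by-direction = ℕP.≤-trans (sumℕ-mono (λ j → ℕP.+-mono-≤ (plus-split j) (minus-split j)))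
      (ℕP.≤-reflexive (trans (sumℕ-+ (λ j → ind (U→V.plusDir j) ℕ.+ ind (V→U.plusDir j)) (λ j → ind (U→V.minusDir j) ℕ.+ ind (V→U.minusDir j)))
        (cong₂ ℕ._+_ (sumℕ-+ (λ j → ind (U→V.plusDir j)) (λ j → ind (V→U.plusDir j)))
                     (sumℕ-+ (λ j → ind (U→V.minusDir j)) (λ j → ind (V→U.minusDir j))))))

    tokens≤2 : tokens e ℕ.≤ 2
    tokens≤2 = ℕP.≤-trans tokens-by-direction (≤2-of-4
      (count-le1 U→V.plusDir U→V.plusDir-unique) (count-le1 V→U.plusDir V→U.plusDir-unique)
      (count-le1 U→V.minusDir U→V.minusDir-unique) (count-le1 V→U.minusDir V→U.minusDir-unique)
      cases)
      where
      none : ∀ P → ¬ T (anyFin P) → countᵇ P ≡ 0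
      none P nt = count-none P (λ b tb → nt (∃⇒anyFin P b tb))
      cases : (countᵇ V→U.plusDir ≡ 0 × countᵇ V→U.minusDir ≡ 0) ⊎
              (countᵇ U→V.plusDir ≡ 0 × countᵇ U→V.minusDir ≡ 0) ⊎
              (countᵇ U→V.minusDir ≡ 0 × countᵇ V→U.minusDir ≡ 0)
      cases with T? (anyFin U→V.minusDir) | T? (anyFin V→U.minusDir)
      ... | yes t | _ with anyFin⇒∃ U→V.minusDir t
      ...   | a , ta = inj₁ (count-none V→U.plusDir (λ b tb → U→V.minusDir⇒¬opposite a ta b (T∧₁ tb)) ,
                             count-none V→U.minusDir (λ b tb → U→V.minusDir⇒¬oppositeChild a ta b (T∧₁ tb)))
      cases | no nt | yes t with anyFin⇒∃ V→U.minusDir t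
      ...   | a , ta = inj₂ (inj₁ (count-none U→V.plusDir (λ b tb → V→U.minusDir⇒¬opposite a ta b (T∧₁ tb)) ,
                                   none U→V.minusDir nt))
      cases | no nt | no nt' = inj₂ (inj₂ (none U→V.minusDir nt , none V→U.minusDir nt'))

    tokens-off-F : ¬ T (F e) → tokens e ≡ 0
    tokens-off-F nf = trans (sumℕ-cong (λ j → cong₂ ℕ._+_ (ind-F {plusToken e j} (λ t → nf (T∧₁ t)))
                                                           (ind-F {minusToken e j} (λ t → nf (T∧₁ t)))))
                            (sumℕ-0 {k})

  tokens≤2[F] : ∀ e → tokens e ℕ.≤ ind (F e) ℕ.+ ind (F e)
  tokens≤2[F] e with T? (F e)
  ... | yes fe rewrite ind-T {F e} fe = TokenBound.tokens≤2 e
  ... | no nf  rewrite ind-F {F e} nf = ℕP.≤-reflexive (TokenBound.tokens-off-F e nf)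

-- Every member of L receives at least two tokens: |F⁺(L j)| + |F⁻(L j)| ≥ 2.
-- Write x(δ_F(L j)) = x(δ_F(child)) + net x j with net y j = y(F⁺) - y(F⁻).
-- Both flows are integers, so net x j is one.  For z = 2x - 1, which has
-- ∣ z e ∣ < 1 on F, net z j = 2 net x j - (p - q) with p = |F⁺|, q = |F⁻|,
-- and ∣ net z j ∣ < p + q; this is impossible for p + q = 1, and forces
-- net z j = 0 for p + q = 2.  If p + q = 0, L j and its child (or no set, if
-- there is no child) have the same F-incidence vector.
module MemberTokens {n m k : ℕ} (S : Situation n m k) where

  open import Defs
  open Rationals
  open Parity
  open Sums
  open BisetCalculus
  open Setting
  open import Data.Bool using (true; false; _∧_; not; T)
  open import Data.Nat as ℕ using (ℕ; suc)
  import Data.Nat.Properties as ℕP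
  open import Data.Integer as ℤ using (ℤ)
  open import Data.Rational as ℚ using (ℚ; 0ℚ; 1ℚ; _+_; _-_; -_; _≤_; _<_; ∣_∣)
  open import Data.Rational.Properties
  open import Data.Rational.Solver
  open import Data.Fin using (Fin)
  open import Data.Product using (_×_; _,_; ∃; proj₁; proj₂)
  open import Data.Sum using (_⊎_; inj₁; inj₂)
  open import Data.Empty using (⊥; ⊥-elim)
  open import Relation.Binary.PropositionalEquality
  open import Relation.Nullary using (¬_; yes; no)
  open import Relation.Nullary.Decidable using (T?)
  open +-*-Solver

  open Basics S
  open LaminarTree S
  open Tokens S

  p q : Fin k → ℕ
  p j = Fplus ends L F j
  q j = Fminus ends L F j

  net : (Fin m → ℚ) → Fin k → ℚ
  net y j = sumℚ (λ e → ifq (plusToken e j) (y e) - ifq (minusToken e j) (y e))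

  -- y(δ_F of the child of L j), or 0 if L j has no child
  childFlow : (Fin m → ℚ) → Fin k → ℚ
  childFlow y j = sumℚ (λ e → ifq (F e ∧ childCrossed j e) (y e))

  flow-split : ∀ y j → sumδ ends F y (L j) ≡ childFlow y j + net y j
  flow-split y j = trans (sumℚ-cong (λ e → split (F e) (cr e (L j)) (childCrossed j e) (y e)))
    (sumℚ-+ (λ e → ifq (F e ∧ childCrossed j e) (y e)) (λ e → ifq (plusToken e j) (y e) - ifq (minusToken e j) (y e)))
    where
    split : ∀ f a b q → ifq (f ∧ a) q ≡ ifq (f ∧ b) q + (ifq (f ∧ a ∧ not b) q - ifq (f ∧ b ∧ not a) q)
    split false a     b     q = solve 0 (con 0ℚ := con 0ℚ :+ (con 0ℚ :- con 0ℚ)) refl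
    split true  true  true  q = solve 1 (λ q → q := q :+ (con 0ℚ :- con 0ℚ)) refl q
    split true  true  false q = solve 1 (λ q → q := con 0ℚ :+ (q :- con 0ℚ)) refl q
    split true  false true  q = solve 1 (λ q → con 0ℚ := q :+ (con 0ℚ :- q)) refl q
    split true  false false q = solve 0 (con 0ℚ := con 0ℚ :+ (con 0ℚ :- con 0ℚ)) refl

  data ChildCase (j : Fin k) : Set where
    hasChild : ∀ c → T (isCh c j) → ChildCase j
    noChild  : (∀ i → ¬ T (isCh i j)) → ChildCase j

  childCase : ∀ j → ChildCase j
  childCase j with T? (anyFin (λ i → isCh i j))
  ... | yes t = hasChild (proj₁ (anyFin⇒∃ (λ i → isCh i j) t)) (proj₂ (anyFin⇒∃ (λ i → isCh i j) t))
  ... | no nt = noChild (λ i ti → nt (∃⇒anyFin (λ i → isCh i j) i ti))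

  childCrossed-child : ∀ c j → T (isCh c j) → ∀ e → childCrossed j e ≡ cr e (L c)
  childCrossed-child c j tc e = T-ext to (λ t → ∃⇒anyFin (λ i → isCh i j ∧ cr e (L i)) c (T∧ tc t))
    where
    to : T (childCrossed j e) → T (cr e (L c))
    to t with anyFin⇒∃ (λ i → isCh i j ∧ cr e (L i)) t
    ... | i , ti = subst (λ i → T (cr e (L i))) (child-unique i c j (T∧₁ {isCh i j} ti) tc) (T∧₂ {isCh i j} ti)

  childFlow-child : ∀ c j → T (isCh c j) → ∀ y → childFlow y j ≡ sumδ ends F y (L c)
  childFlow-child c j tc y = sumℚ-cong (λ e → cong (λ b → ifq (F e ∧ b) (y e)) (childCrossed-child c j tc e))

  childFlow-none : ∀ j → (∀ i → ¬ T (isCh i j)) → ∀ y → childFlow y j ≡ 0ℚ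
  childFlow-none j nc y = sumℚ-zero (λ e → ifq-F (y e) (λ t → no-child-crossed e (T∧₂ {F e} t)))
    where no-child-crossed : ∀ e → ¬ T (childCrossed j e)
          no-child-crossed e t = nc (proj₁ (anyFin⇒∃ _ t)) (T∧₁ (proj₂ (anyFin⇒∃ (λ i → isCh i j ∧ cr e (L i)) t)))

  flow-int : ∀ j → IsInt (sumδ ends F x (L j))
  flow-int j = subst IsInt (sym (proj₁ (proj₂ (tL j)))) (int-- (hShift ends h x̄ (L j) , refl) (ℤ.+ sizeδ ends E1 (L j) , refl))

  childFlow-int : ∀ j → IsInt (childFlow x j)
  childFlow-int j with childCase j
  ... | hasChild c tc = subst IsInt (sym (childFlow-child c j tc x)) (flow-int c)
  ... | noChild nc    = subst IsInt (sym (childFlow-none j nc x)) int-0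

  net-int : ∀ j → IsInt (net x j)
  net-int j = subst IsInt (trans (cong (_- childFlow x j) (flow-split x j))
                               (solve 2 (λ b w → (b :+ w) :- b := w) refl (childFlow x j) (net x j)))
                (int-- (flow-int j) (childFlow-int j))

  z : Fin m → ℚ
  z e = (x e + x e) - 1ℚ

  ∣z∣<1 : ∀ e → T (F e) → ∣ z e ∣ < 1ℚ
  ∣z∣<1 e fe with ∣p∣≡p∨∣p∣≡-p (z e)
  ... | inj₁ eq = <-respˡ-≡ (sym eq) (0<q-p⇒p<q (<-respʳ-≡
        (solve 1 (λ a → (con 1ℚ :- a) :+ (con 1ℚ :- a) := con 1ℚ :- ((a :+ a) :- con 1ℚ)) refl (x e))
        (+-mono-< (p<q⇒0<q-p (F-lt1 e fe)) (p<q⇒0<q-p (F-lt1 e fe)))))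
  ... | inj₂ eq = <-respˡ-≡ (sym eq) (0<q-p⇒p<q (<-respʳ-≡
        (solve 1 (λ a → a :+ a := con 1ℚ :- (:- ((a :+ a) :- con 1ℚ))) refl (x e))
        (<-respˡ-≡ (+-identityˡ 0ℚ) (+-mono-< (F-pos e fe) (F-pos e fe)))))

  net-z : ∀ j → net z j ≡ (net x j + net x j) - (ℕℚ (p j) - ℕℚ (q j))
  net-z j = begin
    sumℚ (λ e → ifq (P e) (z e) - ifq (M e) (z e))
      ≡⟨ sumℚ-cong (λ e → trans (cong₂ _-_ (ifq-z (P e) (x e)) (ifq-z (M e) (x e)))
            (solve 4 (λ a b c d → ((a :+ a) :- c) :- ((b :+ b) :- d) := ((a :- b) :+ (a :- b)) :- (c :- d)) refl
              (ifq (P e) (x e)) (ifq (M e) (x e)) (ifq (P e) 1ℚ) (ifq (M e) 1ℚ))) ⟩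
    sumℚ (λ e → (dx e + dx e) - (ifq (P e) 1ℚ - ifq (M e) 1ℚ))
      ≡⟨ sumℚ-- (λ e → dx e + dx e) (λ e → ifq (P e) 1ℚ - ifq (M e) 1ℚ) ⟩
    sumℚ (λ e → dx e + dx e) - sumℚ (λ e → ifq (P e) 1ℚ - ifq (M e) 1ℚ)
      ≡⟨ cong₂ _-_ (sumℚ-+ dx dx) (trans (sumℚ-- (λ e → ifq (P e) 1ℚ) (λ e → ifq (M e) 1ℚ))
                                          (cong₂ _-_ (sumℚ-ind P) (sumℚ-ind M))) ⟩
    (net x j + net x j) - (ℕℚ (p j) - ℕℚ (q j)) ∎
    where
    open ≡-Reasoning
    P = λ e → plusToken e j
    M = λ e → minusToken e j
    dx = λ e → ifq (P e) (x e) - ifq (M e) (x e)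
    ifq-z : ∀ b q → ifq b ((q + q) - 1ℚ) ≡ (ifq b q + ifq b q) - ifq b 1ℚ
    ifq-z true  q = refl
    ifq-z false q = solve 0 (con 0ℚ := (con 0ℚ :+ con 0ℚ) :- con 0ℚ) refl

  has-token : ∀ j → 1 ℕ.≤ p j ℕ.+ q j → ∃ λ e → T (plusToken e j) ⊎ T (minusToken e j)
  has-token j le with 1 ℕ.≤? p j
  ... | yes p≥1 = proj₁ (count-pos (λ e → plusToken e j) p≥1) , inj₁ (proj₂ (count-pos (λ e → plusToken e j) p≥1))
  ... | no p≱1  = proj₁ found , inj₂ (proj₂ found)
    where p≡0 = ℕP.n≤0⇒n≡0 (ℕP.≤-pred (ℕP.≰⇒> p≱1))
          found = count-pos (λ e → minusToken e j) (subst (1 ℕ.≤_) (cong (ℕ._+ q j) p≡0) le)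

  ∣net-z∣< : ∀ j → 1 ℕ.≤ p j ℕ.+ q j → ∣ net z j ∣ < ℕℚ (p j ℕ.+ q j)
  ∣net-z∣< j le = via (has-token j le)
    where
    P = λ e → plusToken e j
    M = λ e → minusToken e j
    on-F : ∀ e → T (P e) ⊎ T (M e) → ∣ z e ∣ < 1ℚ
    on-F e (inj₁ t) = ∣z∣<1 e (T∧₁ t)
    on-F e (inj₂ t) = ∣z∣<1 e (T∧₁ t)
    via : (∃ λ e → T (P e) ⊎ T (M e)) → ∣ net z j ∣ < ℕℚ (p j ℕ.+ q j)
    via (e₀ , t) = ≤-<-trans (sumℚ-abs (λ e → ifq (P e) (z e) - ifq (M e) (z e)))
      (<-≤-trans (sumℚ-strict (λ e → ∣ifq-ifq∣≤ (P e) (M e) (z e) (on-F e)) e₀ (∣ifq-ifq∣< (P e₀) (M e₀) (z e₀) (on-F e₀) t))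
        (≤-reflexive (trans (sumℚ-+ (λ e → ifq (P e) 1ℚ) (λ e → ifq (M e) 1ℚ))
          (trans (cong₂ _+_ (sumℚ-ind P) (sumℚ-ind M)) (sym (ℕℚ-+ (p j) (q j)))))))

  NetDeviation : Fin k → Set
  NetDeviation j = ∃ λ w →
    net z j ≡ toℚ (doubledDeviation w (p j) (q j)) ×
    (ℤ.- ℤ.+ (p j ℕ.+ q j) ℤ.< doubledDeviation w (p j) (q j) × doubledDeviation w (p j) (q j) ℤ.< ℤ.+ (p j ℕ.+ q j))

  net-z-deviation : ∀ j → 1 ℕ.≤ p j ℕ.+ q j → NetDeviation j
  net-z-deviation j le = via (net-int j)
    where
    via : IsInt (net x j) → NetDeviation j
    via (w , eq) = w , as-int , ∣toℚ∣<⇒bounds (doubledDeviation w (p j) (q j)) (p j ℕ.+ q j)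
                                   (<-respˡ-≡ (cong ∣_∣ as-int) (∣net-z∣< j le))
      where
      as-int : net z j ≡ toℚ (doubledDeviation w (p j) (q j))
      as-int = trans (net-z j) (trans (cong (λ t → (t + t) - (ℕℚ (p j) - ℕℚ (q j))) eq)
                 (sym (trans (toℚ-- (w ℤ.+ w) (ℤ.+ p j ℤ.- ℤ.+ q j)) (cong₂ _-_ (toℚ-+ w w) (toℚ-- (ℤ.+ p j) (ℤ.+ q j))))))

  not-one-token : ∀ j → p j ℕ.+ q j ≡ 1 → ⊥
  not-one-token j e1 = odd (net-z-deviation j (subst (1 ℕ.≤_) (sym e1) ℕP.≤-refl))
    where odd : NetDeviation j → ⊥
          odd (w , _ , lo , hi) = deviation-odd w (p j) (q j) e1 lo hi

  no-plus : ∀ j → p j ℕ.+ q j ≡ 0 → ∀ e → ¬ T (plusToken e j)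
  no-plus j e0 e t = ℕP.<-irrefl refl (subst (1 ℕ.≤_) (ℕP.m+n≡0⇒m≡0 (p j) e0) (count-term (λ e → plusToken e j) e t))

  no-minus : ∀ j → p j ℕ.+ q j ≡ 0 → ∀ e → ¬ T (minusToken e j)
  no-minus j e0 e t = ℕP.<-irrefl refl (subst (1 ℕ.≤_) (ℕP.m+n≡0⇒n≡0 (p j) e0) (count-term (λ e → minusToken e j) e t))

  -- with no tokens, η_{F,L j} equals the vector of its child (or 0): impossible
  not-zero-tokens : ∀ j → p j ℕ.+ q j ≡ 0 → ⊥
  not-zero-tokens j e0 with childCase j
  ... | hasChild c tc = proj₂ (child-strict c j tc) (subst (λ i → Sub (L i) (L c)) (sym j≡c) Sub-refl)
    where
    j≡c : j ≡ c
    j≡c = η-injective j c (λ e fe → T-ext (to e fe) (from e fe))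
      where
      to : ∀ e → T (F e) → T (cr e (L j)) → T (cr e (L c))
      to e fe cj with T? (childCrossed j e)
      ... | yes t = subst T (childCrossed-child c j tc e) t
      ... | no nt = ⊥-elim (no-plus j e0 e (T∧ fe (T∧ cj (Tnot nt))))
      from : ∀ e → T (F e) → T (cr e (L c)) → T (cr e (L j))
      from e fe cc with T? (cr e (L j))
      ... | yes t = t
      ... | no nt = ⊥-elim (no-minus j e0 e (T∧ fe (T∧ (subst T (sym (childCrossed-child c j tc e)) cc) (Tnot nt))))
  ... | noChild nc = <-irrefl (sym no-flow) (proj₂ (proj₂ (tL j)))
    where
    no-flow : sumδ ends F x (L j) ≡ 0ℚ
    no-flow = trans (flow-split x j) (trans (cong₂ _+_ (childFlow-none j nc x) no-net) (+-identityˡ 0ℚ))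
      where no-net = sumℚ-zero (λ e → trans (cong₂ _-_ (ifq-F (x e) (no-plus j e0 e)) (ifq-F (x e) (no-minus j e0 e))) (+-inverseʳ 0ℚ))

  two-tokens : ∀ j → 2 ℕ.≤ p j ℕ.+ q j
  two-tokens j with p j ℕ.+ q j in eq
  ... | 0           = ⊥-elim (not-zero-tokens j eq)
  ... | 1           = ⊥-elim (not-one-token j eq)
  ... | suc (suc _) = ℕ.s≤s (ℕ.s≤s ℕ.z≤n)

  net-z-zero : ∀ j → p j ℕ.+ q j ≡ 2 → net z j ≡ 0ℚ
  net-z-zero j e2 = even (net-z-deviation j (subst (1 ℕ.≤_) (sym e2) (ℕ.s≤s ℕ.z≤n)))
    where even : NetDeviation j → net z j ≡ 0ℚ
          even (w , eq , lo , hi) = trans eq (cong toℚ (deviation-even w (p j) (q j) e2 lo hi))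

module Conclusion {n m k : ℕ} (S : Situation n m k) where

  open import Defs
  open Sums
  open BisetCalculus
  open Setting
  open import Data.Bool using (Bool; true; false; _∧_; _∨_; T)
  open import Data.Bool.Properties using (∨-comm)
  open import Data.Nat as ℕ using (ℕ; zero; suc)
  import Data.Nat.Properties as ℕP
  open import Data.Rational as ℚ using (ℚ; 0ℚ; 1ℚ; ½; _+_; _*_; _-_)
  open import Data.Rational.Properties using (+-identityˡ)
  open import Data.Rational.Solver
  open import Data.Fin using (Fin)
  open import Data.Product using (_,_; ∃; proj₁; proj₂)
  open import Data.Sum using (_⊎_; inj₁; inj₂)
  open import Data.Empty using (⊥; ⊥-elim)
  open import Relation.Binary.PropositionalEquality
  open import Relation.Nullary using (¬_; yes; no)
  open import Relation.Nullary.Decidable using (T?)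
  open +-*-Solver

  open Basics S
  open Rigidity S using (rigidity)
  open Rank S using (|F|≤k)
  open LaminarTree S
  open Tokens S
  open MemberTokens S

  -- Σ_j (p j + q j) = Σ_e tokens e ≤ 2 |F| ≤ 2k, while each term on the left
  -- is at least 2; hence all these inequalities are equalities.

  two|F|≤2k : sumℕ (λ e → ind (F e) ℕ.+ ind (F e)) ℕ.≤ k ℕ.* 2
  two|F|≤2k = ℕP.≤-trans (ℕP.≤-reflexive (sumℕ-+ (λ e → ind (F e)) (λ e → ind (F e))))
    (ℕP.≤-trans (ℕP.+-mono-≤ |F|≤k |F|≤k)
      (ℕP.≤-reflexive (sym (trans (ℕP.*-comm k 2) (cong (k ℕ.+_) (ℕP.+-identityʳ k))))))

  part-i : ∀ j → p j ℕ.+ q j ≡ 2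
  part-i = sumℕ-squeeze {a = λ j → p j ℕ.+ q j} {b = λ _ → 2} two-tokens
    (ℕP.≤-trans (ℕP.≤-reflexive tokens-total) (ℕP.≤-trans (sumℕ-mono tokens≤2[F])
      (ℕP.≤-trans two|F|≤2k (ℕP.≤-reflexive (sym (sumℕ-const {k} 2))))))

  tokens≡2 : ∀ e → T (F e) → tokens e ≡ 2
  tokens≡2 e fe = trans (sym (every-edge-full e)) (cong (λ z → z ℕ.+ z) (ind-T {F e} fe))
    where
    every-edge-full : ∀ e → ind (F e) ℕ.+ ind (F e) ≡ tokens e
    every-edge-full = sumℕ-squeeze {a = λ e → ind (F e) ℕ.+ ind (F e)} {b = tokens} tokens≤2[F]
      (ℕP.≤-trans two|F|≤2k (ℕP.≤-trans (ℕP.≤-reflexive (sym (sumℕ-const {k} 2)))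
        (ℕP.≤-trans (sumℕ-mono two-tokens) (ℕP.≤-reflexive tokens-total))))

  -- Part (iii).  Since net z j = 0 for all j, induction down the chains gives
  -- z(δ_F(L j)) = 0 for all j; by rigidity z vanishes on F, i.e. x = 1/2 there.

  z-flow : ∀ j → sumδ ends F z (L j) ≡ 0ℚ
  z-flow j = go (suc (size (L j))) j ℕP.≤-refl
    where
    go : ∀ bound j → size (L j) ℕ.< bound → sumδ ends F z (L j) ≡ 0ℚ
    go zero    j ()
    go (suc b) j lt = trans (flow-split z j) (trans (cong₂ _+_ child (net-z-zero j (part-i j))) (+-identityˡ 0ℚ))
      where
      child : childFlow z j ≡ 0ℚ
      child with childCase j
      ... | hasChild c tc = trans (childFlow-child c j tc z) (go b c (ℕP.<-≤-trans (size-< c j (child-strict c j tc)) (ℕP.≤-pred lt)))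
      ... | noChild nc    = childFlow-none j nc z

  part-iii : ∀ e → T (F e) → x e ≡ ½
  part-iii e fe = begin
    x e           ≡⟨ solve 1 (λ a → a := con ½ :* ((a :+ a) :- con 1ℚ) :+ con ½) refl (x e) ⟩
    ½ * z e + ½   ≡⟨ cong (λ t → ½ * t + ½) z≡0 ⟩
    ½ * 0ℚ + ½    ≡⟨ solve 0 (con ½ :* con 0ℚ :+ con ½ := con ½) refl ⟩
    ½             ∎
    where
    open ≡-Reasoning
    zF : Fin m → ℚ
    zF e = ifq (F e) (z e)
    zF-flow : ∀ j → dotF zF (L j) ≡ 0ℚ
    zF-flow j = trans (sumℚ-cong (λ e → on-F (F e) (cr e (L j)) (z e))) (z-flow j)
      where on-F : ∀ f c q → ifq (f ∧ c) (ifq f q) ≡ ifq (f ∧ c) q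
            on-F true  c q = refl
            on-F false c q = refl
    z≡0 : z e ≡ 0ℚ
    z≡0 = trans (sym (on-F (F e) fe)) (rigidity zF (λ e nf → ifq-F (z e) nf) zF-flow e)
      where on-F : ∀ b → T b → ifq b (z e) ≡ z e
            on-F true _ = refl

  -- Part (ii).  Let e ∈ F cross a maximal member L M from u to v.
  -- (u, v) is (proj₁ (ends e), proj₂ (ends e)) in one of the two orders.
  module TwoMaximal (e : Fin m) (fe : T (F e)) (u v : Fin n)
                    (cr-split : ∀ A → cr e A ≡ crossesFrom u v A ∨ crossesFrom v u A) where
    module U→V = Direction e u v cr-split
    module V→U = Direction e v u (λ A → trans (cr-split A) (∨-comm (crossesFrom u v A) (crossesFrom v u A)))

    TokenSplit : Set
    TokenSplit = tokens e ℕ.≤ (countᵇ U→V.plusDir ℕ.+ countᵇ V→U.plusDir) ℕ.+ (countᵇ U→V.minusDir ℕ.+ countᵇ V→U.minusDir)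

    plus-below : ∀ j → U→V.Dir (L j) → ∃ λ a → T (U→V.plusDir a)
    plus-below j dj = go (suc (size (L j))) j ℕP.≤-refl dj
      where
      go : ∀ bound j → size (L j) ℕ.< bound → U→V.Dir (L j) → ∃ λ a → T (U→V.plusDir a)
      go zero    j () dj
      go (suc b) j lt dj with T? (childCrossed j e)
      ... | no nt = j , T∧ (U→V.Dir→T (L j) dj) (Tnot nt)
      ... | yes t = via (anyFin⇒∃ (λ i → isCh i j ∧ cr e (L i)) t)
        where
        via : (∃ λ c → T (isCh c j ∧ cr e (L c))) → ∃ λ a → T (U→V.plusDir a)
        via (c , tc) = direction (T∨ {crossesFrom u v (L c)} (subst T (cr-split (L c)) (T∧₂ {isCh c j} tc)))
          where
          c<j : Strict c j
          c<j = child-strict c j (T∧₁ tc)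
          direction : T (crossesFrom u v (L c)) ⊎ T (crossesFrom v u (L c)) → ∃ λ a → T (U→V.plusDir a)
          direction (inj₁ t) = go b c (ℕP.<-≤-trans (size-< c j c<j) (ℕP.≤-pred lt)) (U→V.T→Dir (L c) t)
          direction (inj₂ t) = ⊥-elim (proj₂ dj (I⇒O (bL j) (proj₁ (proj₁ c<j) v (mkI (T∧₁ t)))))

    no-minus-below-maximal : ∀ M → T (isMax M) → U→V.Dir (L M) → ∀ a → ¬ T (U→V.minusDir a)
    no-minus-below-maximal M tM dM a t = via (U→V.minusWitness a t)
      where
      via : U→V.MinusWitness a → ⊥
      via (c , tc , dc , oa , ia) = by-nesting (nested a M u ia (proj₁ dM))
        where by-nesting : Sub (L a) (L M) ⊎ Sub (L M) (L a) → ⊥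
              by-nesting (inj₁ s) = proj₂ dM (proj₂ s v oa)
              by-nesting (inj₂ s) = proj₂ dM (proj₂ (above-maximal M a tM s) v oa)

    -- at most one maximal member contains u, and at most one contains v
    maximal≤2 : countᵇ (λ i → isMax i ∧ cr e (L i)) ℕ.≤ 2
    maximal≤2 = ℕP.≤-trans (sumℕ-mono (λ i → ℕP.≤-trans (ℕP.≤-reflexive (cong (λ z → ind (isMax i ∧ z)) (cr-split (L i))))
                                         (and-or (isMax i) (crossesFrom u v (L i)) (crossesFrom v u (L i)))))
      (ℕP.≤-trans (ℕP.≤-reflexive (sumℕ-+ (λ i → ind (isMax i ∧ crossesFrom u v (L i))) (λ i → ind (isMax i ∧ crossesFrom v u (L i)))))
        (ℕP.+-mono-≤ (count-le1 _ (unique u)) (count-le1 _ (unique v))))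
      where
      and-or : ∀ a b c → ind (a ∧ (b ∨ c)) ℕ.≤ ind (a ∧ b) ℕ.+ ind (a ∧ c)
      and-or false b c = ℕ.z≤n
      and-or true  b c = ind-∨ b c
      unique : ∀ w {w'} i i' → T (isMax i ∧ crossesFrom w w' (L i)) → T (isMax i' ∧ crossesFrom w w' (L i')) → i ≡ i'
      unique w i i' t t' = maximal-unique i i' w (T∧₁ t) (T∧₁ t')
                             (mkI (T∧₁ (T∧₂ {isMax i} t))) (mkI (T∧₁ (T∧₂ {isMax i'} t')))

    -- Below a maximal L M crossed u → v there is a plus token u → v, and hence
    -- no minus token v → u; there is no minus token u → v either.  As e hands
    -- out two tokens and at most one plus token u → v, there is a plus token v → u.
    opposite-plus : TokenSplit → ∀ M → T (isMax M) → U→V.Dir (L M) → ∃ λ b → T (V→U.plusDir b)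
    opposite-plus split M tM dM = count-pos V→U.plusDir
      (ℕP.+-cancelˡ-≤ 1 1 (countᵇ V→U.plusDir) (ℕP.≤-trans two-plus (ℕP.+-monoˡ-≤ (countᵇ V→U.plusDir) plus-u→v≤1)))
      where
      a : Fin k
      a = proj₁ (plus-below M dM)
      no-minus-u→v : countᵇ U→V.minusDir ≡ 0
      no-minus-u→v = count-none U→V.minusDir (no-minus-below-maximal M tM dM)
      no-minus-v→u : countᵇ V→U.minusDir ≡ 0
      no-minus-v→u = count-none V→U.minusDir (λ b tb → V→U.minusDir⇒¬opposite b tb a (T∧₁ (proj₂ (plus-below M dM))))
      plus-u→v≤1 : countᵇ U→V.plusDir ℕ.≤ 1
      plus-u→v≤1 = count-le1 U→V.plusDir U→V.plusDir-unique
      two-plus : 2 ℕ.≤ countᵇ U→V.plusDir ℕ.+ countᵇ V→U.plusDir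
      two-plus = ℕP.≤-trans (ℕP.≤-reflexive (sym (tokens≡2 e fe)))
        (ℕP.≤-trans split (ℕP.≤-reflexive
          (trans (cong₂ (λ s t → (countᵇ U→V.plusDir ℕ.+ countᵇ V→U.plusDir) ℕ.+ (s ℕ.+ t)) no-minus-u→v no-minus-v→u)
                 (ℕP.+-identityʳ _))))

    -- The maximal member L M' above a member with a plus token v → u contains v
    -- but not u (by laminarity with L M), so it is crossed v → u and M' ≠ M.
    two-maximal : TokenSplit → ∀ M → T (isMax M) → T (crossesFrom u v (L M)) → countᵇ (λ i → isMax i ∧ cr e (L i)) ≡ 2
    two-maximal split M tM tcr = ℕP.≤-antisym maximal≤2 (count-ge2 _ M M' M≢M' (T∧ tM (U→V.Dir→cr (L M) dM)) (T∧ tM' crM'))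
      where
      dM : U→V.Dir (L M)
      dM = U→V.T→Dir (L M) tcr
      b : Fin k
      b = proj₁ (opposite-plus split M tM dM)
      M' : Fin k
      M' = proj₁ (maximal-above b)
      tM' : T (isMax M')
      tM' = proj₁ (proj₂ (maximal-above b))
      v∈M' : I (L M') v
      v∈M' = proj₁ (proj₂ (proj₂ (maximal-above b))) v (mkI (T∧₁ (T∧₁ {crossesFrom v u (L b)} (proj₂ (opposite-plus split M tM dM)))))
      u∉M'⁺ : ¬ O (L M') u
      u∉M'⁺ o = by-laminarity (NC→NCross {A = L M} {B = L M'} (lamL M M'))
        where
        inside-M : Sub (L M') (L M) → ⊥
        inside-M s = proj₂ dM (I⇒O (bL M) (proj₁ s v v∈M'))
        by-laminarity : NCross (L M) (L M') → ⊥
        by-laminarity (inj₁ (f , g))   = f u (proj₁ dM) o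
        by-laminarity (inj₂ (inj₁ s)) = inside-M (above-maximal M M' tM s)
        by-laminarity (inj₂ (inj₂ s)) = inside-M s
      crM' : T (cr e (L M'))
      crM' = V→U.Dir→cr (L M') (v∈M' , u∉M'⁺)
      M≢M' : ¬ M ≡ M'
      M≢M' eq = proj₂ dM (I⇒O (bL M) (subst (λ i → I (L i) v) (sym eq) v∈M'))

  part-ii : ∀ e → T (F e) → (∃ λ i → T (isMax i ∧ cr e (L i))) → countᵇ (λ i → isMax i ∧ cr e (L i)) ≡ 2
  part-ii e fe (M , t) = by-direction (T∨ {crossesFrom u v (L M)} (T∧₂ {isMax M} t))
    where
    u v : Fin n
    u = proj₁ (ends e)
    v = proj₂ (ends e)
    open TokenBound e using (tokens-by-direction; module U→V; module V→U)
    by-direction : T (crossesFrom u v (L M)) ⊎ T (crossesFrom v u (L M)) → countᵇ (λ i → isMax i ∧ cr e (L i)) ≡ 2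
    by-direction (inj₁ c) = TwoMaximal.two-maximal e fe u v (λ A → refl) tokens-by-direction M (T∧₁ t) c
    by-direction (inj₂ c) = TwoMaximal.two-maximal e fe v u (λ A → ∨-comm (crossesFrom u v A) (crossesFrom v u A))
      swapped M (T∧₁ t) c
      where
      swapped : tokens e ℕ.≤ (countᵇ V→U.plusDir ℕ.+ countᵇ U→V.plusDir) ℕ.+ (countᵇ V→U.minusDir ℕ.+ countᵇ U→V.minusDir)
      swapped = ℕP.≤-trans tokens-by-direction (ℕP.≤-reflexive (cong₂ ℕ._+_
                  (ℕP.+-comm (countᵇ U→V.plusDir) (countᵇ V→U.plusDir)) (ℕP.+-comm (countᵇ U→V.minusDir) (countᵇ V→U.minusDir))))

open import Defs
open import Data.Bool using (T; _∧_)
open import Data.Nat using (ℕ; _+_)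
open import Data.Integer using (ℤ; 0ℤ; _<_)
open import Data.Rational using (ℚ; ½)
open import Data.Fin using (Fin)
open import Data.Fin.Subset using (Subset)
open import Data.Product using (_×_; ∃; _,_)
open import Relation.Binary.PropositionalEquality using (_≡_)

lemma2 : ∀ {n m k : ℕ} (ends : Fin m → Fin n × Fin n) (Tm : Subset n)
    (h : Biset n → ℤ) → SkewSupermodular h →
    (∀ A → IsBiset A → 0ℤ < h A → InC Tm A) →
    (x̄ : Fin m → ℕ) (x : Fin m → ℚ) →
    ExtremePoint ends (λ A → toℚ (hShift ends h x̄ A)) (λ _ → 1) x →
    (L : Fin k → Biset n) → MaximalLaminarIndep ends h x̄ x L →
    ((∀ j → Fplus ends L (Fset ends x) j + Fminus ends L (Fset ends x) j ≡ 2) ×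
     (∀ e → T (Fset ends x e) →
        (∃ λ i → T (isMaximal ends L i ∧ crosses ends e (L i))) →
        countᵇ (λ i → isMaximal ends L i ∧ crosses ends e (L i)) ≡ 2) ×
     (∀ e → T (Fset ends x e) → x e ≡ ½))
lemma2 {n} {m} {k} ends Tm h skew h-in-C x̄ x extreme L basis = part-i , part-ii , part-iii
  where
  situation : Situation n m k
  situation = record { ends = ends ; Tm = Tm ; h = h ; skew = skew ; h-in-C = h-in-C
                     ; x̄ = x̄ ; x = x ; extreme = extreme ; L = L ; basis = basis }
  open Conclusion situation using (part-i; part-ii; part-iii)
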